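{- Let $T$ be a tree of type $H$ with parameters $(s,t;r;a,b)$. (i) $T$ is a path-like tree with a parallel path if and only if $a$ divides $s$ and $b$ divides $t$, where $a\le s-a$ and $b\le t-b$. (ii) $T$ is a path-like tree with a crossed path if and only if $a+r$ divides $t-b$ and $b+r$ divides $s-a$, where $a+r\le t-b$ and $b+r\le s-a$.
   Context: A tree of type $H$ with parameters $(s,t;r;a,b)$, where $r\ge1$, $1<a<s$, $1<b<t$, is the tree with vertex set $\{u_1,\ldots,u_s,v_1,\ldots,v_t,w_1,\ldots,w_{r+1}\}$ in which $u_a=w_1$, $v_b=w_{r+1}$, and edge set $\{u_1u_2,\ldots,u_{s-1}u_s\}\cup\{v_1v_2,\ldots,v_{t-1}v_t\}\cup\{w_1w_2,\ldots,w_rw_{r+1}\}$. Its only vertices of degree $3$ are $u_a$ and $v_b$. A linear configuration of a tree $T$ consists of paths $P^1_{k_1},\ldots,P^n_{k_n}$, $P^i_{k_i}=v^i_1v^i_2\cdots v^i_{k_i}$, whose vertex sets partition $V(T)$, whose edges are edges of $T$, and such that every other edge of $T$ is of the form $v^l_iv^{l+1}_j$ ($1\le l\le n-1$) with $d_T(v^l_i,v^l_{k_l})=d_T(v^{l+1}_1,v^{l+1}_j)$ and $j>1$ ($d_T$ = distance in $T$). A tree is a path-like tree if and only if it admits a linear configuration (this may be taken as the definition of path-like tree here). $T$ (of type $H$) is a path-like tree with a parallel path if it admits a linear configuration in which both vertices of degree $3$ lie on the same path $P^l_{k_l}$, say they are $v^l_i$ and $v^l_{i'}$ with $i<i'$,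 where $v^l_i$ is adjacent to a vertex of $P^{l-1}_{k_{l-1}}$ and $v^l_{i'}$ is adjacent to a vertex of $P^{l+1}_{k_{l+1}}$. It is a path-like tree with a crossed path if it admits a linear configuration in which both vertices of degree $3$ lie on the same path $P^l_{k_l}$, say $v^l_i$ and $v^l_{i'}$ with $i<i'$, where $v^l_i$ is adjacent to a vertex of $P^{l+1}_{k_{l+1}}$ and $v^l_{i'}$ is adjacent to a vertex of $P^{l-1}_{k_{l-1}}$. -}

module Defs where

open import Data.Nat using (ℕ; zero; suc; _+_; _∸_; _≤_; _<_)
open import Data.Fin using (Fin; toℕ; fromℕ)
open import Data.Product using (Σ; ∃; _×_; _,_)
open import Data.Sum using (_⊎_)
open import Relation.Binary.PropositionalEquality using (_≡_)

module Graph {V : Set} (Adj : V → V → Set) where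

  data Walk : V → V → ℕ → Set where
    here : ∀ {x} → Walk x x 0
    step : ∀ {x y z n} → Adj x y → Walk y z n → Walk x z (suc n)

  Dist : V → V → ℕ → Set
  Dist x y n = Walk x y n × (∀ m → Walk x y m → n ≤ m)

  -- Paths are indexed by l : Fin n (0-based); path l has k_l = suc (len l)
  -- vertices P l 0, ..., P l (len l) (0-based, so the paper's v^l_i is
  -- P l (i-1)); the first vertex is P l zero, the last P l (fromℕ (len l)).
  record LinearConfiguration : Set where
    field
      n    : ℕ
      len  : Fin n → ℕ
      P    : (l : Fin n) → Fin (suc (len l)) → V

    last : (l : Fin n) → Fin (suc (len l))
    last l = fromℕ (len l)

    PathEdge : V → V → Set
    PathEdge x y = Σ (Fin n) λ l → Σ (Fin (suc (len l))) λ i → Σ (Fin (suc (len l))) λ j →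
      toℕ j ≡ suc (toℕ i) × ((P l i ≡ x × P l j ≡ y) ⊎ (P l i ≡ y × P l j ≡ x))

    CrossEdge : V → V → Set
    CrossEdge x y = Σ (Fin n) λ l → Σ (Fin n) λ l' → toℕ l' ≡ suc (toℕ l) ×
      Σ (Fin (suc (len l))) λ i → Σ (Fin (suc (len l'))) λ j →
      P l i ≡ x × P l' j ≡ y × 0 < toℕ j ×
      Σ ℕ λ d → Dist (P l i) (P l (last l)) d × Dist (P l' Fin.zero) (P l' j) d

    field
      cover    : ∀ x → Σ (Fin n) λ l → Σ (Fin (suc (len l))) λ i → P l i ≡ x
      disjoint : ∀ l l' (i : Fin (suc (len l))) (i' : Fin (suc (len l'))) →
                 P l i ≡ P l' i' → _≡_ {A = Σ (Fin n) λ m → Fin (suc (len m))} (l , i) (l' , i')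
      path-edges : ∀ l (i j : Fin (suc (len l))) → toℕ j ≡ suc (toℕ i) → Adj (P l i) (P l j)
      other-edges : ∀ x y → Adj x y → PathEdge x y ⊎ CrossEdge x y ⊎ CrossEdge y x

    AdjToPath : V → Fin n → Set
    AdjToPath x l = Σ (Fin (suc (len l))) λ j → Adj x (P l j)

-- Vertices: u i  (i : Fin s)       stands for u_{i+1},
--           v j  (j : Fin t)       stands for v_{j+1},
--           w k  (k : Fin (r ∸ 1)) stands for the internal vertex w_{k+2}
-- (w_1 = u_a and w_{r+1} = v_b are not duplicated).

data HVertex (s t r : ℕ) : Set where
  u : Fin s → HVertex s t r
  v : Fin t → HVertex s t r
  w : Fin (r ∸ 1) → HVertex s t r

data HEdge (s t r a b : ℕ) : HVertex s t r → HVertex s t r → Set where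
  uu : ∀ {i j} → toℕ j ≡ suc (toℕ i) → HEdge s t r a b (u i) (u j)
  vv : ∀ {i j} → toℕ j ≡ suc (toℕ i) → HEdge s t r a b (v i) (v j)
  ww : ∀ {i j} → toℕ j ≡ suc (toℕ i) → HEdge s t r a b (w i) (w j)
  -- edge w_1 w_2 = u_a w_2   (when r ≥ 2)
  uw : ∀ {i k} → suc (toℕ i) ≡ a → toℕ k ≡ 0 → HEdge s t r a b (u i) (w k)
  -- edge w_r w_{r+1} = w_r v_b   (when r ≥ 2)
  wv : ∀ {k j} → toℕ k + 2 ≡ r → suc (toℕ j) ≡ b → HEdge s t r a b (w k) (v j)
  -- edge w_1 w_2 = u_a v_b   (when r = 1)
  uv : ∀ {i j} → r ≡ 1 → suc (toℕ i) ≡ a → suc (toℕ j) ≡ b → HEdge s t r a b (u i) (v j)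

HAdj : (s t r a b : ℕ) → HVertex s t r → HVertex s t r → Set
HAdj s t r a b x y = HEdge s t r a b x y ⊎ HEdge s t r a b y x

IsUa : (s t r a : ℕ) → HVertex s t r → Set
IsUa s t r a x = Σ (Fin s) λ i → x ≡ u i × suc (toℕ i) ≡ a

IsVb : (s t r b : ℕ) → HVertex s t r → Set
IsVb s t r b x = Σ (Fin t) λ j → x ≡ v j × suc (toℕ j) ≡ b

module _ (s t r a b : ℕ) where
  open Graph (HAdj s t r a b)
  open LinearConfiguration

  Deg3Pair : HVertex s t r → HVertex s t r → Set
  Deg3Pair x y = (IsUa s t r a x × IsVb s t r b y) ⊎ (IsVb s t r b x × IsUa s t r a y)

  ParallelPath : Set
  ParallelPath = Σ LinearConfiguration λ C →
    Σ (Fin (n C)) λ l → Σ (Fin (suc (len C l))) λ i → Σ (Fin (suc (len C l))) λ i' →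
    toℕ i < toℕ i' × Deg3Pair (P C l i) (P C l i') ×
    (Σ (Fin (n C)) λ l⁻ → suc (toℕ l⁻) ≡ toℕ l × AdjToPath C (P C l i) l⁻) ×
    (Σ (Fin (n C)) λ l⁺ → toℕ l⁺ ≡ suc (toℕ l) × AdjToPath C (P C l i') l⁺)

  CrossedPath : Set
  CrossedPath = Σ LinearConfiguration λ C →
    Σ (Fin (n C)) λ l → Σ (Fin (suc (len C l))) λ i → Σ (Fin (suc (len C l))) λ i' →
    toℕ i < toℕ i' × Deg3Pair (P C l i) (P C l i') ×
    (Σ (Fin (n C)) λ l⁺ → toℕ l⁺ ≡ suc (toℕ l) × AdjToPath C (P C l i) l⁺) ×
    (Σ (Fin (n C)) λ l⁻ → suc (toℕ l⁻) ≡ toℕ l × AdjToPath C (P C l i') l⁻)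

{-# OPTIONS --safe #-}

-- If u_a and v_b lie on one path P^l of a linear configuration, then P^l consists of one pendant
-- path at u_a, the spine and one pendant path at v_b. The other pendant path at u_a starts on a
-- neighbouring path, and the distance condition on crossing edges cuts it into blocks of d + 1
-- vertices on consecutive paths, where d is the distance along P^l from u_a to the end of P^l that
-- the crossing edges measure: the near end in the parallel case (d = a − 1 up to relabelling), the
-- far end beyond the spine in the crossed case (d = r + b′ − 1). The same holds at v_b, which gives
-- the divisibilities. Conversely, if they hold, tiling the two free pendant paths by such blocks
-- around the path through the spine gives a linear configuration. All distances are computed from
-- 1-Lipschitz potentials that change along a walk by its full length.

module Submission where

open import Defs
open import Data.Nat
open import Data.Nat.Properties
open import Data.Nat.Divisibility using (_∣_; divides; ∣⇒≤; ∣m∸n∣n⇒∣m; ∣-refl; ∣m+n∣m⇒∣n)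
open import Data.Nat.DivMod using (_/_; _%_; m≡m%n+[m/n]*n; m%n<n)
open import Data.Fin as Fin using (Fin; toℕ; fromℕ; fromℕ<)
open import Data.Fin.Properties using (toℕ-injective; toℕ-fromℕ; toℕ-fromℕ<; toℕ<n; toℕ≤pred[n])
open import Data.Product
open import Data.Sum
open import Data.Empty
open import Data.Unit using (⊤; tt)
open import Function.Base using (_∘′_)
open import Function.Bundles using (_⇔_; mk⇔)
open import Relation.Nullary
open import Relation.Binary using (Symmetric; tri<; tri≈; tri>)
open import Relation.Binary.PropositionalEquality

-- Arithmetic

n≢2+n : ∀ {m} → m ≢ suc (suc m)
n≢2+n ()

off-by-one : ∀ {m n} → m ≤ suc n → n ≤ suc m → m ≢ n → n ≡ suc m ⊎ m ≡ suc n
off-by-one {m} {n} m≤1+n n≤1+m m≢n with <-cmp m n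
... | tri< m<n _ _ = inj₁ (≤-antisym n≤1+m m<n)
... | tri≈ _ m≡n _ = ⊥-elim (m≢n m≡n)
... | tri> _ _ n<m = inj₂ (≤-antisym m≤1+n n<m)

m∸n≤1+m∸1+n : ∀ m n → m ∸ n ≤ suc (m ∸ suc n)
m∸n≤1+m∸1+n zero    zero    = z≤n
m∸n≤1+m∸1+n zero    (suc n) = z≤n
m∸n≤1+m∸1+n (suc m) zero    = ≤-refl
m∸n≤1+m∸1+n (suc m) (suc n) = m∸n≤1+m∸1+n m n

∸-monoʳ-≤-suc : ∀ o {m n} → m ≤ suc n → o ∸ n ≤ suc (o ∸ m)
∸-monoʳ-≤-suc o {zero}  {n} _     = ≤-trans (m∸n≤m o n) (n≤1+n o)
∸-monoʳ-≤-suc o {suc m} (s≤s m≤n) = ≤-trans (∸-monoʳ-≤ o m≤n) (m∸n≤1+m∸1+n o m)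

1+[m∸1+n]≡m∸n : ∀ {m n} → n < m → suc (m ∸ suc n) ≡ m ∸ n
1+[m∸1+n]≡m∸n n<m = sym (+-∸-assoc 1 n<m)

0<m∸n⇒n<m : ∀ {m n} → 0 < m ∸ n → n < m
0<m∸n⇒n<m {m} {n} 0<m∸n = m∸n≢0⇒n<m (λ m∸n≡0 → <⇒≢ 0<m∸n (sym m∸n≡0))

division-unique : ∀ K q q′ e e′ → e < K → e′ < K → q * K + e ≡ q′ * K + e′ → q ≡ q′ × e ≡ e′
division-unique K zero    zero     e e′ _   _    eq = refl , eq
division-unique K zero    (suc q′) e e′ e<K _    eq =
  ⊥-elim (<⇒≱ e<K (≤-trans (m≤m+n K (q′ * K + e′)) (≤-reflexive (trans (sym (+-assoc K (q′ * K) e′)) (sym eq)))))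
division-unique K (suc q) zero     e e′ _   e′<K eq =
  ⊥-elim (<⇒≱ e′<K (≤-trans (m≤m+n K (q * K + e)) (≤-reflexive (trans (sym (+-assoc K (q * K) e)) eq))))
division-unique K (suc q) (suc q′) e e′ e<K e′<K eq
  with division-unique K q q′ e e′ e<K e′<K (+-cancelˡ-≡ K _ _ (trans (sym (+-assoc K (q * K) e)) (trans eq (+-assoc K (q′ * K) e′))))
... | q≡q′ , e≡e′ = cong suc q≡q′ , e≡e′

quotient-< : ∀ K q e m → q * K + suc e ≤ m * K → q < m
quotient-< K q e m le with q <? m
... | yes q<m = q<m
... | no q≮m = ⊥-elim (<⇒≱ (≤-trans (s≤s (≤-trans (*-monoˡ-≤ K (≮⇒≥ q≮m)) (m≤m+n (q * K) e))) (≤-reflexive (sym (+-suc (q * K) e)))) le)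

quotient-pos : ∀ {m k q} → 0 < m → m ≡ q * k → 0 < q
quotient-pos {q = zero}  0<m e = ⊥-elim (<⇒≢ 0<m (sym e))
quotient-pos {q = suc q} _   _ = z<s

∣⇒∣∸ : ∀ {d m} → d ≤ m → d ∣ m → d ∣ m ∸ d
∣⇒∣∸ {d} d≤m d∣m = ∣m+n∣m⇒∣n (subst (d ∣_) (sym (m+[n∸m]≡n d≤m)) d∣m) ∣-refl

side-divides : ∀ {c S} → 0 < c → c ≤ S → suc c ≤ S ∸ c → (suc c ∣ S ∸ c) ⊎ (suc (S ∸ c) ∣ c) → suc c ∣ suc S
side-divides _   c≤S _     (inj₁ d) = ∣m∸n∣n⇒∣m (suc _) (s≤s c≤S) d ∣-refl
side-divides 0<c _   c<S∸c (inj₂ d) = ⊥-elim (1+n≰n (≤-trans (n≤1+n _) (≤-trans (s≤s (∣⇒≤ {{>-nonZero 0<c}} d)) c<S∸c)))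

-- Indexing paths by ℕ: clamp k is junk for k > n.

clamp : ∀ {n} → ℕ → Fin (suc n)
clamp         zero    = Fin.zero
clamp {zero}  (suc k) = Fin.zero
clamp {suc n} (suc k) = Fin.suc (clamp k)

toℕ-clamp : ∀ {n} k → k ≤ n → toℕ (clamp {n} k) ≡ k
toℕ-clamp         zero    _         = refl
toℕ-clamp {suc n} (suc k) (s≤s k≤n) = cong suc (toℕ-clamp k k≤n)

clamp-toℕ : ∀ {n} (i : Fin (suc n)) → clamp {n} (toℕ i) ≡ i
clamp-toℕ         Fin.zero    = refl
clamp-toℕ {suc n} (Fin.suc i) = cong Fin.suc (clamp-toℕ i)

-- Walks and 1-Lipschitz potentials

module Walks {V : Set} (Adj : V → V → Set) (Adj-sym : Symmetric Adj) where
  open Graph Adj public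

  _++ʷ_ : ∀ {x y z m k} → Walk x y m → Walk y z k → Walk x z (m + k)
  here     ++ʷ q = q
  step e p ++ʷ q = step e (p ++ʷ q)

  reverseʷ : ∀ {x y m} → Walk x y m → Walk y x m
  reverseʷ here                   = here
  reverseʷ {m = suc m} (step e p) = subst (Walk _ _) (+-comm m 1) (reverseʷ p ++ʷ step (Adj-sym e) here)

  Lipschitz : (V → ℕ) → Set
  Lipschitz h = ∀ {x y} → Adj x y → h x ≤ suc (h y)

  ∸-lipschitz : ∀ {h} → Lipschitz h → (R : ℕ) → Lipschitz (λ x → R ∸ h x)
  ∸-lipschitz h-lip R e = ∸-monoʳ-≤-suc R (h-lip (Adj-sym e))

  lipschitz-walk : ∀ {h} → Lipschitz h → ∀ {x y m} → Walk x y m → h y ≤ h x + m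
  lipschitz-walk h-lip here = m≤m+n _ 0
  lipschitz-walk {h} h-lip {x} (step {n = m} e p) =
    ≤-trans (lipschitz-walk h-lip p) (≤-trans (+-monoˡ-≤ m (h-lip (Adj-sym e))) (≤-reflexive (sym (+-suc (h x) m))))

  Dist⇒≤ : ∀ {x y d m} → Dist x y d → Walk x y m → d ≤ m
  Dist⇒≤ D p = proj₂ D _ p

  Dist-unique : ∀ {x y d d′} → Dist x y d → Dist x y d′ → d ≡ d′
  Dist-unique D D′ = ≤-antisym (Dist⇒≤ D (proj₁ D′)) (Dist⇒≤ D′ (proj₁ D))

  Dist-0⇒≡ : ∀ {x y} → Dist x y 0 → x ≡ y
  Dist-0⇒≡ (here , _) = refl

  Dist-self : ∀ {x d} → Dist x x d → d ≡ 0
  Dist-self D = n≤0⇒n≡0 (Dist⇒≤ D here)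

  Tight : (V → ℕ) → V → V → ℕ → Set
  Tight h x y m = h y ≡ h x + m ⊎ h x ≡ h y + m

  tight-walk⇒Dist : ∀ {h} → Lipschitz h → ∀ {x y m} → Walk x y m → Tight h x y m → Dist x y m
  tight-walk⇒Dist {h} h-lip {x} {y} {m} p (inj₁ e) =
    p , λ m′ p′ → +-cancelˡ-≤ (h x) m m′ (subst (_≤ h x + m′) e (lipschitz-walk h-lip p′))
  tight-walk⇒Dist {h} h-lip {x} {y} {m} p (inj₂ e) =
    p , λ m′ p′ → +-cancelˡ-≤ (h y) m m′ (subst (_≤ h y + m′) e (lipschitz-walk h-lip (reverseʷ p′)))

  Dist-tight : ∀ {h} → Lipschitz h → ∀ {x y m d} → Walk x y m → Tight h x y m → Dist x y d → d ≡ m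
  Dist-tight h-lip p t D = Dist-unique D (tight-walk⇒Dist h-lip p t)

  -- A path hanging off z: depth is the distance to z along it (0 off the path), node its inverse.
  record PendantPath (z : V) : Set where
    field
      N               : ℕ
      depth           : V → ℕ
      node            : ℕ → V
      depth-root      : depth z ≡ 0
      node-root       : node 0 ≡ z
      depth-node      : ∀ k → k ≤ N → depth (node k) ≡ k
      node-depth      : ∀ x → 0 < depth x → node (depth x) ≡ x
      depth≤N         : ∀ x → depth x ≤ N
      depth-lipschitz : Lipschitz depth
      depth-flat      : ∀ {x y} → Adj x y → depth x ≡ depth y → depth x ≡ 0
      attached-at-z   : ∀ {x y} → Adj x y → depth x ≡ 1 → depth y ≡ 0 → y ≡ z
      node-adjacent   : ∀ k → k < N → Adj (node k) (node (suc k))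

  module PendantPathProperties {z : V} (B : PendantPath z) where
    open PendantPath B

    depth-injective : ∀ {x y} → 0 < depth x → depth x ≡ depth y → x ≡ y
    depth-injective {x} {y} 0<dx dx≡dy =
      trans (sym (node-depth x 0<dx)) (trans (cong node dx≡dy) (node-depth y (subst (0 <_) dx≡dy 0<dx)))

    node-of-depth : ∀ {x k} → 0 < k → depth x ≡ k → x ≡ node k
    node-of-depth 0<k dx = trans (sym (node-depth _ (subst (0 <_) (sym dx) 0<k))) (cong node dx)

    step-down : ∀ {x y c} → Adj x y → depth x ≡ suc c → depth y ≤ c → y ≡ node c
    step-down {c = zero}  e dx dy = trans (attached-at-z e dx (n≤0⇒n≡0 dy)) (sym node-root)
    step-down {x} {y} {suc c} e dx dy = trans (sym (node-depth y (subst (0 <_) (sym dy≡) z<s))) (cong node dy≡)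
      where
        dy≡ : depth y ≡ suc c
        dy≡ = ≤-antisym dy (s≤s⁻¹ (subst (_≤ suc (depth y)) dx (depth-lipschitz e)))

    depth-step : ∀ {x y} → Adj x y → 0 < depth x → depth y ≡ suc (depth x) ⊎ depth x ≡ suc (depth y)
    depth-step e 0<dx =
      off-by-one (depth-lipschitz e) (depth-lipschitz (Adj-sym e)) (λ dx≡dy → <⇒≢ 0<dx (sym (depth-flat e dx≡dy)))

    extend⁺ : (V → ℕ) → ℕ → V → ℕ
    extend⁺ g R x with depth x
    ... | zero  = g x
    ... | suc k = R + suc k

    extend⁻ : (V → ℕ) → ℕ → V → ℕ
    extend⁻ g R x with depth x
    ... | zero  = g x
    ... | suc k = R ∸ suc k

    extend⁺-outside : ∀ g R x → depth x ≡ 0 → extend⁺ g R x ≡ g x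
    extend⁺-outside g R x e rewrite e = refl

    extend⁺-inside : ∀ g R x → 0 < depth x → extend⁺ g R x ≡ R + depth x
    extend⁺-inside g R x 0<dx with depth x
    ... | suc k = refl

    extend⁻-outside : ∀ g R x → depth x ≡ 0 → extend⁻ g R x ≡ g x
    extend⁻-outside g R x e rewrite e = refl

    extend⁻-inside : ∀ g R x → 0 < depth x → extend⁻ g R x ≡ R ∸ depth x
    extend⁻-inside g R x 0<dx with depth x
    ... | suc k = refl

    private
      depth-1-0 : ∀ {x y k} → Adj x y → depth x ≡ suc k → depth y ≡ 0 → k ≡ 0 × y ≡ z
      depth-1-0 {k = k} e dx dy = k≡0 , attached-at-z e (trans dx (cong suc k≡0)) dy
        where
          k≡0 : k ≡ 0
          k≡0 = n≤0⇒n≡0 (s≤s⁻¹ (subst₂ (λ a b → a ≤ suc b) dx dy (depth-lipschitz e)))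

    extend⁺-lipschitz : ∀ g R → Lipschitz g → g z ≡ R → Lipschitz (extend⁺ g R)
    extend⁺-lipschitz g R g-lip gz {x} {y} e with depth x in dx | depth y in dy
    ... | zero  | zero   = g-lip e
    ... | suc k | suc k′ =
      ≤-trans (+-monoʳ-≤ R (subst₂ (λ a b → a ≤ suc b) dx dy (depth-lipschitz e))) (≤-reflexive (+-suc R (suc k′)))
    ... | suc k | zero with depth-1-0 e dx dy
    ...   | refl , refl = ≤-reflexive (trans (+-comm R 1) (cong suc (sym gz)))
    extend⁺-lipschitz g R g-lip gz {x} {y} e | zero | suc k′ with depth-1-0 (Adj-sym e) dy dx
    ...   | refl , refl = ≤-trans (≤-reflexive gz) (≤-trans (m≤m+n R 1) (n≤1+n _))

    extend⁻-lipschitz : ∀ g R → Lipschitz g → g z ≡ R → Lipschitz (extend⁻ g R)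
    extend⁻-lipschitz g R g-lip gz {x} {y} e with depth x in dx | depth y in dy
    ... | zero  | zero   = g-lip e
    ... | suc k | suc k′ = ∸-monoʳ-≤-suc R (subst₂ (λ a b → a ≤ suc b) dy dx (depth-lipschitz (Adj-sym e)))
    ... | suc k | zero with depth-1-0 e dx dy
    ...   | refl , refl = ≤-trans (m∸n≤m R 1) (≤-trans (≤-reflexive (sym gz)) (n≤1+n _))
    extend⁻-lipschitz g R g-lip gz {x} {y} e | zero | suc k′ with depth-1-0 (Adj-sym e) dy dx
    ...   | refl , refl = ≤-trans (≤-reflexive gz) (m∸n≤1+m∸1+n R 0)

-- Linear configurations

module ConfigurationAccess {V : Set} (Adj : V → V → Set) (Adj-sym : Symmetric Adj)
                           (C : Graph.LinearConfiguration Adj) where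
  open Walks Adj Adj-sym
  open LinearConfiguration C

  at : Fin n → ℕ → V
  at l k = P l (clamp k)

  at-last : ∀ l → at l (len l) ≡ P l (last l)
  at-last l = cong (P l) (toℕ-injective (trans (toℕ-clamp (len l) ≤-refl) (sym (toℕ-fromℕ (len l)))))

  at-toℕ : ∀ l i → at l (toℕ i) ≡ P l i
  at-toℕ l i = cong (P l) (clamp-toℕ i)

  at-cover : ∀ x → Σ (Fin n) λ l → Σ ℕ λ k → k ≤ len l × at l k ≡ x
  at-cover x with cover x
  ... | l , i , e = l , toℕ i , toℕ≤pred[n] i , trans (at-toℕ l i) e

  at-injective : ∀ {l l′ k k′} → k ≤ len l → k′ ≤ len l′ → at l k ≡ at l′ k′ → l ≡ l′ × k ≡ k′
  at-injective {l} {l′} {k} {k′} k≤ k′≤ e =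
    cong proj₁ D , trans (sym (toℕ-clamp k k≤)) (trans (cong (λ q → toℕ (proj₂ q)) D) (toℕ-clamp k′ k′≤))
    where D = disjoint l l′ (clamp k) (clamp k′) e

  at-injective-path : ∀ {l l′ k k′} → k ≤ len l → k′ ≤ len l′ → at l k ≡ at l′ k′ → toℕ l ≡ toℕ l′
  at-injective-path k≤ k′≤ e = cong toℕ (proj₁ (at-injective k≤ k′≤ e))

  at-injective-index : ∀ {l k k′} → k ≤ len l → k′ ≤ len l → at l k ≡ at l k′ → k ≡ k′
  at-injective-index k≤ k′≤ e = proj₂ (at-injective k≤ k′≤ e)

  at-adjacent : ∀ l k → k < len l → Adj (at l k) (at l (suc k))
  at-adjacent l k k< = path-edges l (clamp k) (clamp (suc k))
    (trans (toℕ-clamp (suc k) k<) (cong suc (sym (toℕ-clamp k (<⇒≤ k<)))))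

  along : ∀ l k e → k + e ≤ len l → Walk (at l k) (at l (k + e)) e
  along l k zero    _ = subst (λ j → Walk (at l k) (at l j) 0) (sym (+-identityʳ k)) here
  along l k (suc e) k+e< =
    step (at-adjacent l k (≤-trans (s≤s (m≤m+n k e)) k+e<′))
         (subst (λ j → Walk (at l (suc k)) (at l j) e) (sym (+-suc k e)) (along l (suc k) e k+e<′))
    where k+e<′ = subst (_≤ len l) (+-suc k e) k+e<

  Cross : Fin n → ℕ → Fin n → ℕ → Set
  Cross l k l′ k′ = toℕ l′ ≡ suc (toℕ l) × 0 < k′ ×
    Σ ℕ λ d → Dist (at l k) (at l (len l)) d × Dist (at l′ 0) (at l′ k′) d

  EdgeKind : Fin n → ℕ → Fin n → ℕ → Set
  EdgeKind l k l′ k′ = (l ≡ l′ × (k′ ≡ suc k ⊎ k ≡ suc k′)) ⊎ Cross l k l′ k′ ⊎ Cross l′ k′ l k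

  private
    locate : ∀ {x l k} (m : Fin n) (i : Fin (suc (len m))) → P m i ≡ x → k ≤ len l → at l k ≡ x → m ≡ l × toℕ i ≡ k
    locate m i e k≤ e′ = at-injective (toℕ≤pred[n] i) k≤ (trans (at-toℕ m i) (trans e (sym e′)))

    cross : ∀ {x y l k l′ k′} → k ≤ len l → at l k ≡ x → k′ ≤ len l′ → at l′ k′ ≡ y → CrossEdge x y → Cross l k l′ k′
    cross k≤ ex k′≤ ey (m , m′ , mm′ , i , j , ei , ej , 0<j , d , D , D′) with locate m i ei k≤ ex | locate m′ j ej k′≤ ey
    ... | refl , refl | refl , refl =
      mm′ , 0<j , d ,
      subst (λ a → Dist (at m (toℕ i)) a d) (sym (at-last m)) (subst (λ a → Dist a (P m (last m)) d) (sym (at-toℕ m i)) D) ,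
      subst (λ a → Dist (P m′ Fin.zero) a d) (sym (at-toℕ m′ j)) D′

  classify-edge : ∀ {x y l k l′ k′} → Adj x y → k ≤ len l → at l k ≡ x → k′ ≤ len l′ → at l′ k′ ≡ y → EdgeKind l k l′ k′
  classify-edge {x} {y} e k≤ ex k′≤ ey with other-edges x y e
  ... | inj₁ (m , i , j , ji , inj₁ (ei , ej)) with locate m i ei k≤ ex | locate m j ej k′≤ ey
  ...   | refl , refl | refl , refl = inj₁ (refl , inj₁ ji)
  classify-edge e k≤ ex k′≤ ey | inj₁ (m , i , j , ji , inj₂ (ei , ej)) with locate m i ei k′≤ ey | locate m j ej k≤ ex
  ...   | refl , refl | refl , refl = inj₁ (refl , inj₂ ji)
  classify-edge e k≤ ex k′≤ ey | inj₂ (inj₁ c) = inj₂ (inj₁ (cross k≤ ex k′≤ ey c))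
  classify-edge e k≤ ex k′≤ ey | inj₂ (inj₂ c) = inj₂ (inj₂ (cross k′≤ ey k≤ ex c))

module PendantInConfiguration {V : Set} (Adj : V → V → Set) (Adj-sym : Symmetric Adj)
                              (C : Graph.LinearConfiguration Adj) {z : V} (B : Walks.PendantPath Adj Adj-sym z) where
  open Walks Adj Adj-sym
  open LinearConfiguration C
  open ConfigurationAccess Adj Adj-sym C
  open PendantPath B
  open PendantPathProperties B

  HasOutside : Fin n → Set
  HasOutside l = Σ ℕ λ k → k ≤ len l × depth (at l k) ≡ 0

  crossing-down : ∀ l c k e → k + e ≤ len l → c < depth (at l k) → depth (at l (k + e)) ≤ c →
                  Σ ℕ λ m → k ≤ m × m < k + e × at l (suc m) ≡ node c
  crossing-down l c k zero    _    c<dk dk≤c = ⊥-elim (<⇒≱ c<dk (subst (λ j → depth (at l j) ≤ c) (+-identityʳ k) dk≤c))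
  crossing-down l c k (suc e) k+e≤ c<dk dk≤c with depth (at l (suc k)) ≤? c
  ... | yes d≤c = k , ≤-refl , subst (suc k ≤_) (sym (+-suc k e)) (s≤s (m≤m+n k e)) ,
                  step-down edge (≤-antisym (≤-trans (depth-lipschitz edge) (s≤s d≤c)) c<dk) d≤c
    where edge = at-adjacent l k (≤-trans (s≤s (m≤m+n k e)) (subst (_≤ len l) (+-suc k e) k+e≤))
  ... | no d≰c with crossing-down l c (suc k) e (subst (_≤ len l) (+-suc k e) k+e≤) (≰⇒> d≰c)
                                  (subst (λ j → depth (at l j) ≤ c) (+-suc k e) dk≤c)
  ...   | m , k<m , m< , e′ = m , ≤-trans (n≤1+n k) k<m , subst (m <_) (sym (+-suc k e)) m< , e′

  crossing-up : ∀ l c k e → k + e ≤ len l → depth (at l k) ≤ c → c < depth (at l (k + e)) →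
                Σ ℕ λ m → k ≤ m × m < k + e × at l m ≡ node c
  crossing-up l c k zero    _    dk≤c c<dk = ⊥-elim (<⇒≱ c<dk (subst (λ j → depth (at l j) ≤ c) (sym (+-identityʳ k)) dk≤c))
  crossing-up l c k (suc e) k+e≤ dk≤c c<dk with depth (at l (suc k)) ≤? c
  ... | no d≰c = k , ≤-refl , subst (suc k ≤_) (sym (+-suc k e)) (s≤s (m≤m+n k e)) ,
                 step-down (Adj-sym edge) (≤-antisym (≤-trans (depth-lipschitz (Adj-sym edge)) (s≤s dk≤c)) (≰⇒> d≰c)) dk≤c
    where edge = at-adjacent l k (≤-trans (s≤s (m≤m+n k e)) (subst (_≤ len l) (+-suc k e) k+e≤))
  ... | yes d≤c with crossing-up l c (suc k) e (subst (_≤ len l) (+-suc k e) k+e≤) d≤c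
                                 (subst (λ j → c < depth (at l j)) (+-suc k e) c<dk)
  ...   | m , k<m , m< , e′ = m , ≤-trans (n≤1+n k) k<m , subst (m <_) (sym (+-suc k e)) m< , e′

  node-on-path : ∀ l c k k′ → k ≤ len l → k′ ≤ len l → c < depth (at l k) → depth (at l k′) ≤ c →
                 Σ ℕ λ m → m ≤ len l × at l m ≡ node c
  node-on-path l c k k′ k≤ k′≤ c<dk dk′≤c with ≤-total k k′
  ... | inj₁ k≤k′ with crossing-down l c k (k′ ∸ k) (subst (_≤ len l) (sym (m+[n∸m]≡n k≤k′)) k′≤) c<dk
                         (subst (λ j → depth (at l j) ≤ c) (sym (m+[n∸m]≡n k≤k′)) dk′≤c)
  ...   | m , _ , m< , e = suc m , ≤-trans (subst (suc m ≤_) (m+[n∸m]≡n k≤k′) m<) k′≤ , e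
  node-on-path l c k k′ k≤ k′≤ c<dk dk′≤c | inj₂ k′≤k
    with crossing-up l c k′ (k ∸ k′) (subst (_≤ len l) (sym (m+[n∸m]≡n k′≤k)) k≤) dk′≤c
                         (subst (λ j → c < depth (at l j)) (sym (m+[n∸m]≡n k′≤k)) c<dk)
  ...   | m , _ , m< , e = m , ≤-trans (<⇒≤ (subst (m <_) (m+[n∸m]≡n k′≤k) m<)) k≤ , e

  -- A path meeting both sides of level c contains node c, so it is the path through node c.
  level-path-unique : ∀ {c l i l′ k k′} → i ≤ len l → at l i ≡ node c → k ≤ len l′ → k′ ≤ len l′ →
                      c < depth (at l′ k) → depth (at l′ k′) ≤ c → toℕ l ≡ toℕ l′
  level-path-unique {c} {l} {i} {l′} {k} {k′} i≤ e k≤ k′≤ c<dk dk′≤c with node-on-path l′ c k k′ k≤ k′≤ c<dk dk′≤c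
  ... | m , m≤ , e′ = at-injective-path i≤ m≤ (trans e (sym e′))

  step-up : ∀ {x y c} → Adj x y → depth x ≡ suc c → y ≢ node c → depth y ≡ suc (suc c)
  step-up e dx y≢ with depth-step e (subst (0 <_) (sym dx) z<s)
  ... | inj₁ up   = trans up (cong suc dx)
  ... | inj₂ down = ⊥-elim (y≢ (step-down e dx (≤-reflexive (suc-injective (trans (sym down) dx)))))

  outside-neighbour : ∀ {x y} → Adj x y → depth x ≡ 0 → x ≢ z → depth y ≡ 0
  outside-neighbour {x} {y} e dx x≢z with depth y in dy
  ... | zero        = refl
  ... | suc zero    = ⊥-elim (x≢z (attached-at-z (Adj-sym e) dy dx))
  ... | suc (suc k) = ⊥-elim (<⇒≱ (s≤s (s≤s (z≤n {k}))) (subst₂ (λ p q → p ≤ suc q) dy dx (depth-lipschitz (Adj-sym e))))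

  -- Inside a pendant path a vertex has at most one deeper neighbour.
  crossing-at-endpoint : ∀ {m j c m′ k′} → j ≤ len m → depth (at m j) ≡ suc c → k′ ≤ len m′ → Adj (at m j) (at m′ k′) →
                         depth (at m′ k′) ≤ c → toℕ m ≢ toℕ m′ → j ≡ 0 ⊎ j ≡ len m
  crossing-at-endpoint {j = zero} _ _ _ _ _ _ = inj₁ refl
  crossing-at-endpoint {m} {suc j} {c} {m′} {k′} j≤ dj k′≤ e dk′ m≢m′ with m≤n⇒m<n∨m≡n j≤
  ... | inj₂ j≡ = inj₂ j≡
  ... | inj₁ j< = ⊥-elim (n≢2+n (at-injective-index (≤-trans (n≤1+n j) j≤) j<
                    (depth-injective (subst (0 <_) (sym before) z<s) (trans before (sym after)))))
    where
      off-node : ∀ k → k ≤ len m → at m k ≢ node c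
      off-node k k≤ e′ = m≢m′ (at-injective-path k≤ k′≤ (trans e′ (sym (step-down e dj dk′))))
      before : depth (at m j) ≡ suc (suc c)
      before = step-up (Adj-sym (at-adjacent m j j≤)) dj (off-node j (≤-trans (n≤1+n j) j≤))
      after : depth (at m (suc (suc j))) ≡ suc (suc c)
      after = step-up (at-adjacent m (suc j) j<) dj (off-node (suc (suc j)) j<)

  depth-grows : (g : ℕ → V) (E c : ℕ) → (∀ e → e < E → Adj (g e) (g (suc e))) →
                (∀ e e′ → e ≤ E → e′ ≤ E → g e ≡ g e′ → e ≡ e′) →
                depth (g 0) ≡ suc c → (π : V) → Adj (g 0) π → depth π ≤ c → (1 ≤ E → g 1 ≢ π) →
                ∀ e → e ≤ E → depth (g e) ≡ suc c + e
  depth-grows g E c g-adj g-inj g0 π g0π dπ g1≢π = grows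
    where
      climb : ∀ e → depth (g e) ≡ suc c + e → depth (g (suc e)) ≡ suc (depth (g e)) → depth (g (suc e)) ≡ suc c + suc e
      climb e ge up = trans up (trans (cong suc ge) (sym (+-suc (suc c) e)))

      grows : ∀ e → e ≤ E → depth (g e) ≡ suc c + e
      grows zero    _ = trans g0 (cong suc (sym (+-identityʳ c)))
      grows (suc e) e<E with grows e (<⇒≤ e<E)
      ... | ge with depth-step (g-adj e e<E) (subst (0 <_) (sym ge) z<s)
      ...   | inj₁ up = climb e ge up
      grows (suc zero) 0<E | ge | inj₂ down =
        ⊥-elim (g1≢π 0<E (trans (step-down (g-adj 0 0<E) g0 (≤-reflexive (suc-injective (trans (sym down) g0))))
                               (sym (step-down g0π g0 dπ))))
      grows (suc (suc e)) e<E | ge | inj₂ down =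
        ⊥-elim (n≢2+n (g-inj e (suc (suc e)) (≤-trans (n≤1+n e) (<⇒≤ e<E)) e<E
                  (depth-injective (subst (0 <_) (sym ge′) z<s) (trans ge′ (sym ge″)))))
        where
          ge′ = grows e (≤-trans (n≤1+n e) (<⇒≤ e<E))
          ge″ : depth (g (suc (suc e))) ≡ suc c + e
          ge″ = suc-injective (trans (sym down) (trans ge (+-suc (suc c) e)))

  Climbs⁻ : Fin n → ℕ → Set
  Climbs⁻ m L = ∀ e → e ≤ len m → depth (at m e) ≡ L + e

  Climbs⁺ : Fin n → ℕ → Set
  Climbs⁺ m L = ∀ e → e ≤ len m → depth (at m (len m ∸ e)) ≡ L + e

  climbing-path-geodesic : ∀ m → Tight depth (at m 0) (at m (len m)) (len m) → Dist (at m 0) (at m (len m)) (len m)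
  climbing-path-geodesic m = tight-walk⇒Dist depth-lipschitz (along m 0 (len m) ≤-refl)

  Climbs⁻-geodesic : ∀ {m L} → Climbs⁻ m L → Dist (at m 0) (at m (len m)) (len m)
  Climbs⁻-geodesic {m} {L} cl = climbing-path-geodesic m (inj₁ (trans (cl (len m) ≤-refl)
                                  (cong (_+ len m) (sym (trans (cl 0 z≤n) (+-identityʳ L))))))

  Climbs⁺-geodesic : ∀ {m L} → Climbs⁺ m L → Dist (at m 0) (at m (len m)) (len m)
  Climbs⁺-geodesic {m} {L} cl = climbing-path-geodesic m (inj₂ (trans top (cong (_+ len m) (sym bottom))))
    where
      top : depth (at m 0) ≡ L + len m
      top = subst (λ a → depth (at m a) ≡ L + len m) (n∸n≡0 (len m)) (cl (len m) ≤-refl)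
      bottom : depth (at m (len m)) ≡ L
      bottom = trans (cl 0 z≤n) (+-identityʳ L)

  private
    m+n≢1+m+1+n : ∀ m n → m + n ≢ suc (m + suc n)
    m+n≢1+m+1+n m n = <⇒≢ (s≤s (+-monoʳ-≤ m (n≤1+n n)))

    block-end : ∀ q d → suc (q * suc d) + d ≡ suc q * suc d
    block-end q d = cong suc (+-comm (q * suc d) d)

    q<block-start : ∀ q d → q < suc (q * suc d)
    q<block-start q d = s≤s (m≤m*n q (suc d))

  enters⁻ : ∀ d c → 0 < d → (m m′ : Fin n) → ∀ j k′ → toℕ m′ ≡ suc (toℕ m) → j ≤ len m → k′ ≤ len m′ →
            depth (at m j) ≡ suc c → at m′ k′ ≡ node c → Dist (at m′ 0) (at m′ k′) d → len m ≡ d × Climbs⁻ m (suc c)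
  enters⁻ d c 0<d m m′ j k′ m′≡ j≤ k′≤ dj ek′ D = len≡d , climbs
    where
      c<N : suc c ≤ N
      c<N = subst (_≤ N) dj (depth≤N (at m j))
      edge : Adj (at m j) (at m′ k′)
      edge = subst₂ Adj (sym (node-of-depth z<s dj)) (sym ek′) (Adj-sym (node-adjacent c c<N))
      dk′ : depth (at m′ k′) ≤ c
      dk′ = ≤-reflexive (trans (cong depth ek′) (depth-node c (<⇒≤ c<N)))
      m≢m′ : toℕ m ≢ toℕ m′
      m≢m′ e = 1+n≢n (trans (sym m′≡) (sym e))
      exit-dist : Σ ℕ λ d′ → Dist (at m j) (at m (len m)) d′ × d′ ≡ d
      exit-dist with classify-edge edge j≤ refl k′≤ refl
      ... | inj₁ (refl , _)                    = ⊥-elim (1+n≢n (sym m′≡))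
      ... | inj₂ (inj₂ (m≡ , _))               = ⊥-elim (n≢2+n (trans m≡ (cong suc m′≡)))
      ... | inj₂ (inj₁ (_ , _ , d′ , D₁ , D₂)) = d′ , D₁ , Dist-unique D₂ D
      j≡0 : j ≡ 0
      j≡0 with crossing-at-endpoint j≤ dj k′≤ edge dk′ m≢m′ | exit-dist
      ... | inj₁ j≡0   | _ = j≡0
      ... | inj₂ refl | d′ , D₁ , d′≡d = ⊥-elim (<⇒≢ 0<d (trans (sym (Dist-self D₁)) d′≡d))
      climbs : Climbs⁻ m (suc c)
      climbs = depth-grows (at m) (len m) c (at-adjacent m) (λ e e′ e≤ e′≤ → at-injective-index e≤ e′≤)
                 (subst (λ a → depth (at m a) ≡ suc c) j≡0 dj) (at m′ k′) (subst (λ a → Adj (at m a) (at m′ k′)) j≡0 edge) dk′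
                 (λ 1≤ e → m≢m′ (at-injective-path 1≤ k′≤ e))
      len≡d : len m ≡ d
      len≡d with exit-dist
      ... | d′ , D₁ , d′≡d = trans (Dist-unique (Climbs⁻-geodesic climbs) (subst (λ a → Dist (at m a) (at m (len m)) d′) j≡0 D₁)) d′≡d

  enters⁺ : ∀ d c → 0 < d → (m m′ : Fin n) → ∀ k j → toℕ m′ ≡ suc (toℕ m) → k ≤ len m → j ≤ len m′ →
            depth (at m′ j) ≡ suc c → at m k ≡ node c → Dist (at m k) (at m (len m)) d → len m′ ≡ d × Climbs⁺ m′ (suc c)
  enters⁺ d c 0<d m m′ k j m′≡ k≤ j≤ dj ek D = len≡d , climbs
    where
      c<N : suc c ≤ N
      c<N = subst (_≤ N) dj (depth≤N (at m′ j))
      edge : Adj (at m k) (at m′ j)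
      edge = subst₂ Adj (sym ek) (sym (node-of-depth z<s dj)) (node-adjacent c c<N)
      dk : depth (at m k) ≤ c
      dk = ≤-reflexive (trans (cong depth ek) (depth-node c (<⇒≤ c<N)))
      m′≢m : toℕ m′ ≢ toℕ m
      m′≢m e = 1+n≢n (trans (sym m′≡) e)
      entry-dist : Dist (at m′ 0) (at m′ j) d × 0 < j
      entry-dist with classify-edge edge k≤ refl j≤ refl
      ... | inj₁ (refl , _)                      = ⊥-elim (1+n≢n (sym m′≡))
      ... | inj₂ (inj₂ (m≡ , _))                 = ⊥-elim (n≢2+n (trans m≡ (cong suc m′≡)))
      ... | inj₂ (inj₁ (_ , 0<j , d′ , D₁ , D₂)) = subst (Dist (at m′ 0) (at m′ j)) (Dist-unique D₁ D) D₂ , 0<j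
      j≡len : j ≡ len m′
      j≡len with crossing-at-endpoint j≤ dj k≤ (Adj-sym edge) dk m′≢m
      ... | inj₁ j≡0   = ⊥-elim (<⇒≢ (proj₂ entry-dist) (sym j≡0))
      ... | inj₂ j≡len = j≡len
      climbs : Climbs⁺ m′ (suc c)
      climbs = depth-grows (λ e → at m′ (len m′ ∸ e)) (len m′) c
                 (λ e e< → Adj-sym (subst (λ a → Adj (at m′ (len m′ ∸ suc e)) (at m′ a)) (1+[m∸1+n]≡m∸n e<)
                             (at-adjacent m′ (len m′ ∸ suc e) (subst (_≤ len m′) (sym (1+[m∸1+n]≡m∸n e<)) (m∸n≤m (len m′) e)))))
                 (λ e e′ e≤ e′≤ eq → ∸-cancelˡ-≡ e≤ e′≤ (at-injective-index (m∸n≤m _ e) (m∸n≤m _ e′) eq))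
                 (subst (λ a → depth (at m′ a) ≡ suc c) j≡len dj) (at m k)
                 (subst (λ a → Adj (at m′ a) (at m k)) j≡len (Adj-sym edge)) dk
                 (λ _ e → m′≢m (at-injective-path (m∸n≤m _ 1) k≤ e))
      len≡d : len m′ ≡ d
      len≡d = Dist-unique (Climbs⁺-geodesic climbs) (subst (λ a → Dist (at m′ 0) (at m′ a) d) j≡len (proj₁ entry-dist))

  climbs⁻-top : ∀ {m L d} → 0 < L → len m ≡ d → Climbs⁻ m L → at m (len m) ≡ node (L + d)
  climbs⁻-top {m} {L} 0<L refl cl = node-of-depth (≤-trans 0<L (m≤m+n L (len m))) (cl (len m) ≤-refl)

  climbs⁺-top : ∀ {m L d} → 0 < L → len m ≡ d → Climbs⁺ m L → at m 0 ≡ node (L + d)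
  climbs⁺-top {m} {L} 0<L refl cl =
    node-of-depth (≤-trans 0<L (m≤m+n L (len m))) (subst (λ a → depth (at m a) ≡ L + len m) (n∸n≡0 (len m)) (cl (len m) ≤-refl))

  exits⁻ : ∀ {m L d} → 0 < L → len m ≡ d → Climbs⁻ m L → L + d < N →
           Σ (Fin n) λ m″ → Σ ℕ λ j″ → toℕ m ≡ suc (toℕ m″) × j″ ≤ len m″ × depth (at m″ j″) ≡ suc (L + d)
  exits⁻ {m} {L} {d} 0<L len≡d cl top<N with at-cover (node (suc (L + d)))
  ... | m″ , j″ , j″≤ , e″ with classify-edge (subst (Adj _) (sym e″) (subst (λ a → Adj a _) (sym (climbs⁻-top 0<L len≡d cl))
                                                  (node-adjacent (L + d) top<N))) ≤-refl refl j″≤ refl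
  ...   | inj₁ (refl , inj₁ j″≡) = ⊥-elim (<⇒≱ (subst (len m <_) (sym j″≡) ≤-refl) j″≤)
  ...   | inj₁ (refl , inj₂ len≡) =
          ⊥-elim (m+n≢1+m+1+n L j″ (trans (sym (cl j″ j″≤)) (trans (cong depth e″)
                   (trans (depth-node (suc (L + d)) top<N) (cong (λ a → suc (L + a)) (trans (sym len≡d) len≡))))))
  ...   | inj₂ (inj₁ (_ , 0<j″ , d″ , D₁ , D₂)) =
          ⊥-elim (<⇒≢ 0<j″ (at-injective-index z≤n j″≤ (Dist-0⇒≡ (subst (Dist (at m″ 0) (at m″ j″)) (Dist-self D₁) D₂))))
  ...   | inj₂ (inj₂ (m≡ , _)) = m″ , j″ , m≡ , j″≤ , trans (cong depth e″) (depth-node (suc (L + d)) top<N)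

  exits⁺ : ∀ {m L d} → 0 < L → 0 < d → len m ≡ d → Climbs⁺ m L → L + d < N →
           Σ (Fin n) λ m″ → Σ ℕ λ j″ → toℕ m″ ≡ suc (toℕ m) × j″ ≤ len m″ × depth (at m″ j″) ≡ suc (L + d)
  exits⁺ {m} {L} {suc p} 0<L (s≤s z≤n) len≡d cl top<N with at-cover (node (suc (L + suc p)))
  ... | m″ , j″ , j″≤ , e″ with classify-edge (subst (Adj _) (sym e″) (subst (λ a → Adj a _) (sym (climbs⁺-top 0<L len≡d cl))
                                                  (node-adjacent (L + suc p) top<N))) z≤n refl j″≤ refl
  ...   | inj₁ (refl , inj₂ ())
  ...   | inj₁ (refl , inj₁ refl) = ⊥-elim (m+n≢1+m+1+n L p (trans (sym from-climb) from-node))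
    where
      from-climb : depth (at m 1) ≡ L + p
      from-climb = subst (λ a → depth (at m a) ≡ L + p) (trans (cong (_∸ p) len≡d) (m+n∸n≡m 1 p))
                     (cl p (subst (p ≤_) (sym len≡d) (n≤1+n p)))
      from-node : depth (at m 1) ≡ suc (L + suc p)
      from-node = trans (cong depth e″) (depth-node (suc (L + suc p)) top<N)
  ...   | inj₂ (inj₂ (_ , () , _))
  ...   | inj₂ (inj₁ (m″≡ , _)) = m″ , j″ , m″≡ , j″≤ , trans (cong depth e″) (depth-node (suc (L + suc p)) top<N)

  -- The pendant path is cut into blocks of d+1 vertices on consecutive paths, hence d+1 divides N.
  blocks∣N⁻ : ∀ d → 0 < d → ∀ fuel q (m m′ : Fin n) j k′ → toℕ m′ ≡ suc (toℕ m) → j ≤ len m → k′ ≤ len m′ →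
              depth (at m j) ≡ suc (q * suc d) → at m′ k′ ≡ node (q * suc d) → Dist (at m′ 0) (at m′ k′) d →
              q + fuel ≡ N → suc d ∣ N
  blocks∣N⁻ d 0<d fuel q m m′ j k′ m′≡ j≤ k′≤ dj ek′ D q+fuel≡N with enters⁻ d (q * suc d) 0<d m m′ j k′ m′≡ j≤ k′≤ dj ek′ D
  ... | len≡d , cl with m≤n⇒m<n∨m≡n (subst (_≤ N) (trans (cl (len m) ≤-refl) (cong (suc (q * suc d) +_) len≡d)) (depth≤N _))
  ...   | inj₂ top≡N = divides (suc q) (trans (sym top≡N) (block-end q d))
  ...   | inj₁ top<N with exits⁻ z<s len≡d cl top<N
  ...     | m″ , j″ , m≡ , j″≤ , dj″ = next fuel q+fuel≡N
    where
      next : ∀ f → q + f ≡ N → suc d ∣ N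
      next zero    q≡N  = ⊥-elim (<⇒≱ (≤-trans (q<block-start q d) (≤-trans (m≤m+n _ d) (<⇒≤ top<N)))
                                      (≤-reflexive (trans (sym q≡N) (+-identityʳ q))))
      next (suc f) q+f≡ = blocks∣N⁻ d 0<d f (suc q) m″ m j″ (len m) m≡ j″≤ ≤-refl
                            (trans dj″ (cong suc (block-end q d))) (trans (climbs⁻-top z<s len≡d cl) (cong node (block-end q d)))
                            (subst (Dist (at m 0) (at m (len m))) len≡d (Climbs⁻-geodesic cl)) (trans (sym (+-suc q f)) q+f≡)

  blocks∣N⁺ : ∀ d → 0 < d → ∀ fuel q (m m′ : Fin n) k j → toℕ m′ ≡ suc (toℕ m) → k ≤ len m → j ≤ len m′ →
              depth (at m′ j) ≡ suc (q * suc d) → at m k ≡ node (q * suc d) → Dist (at m k) (at m (len m)) d →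
              q + fuel ≡ N → suc d ∣ N
  blocks∣N⁺ d 0<d fuel q m m′ k j m′≡ k≤ j≤ dj ek D q+fuel≡N with enters⁺ d (q * suc d) 0<d m m′ k j m′≡ k≤ j≤ dj ek D
  ... | len≡d , cl with m≤n⇒m<n∨m≡n (subst (_≤ N) (trans top-depth (cong (suc (q * suc d) +_) len≡d)) (depth≤N _))
    where
      top-depth : depth (at m′ 0) ≡ suc (q * suc d) + len m′
      top-depth = subst (λ a → depth (at m′ a) ≡ suc (q * suc d) + len m′) (n∸n≡0 (len m′)) (cl (len m′) ≤-refl)
  ...   | inj₂ top≡N = divides (suc q) (trans (sym top≡N) (block-end q d))
  ...   | inj₁ top<N with exits⁺ z<s 0<d len≡d cl top<N
  ...     | m″ , j″ , m″≡ , j″≤ , dj″ = next fuel q+fuel≡N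
    where
      next : ∀ f → q + f ≡ N → suc d ∣ N
      next zero    q≡N  = ⊥-elim (<⇒≱ (≤-trans (q<block-start q d) (≤-trans (m≤m+n _ d) (<⇒≤ top<N)))
                                      (≤-reflexive (trans (sym q≡N) (+-identityʳ q))))
      next (suc f) q+f≡ = blocks∣N⁺ d 0<d f (suc q) m′ m″ 0 j″ m″≡ z≤n j″≤
                            (trans dj″ (cong suc (block-end q d))) (trans (climbs⁺-top z<s len≡d cl) (cong node (block-end q d)))
                            (subst (Dist (at m′ 0) (at m′ (len m′))) len≡d (Climbs⁺-geodesic cl)) (trans (sym (+-suc q f)) q+f≡)

  starts-at-tip : ∀ l K → depth (at l 0) ≡ suc K → depth (at l 1) ≤ suc K →
                  (∀ l′ → toℕ l′ ≡ suc (toℕ l) → HasOutside l′) → suc K ≡ N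
  starts-at-tip l K d0 d1 next-leaves with m≤n⇒m<n∨m≡n (subst (_≤ N) d0 (depth≤N (at l 0)))
  ... | inj₂ K≡N = K≡N
  ... | inj₁ K<N with at-cover (node (suc (suc K)))
  ...   | l′ , k′ , k′≤ , e′ with classify-edge (subst (Adj (at l 0)) (sym e′)
                                   (subst (λ a → Adj a _) (sym (node-of-depth z<s d0)) (node-adjacent (suc K) K<N))) z≤n refl k′≤ refl
  ...     | inj₁ (refl , inj₂ ())
  ...     | inj₁ (refl , inj₁ refl) = ⊥-elim (<⇒≱ (subst (suc K <_) (sym (trans (cong depth e′) (depth-node (suc (suc K)) K<N))) ≤-refl) d1)
  ...     | inj₂ (inj₂ (_ , () , _))
  ...     | inj₂ (inj₁ (l′≡ , _)) with next-leaves l′ l′≡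
  ...       | k , k≤ , dk = ⊥-elim (1+n≢n (trans (sym l′≡) (sym (level-path-unique z≤n (node-of-depth z<s d0) k′≤ k≤
                               (subst (suc K <_) (sym (trans (cong depth e′) (depth-node (suc (suc K)) K<N))) ≤-refl)
                               (subst (_≤ suc K) (sym dk) z≤n)))))

  ends-at-tip : ∀ l K → depth (at l (len l)) ≡ suc K → depth (at l (len l ∸ 1)) ≤ suc K →
                (∀ l′ → toℕ l ≡ suc (toℕ l′) → HasOutside l′) → suc K ≡ N
  ends-at-tip l K dlast d1 prev-leaves with m≤n⇒m<n∨m≡n (subst (_≤ N) dlast (depth≤N (at l (len l))))
  ... | inj₂ K≡N = K≡N
  ... | inj₁ K<N with at-cover (node (suc (suc K)))
  ...   | l′ , k′ , k′≤ , e′ with classify-edge (subst (Adj (at l (len l))) (sym e′)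
                                   (subst (λ a → Adj a _) (sym (node-of-depth z<s dlast)) (node-adjacent (suc K) K<N))) ≤-refl refl k′≤ refl
  ...     | inj₁ (refl , inj₁ k′≡) = ⊥-elim (<⇒≱ (subst (len l <_) (sym k′≡) ≤-refl) k′≤)
  ...     | inj₁ (refl , inj₂ len≡) = ⊥-elim (<⇒≱ (subst (suc K <_) (sym d-prev) ≤-refl) d1)
    where
      d-prev : depth (at l (len l ∸ 1)) ≡ suc (suc K)
      d-prev = trans (cong (λ a → depth (at l (a ∸ 1))) len≡) (trans (cong depth e′) (depth-node (suc (suc K)) K<N))
  ...     | inj₂ (inj₁ (_ , 0<k′ , d , D₁ , D₂)) =
            ⊥-elim (<⇒≢ 0<k′ (at-injective-index z≤n k′≤ (Dist-0⇒≡ (subst (Dist (at l′ 0) (at l′ k′)) (Dist-self D₁) D₂))))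
  ...     | inj₂ (inj₂ (l≡ , _)) with prev-leaves l′ l≡
  ...       | k , k≤ , dk = ⊥-elim (1+n≢n (trans (sym l≡) (level-path-unique ≤-refl (node-of-depth z<s dlast) k′≤ k≤
                               (subst (suc K <_) (sym (trans (cong depth e′) (depth-node (suc (suc K)) K<N))) ≤-refl)
                               (subst (_≤ suc K) (sym dk) z≤n))))

  pendant-prefix : ∀ l i₀ → suc i₀ ≤ len l → at l (suc i₀) ≡ z → depth (at l i₀) ≡ 1 →
                   (∀ l′ → toℕ l′ ≡ suc (toℕ l) → HasOutside l′) → suc i₀ ≡ N × depth (at l 0) ≡ N
  pendant-prefix l i₀ i₀< z-at d1 next-leaves = i₀≡N , trans d0 i₀≡N
    where
      dz : depth (at l (suc i₀)) ≡ 0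
      dz = trans (cong depth z-at) depth-root
      climbs : ∀ e → e ≤ i₀ → depth (at l (i₀ ∸ e)) ≡ 1 + e
      climbs = depth-grows (λ e → at l (i₀ ∸ e)) i₀ 0
                 (λ e e< → Adj-sym (subst (λ a → Adj (at l (i₀ ∸ suc e)) (at l a)) (1+[m∸1+n]≡m∸n e<)
                             (at-adjacent l (i₀ ∸ suc e) (≤-trans (subst (_≤ i₀) (sym (1+[m∸1+n]≡m∸n e<)) (m∸n≤m i₀ e)) (<⇒≤ i₀<)))))
                 (λ e e′ e≤ e′≤ eq → ∸-cancelˡ-≡ e≤ e′≤
                    (at-injective-index (≤-trans (m∸n≤m i₀ e) (<⇒≤ i₀<)) (≤-trans (m∸n≤m i₀ e′) (<⇒≤ i₀<)) eq))
                 d1 (at l (suc i₀)) (at-adjacent l i₀ i₀<) (≤-reflexive dz)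
                 (λ _ eq → <⇒≢ (s≤s (m∸n≤m i₀ 1)) (at-injective-index (≤-trans (m∸n≤m i₀ 1) (<⇒≤ i₀<)) i₀< eq))
      d0 : depth (at l 0) ≡ suc i₀
      d0 = subst (λ a → depth (at l a) ≡ suc i₀) (n∸n≡0 i₀) (climbs i₀ ≤-refl)
      d1≤ : depth (at l 1) ≤ suc i₀
      d1≤ = ≤-trans (lipschitz-walk depth-lipschitz (reverseʷ (along l 1 i₀ i₀<))) (≤-trans (≤-reflexive (cong (_+ i₀) dz)) (n≤1+n i₀))
      i₀≡N : suc i₀ ≡ N
      i₀≡N = starts-at-tip l i₀ d0 d1≤ next-leaves

  pendant-suffix : ∀ l i → suc i ≤ len l → at l i ≡ z → depth (at l (suc i)) ≡ 1 →
                   (∀ l′ → toℕ l ≡ suc (toℕ l′) → HasOutside l′) → len l ≡ i + N × depth (at l (len l)) ≡ N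
  pendant-suffix l i i< z-at d1 prev-leaves = trans (sym 1+E+i≡len) (trans (+-comm (suc E) i) (cong (i +_) E≡N)) , trans dlast E≡N
    where
      dz : depth (at l i) ≡ 0
      dz = trans (cong depth z-at) depth-root
      E = len l ∸ suc i
      E+1+i≡len : E + suc i ≡ len l
      E+1+i≡len = m∸n+n≡m i<
      1+E+i≡len : suc (E + i) ≡ len l
      1+E+i≡len = trans (sym (+-suc E i)) E+1+i≡len
      bound : ∀ e → e ≤ E → suc (e + i) ≤ len l
      bound e e≤ = subst (_≤ len l) (+-suc e i) (subst (e + suc i ≤_) E+1+i≡len (+-monoˡ-≤ (suc i) e≤))
      climbs : ∀ e → e ≤ E → depth (at l (suc (e + i))) ≡ 1 + e
      climbs = depth-grows (λ e → at l (suc (e + i))) E 0 (λ e e< → at-adjacent l (suc (e + i)) (bound (suc e) e<))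
                 (λ e e′ e≤ e′≤ eq → +-cancelʳ-≡ i e e′ (suc-injective (at-injective-index (bound e e≤) (bound e′ e′≤) eq)))
                 d1 (at l i) (Adj-sym (at-adjacent l i i<)) (≤-reflexive dz)
                 (λ 1≤ eq → n≢2+n (sym (at-injective-index (bound 1 1≤) (<⇒≤ i<) eq)))
      dlast : depth (at l (len l)) ≡ suc E
      dlast = subst (λ a → depth (at l a) ≡ suc E) 1+E+i≡len (climbs E ≤-refl)
      len∸1≡i+E : len l ∸ 1 ≡ i + E
      len∸1≡i+E = trans (cong (_∸ 1) (sym 1+E+i≡len)) (+-comm E i)
      d-last≤ : depth (at l (len l ∸ 1)) ≤ suc E
      d-last≤ = subst (λ a → depth (at l a) ≤ suc E) (sym len∸1≡i+E)
                  (≤-trans (lipschitz-walk depth-lipschitz (along l i E (subst (_≤ len l) (+-comm E i) (<⇒≤ (subst (E + i <_) 1+E+i≡len ≤-refl)))))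
                           (≤-trans (≤-reflexive (cong (_+ E) dz)) (n≤1+n E)))
      E≡N : suc E ≡ N
      E≡N = ends-at-tip l E dlast d-last≤ prev-leaves

  LeavesOnBothSides : Fin n → Set
  LeavesOnBothSides l = (∀ l′ → toℕ l′ ≡ suc (toℕ l) → HasOutside l′) × (∀ l′ → toℕ l ≡ suc (toℕ l′) → HasOutside l′)

  z-path-unique : ∀ {l i l′ k′} → i ≤ len l → at l i ≡ z → k′ ≤ len l′ → 0 < depth (at l′ k′) → HasOutside l′ → toℕ l ≡ toℕ l′
  z-path-unique i≤ z-at k′≤ pos (k , k≤ , dk) = level-path-unique i≤ (trans z-at (sym node-root)) k′≤ k≤ pos (≤-reflexive dk)

  node1-before-z : ∀ l i → suc i ≤ len l → at l i ≡ z → depth (at l (suc i)) ≡ 0 → LeavesOnBothSides l → 0 < N →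
                   Σ ℕ λ i₀ → i ≡ suc i₀ × depth (at l i₀) ≡ 1
  node1-before-z l i i< z-at d-next (next-leaves , prev-leaves) 0<N with at-cover (node 1)
  ... | l′ , k′ , k′≤ , e′ with classify-edge (subst₂ Adj (sym z-at) (sym e′) (subst (λ a → Adj a (node 1)) node-root (node-adjacent 0 0<N)))
                                             (<⇒≤ i<) refl k′≤ refl
  ...   | inj₁ (refl , inj₁ refl) = ⊥-elim (0≢1+n (trans (sym d-next) (trans (cong depth e′) (depth-node 1 0<N))))
  ...   | inj₁ (refl , inj₂ refl) = k′ , refl , trans (cong depth e′) (depth-node 1 0<N)
  ...   | inj₂ (inj₁ (l′≡ , _)) = ⊥-elim (1+n≢n (trans (sym l′≡) (sym (z-path-unique (<⇒≤ i<) z-at k′≤ d′>0 (next-leaves l′ l′≡)))))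
    where d′>0 = subst (0 <_) (sym (trans (cong depth e′) (depth-node 1 0<N))) z<s
  ...   | inj₂ (inj₂ (l≡ , _)) = ⊥-elim (1+n≢n (trans (sym l≡) (z-path-unique (<⇒≤ i<) z-at k′≤ d′>0 (prev-leaves l′ l≡))))
    where d′>0 = subst (0 <_) (sym (trans (cong depth e′) (depth-node 1 0<N))) z<s

  node1-after-z : ∀ l i₁ → suc i₁ ≤ len l → at l (suc i₁) ≡ z → depth (at l i₁) ≡ 0 → LeavesOnBothSides l → 0 < N →
                  suc (suc i₁) ≤ len l × depth (at l (suc (suc i₁))) ≡ 1
  node1-after-z l i₁ i₁< z-at d-prev (next-leaves , prev-leaves) 0<N with at-cover (node 1)
  ... | l′ , k′ , k′≤ , e′ with classify-edge (subst₂ Adj (sym z-at) (sym e′) (subst (λ a → Adj a (node 1)) node-root (node-adjacent 0 0<N)))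
                                             i₁< refl k′≤ refl
  ...   | inj₁ (refl , inj₁ refl) = k′≤ , trans (cong depth e′) (depth-node 1 0<N)
  ...   | inj₁ (refl , inj₂ refl) = ⊥-elim (0≢1+n (trans (sym d-prev) (trans (cong depth e′) (depth-node 1 0<N))))
  ...   | inj₂ (inj₁ (l′≡ , _)) = ⊥-elim (1+n≢n (trans (sym l′≡) (sym (z-path-unique i₁< z-at k′≤ d′>0 (next-leaves l′ l′≡)))))
    where d′>0 = subst (0 <_) (sym (trans (cong depth e′) (depth-node 1 0<N))) z<s
  ...   | inj₂ (inj₂ (l≡ , _)) = ⊥-elim (1+n≢n (trans (sym l≡) (z-path-unique i₁< z-at k′≤ d′>0 (prev-leaves l′ l≡))))
    where d′>0 = subst (0 <_) (sym (trans (cong depth e′) (depth-node 1 0<N))) z<s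

  next-outside : ∀ l i i′ → i < i′ → i′ ≤ len l → at l i ≡ z → depth (at l i′) ≡ 0 → depth (at l (suc i)) ≡ 0
  next-outside l i i′ i<i′ i′≤ z-at d′ with depth (at l (suc i)) in d-next
  ... | zero  = refl
  ... | suc _ with crossing-down l 0 (suc i) (i′ ∸ suc i) (subst (_≤ len l) (sym (m+[n∸m]≡n i<i′)) i′≤) (subst (0 <_) (sym d-next) z<s)
                                 (subst (λ a → depth (at l a) ≤ 0) (sym (m+[n∸m]≡n i<i′)) (≤-reflexive d′))
  ...   | m , i<m , m< , e = ⊥-elim (<⇒≢ (≤-trans i<m (n≤1+n m))
                               (sym (at-injective-index (≤-trans (subst (m <_) (m+[n∸m]≡n i<i′) m<) i′≤) (≤-trans (<⇒≤ i<i′) i′≤)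
                                      (trans e (trans node-root (sym z-at))))))

  previous-outside : ∀ l i i₁ → i ≤ i₁ → suc i₁ ≤ len l → at l (suc i₁) ≡ z → depth (at l i) ≡ 0 → depth (at l i₁) ≡ 0
  previous-outside l i i₁ i≤i₁ i₁< z-at d′ with depth (at l i₁) in d-prev
  ... | zero  = refl
  ... | suc _ with crossing-up l 0 i (i₁ ∸ i) (subst (_≤ len l) (sym (m+[n∸m]≡n i≤i₁)) (<⇒≤ i₁<)) (≤-reflexive d′)
                               (subst (λ a → 0 < depth (at l a)) (sym (m+[n∸m]≡n i≤i₁)) (subst (0 <_) (sym d-prev) z<s))
  ...   | m , _ , m< , e = ⊥-elim (<⇒≢ (≤-trans m<i₁ (n≤1+n i₁)) (at-injective-index (≤-trans (<⇒≤ (≤-trans m<i₁ (n≤1+n i₁))) i₁<) i₁<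
                              (trans e (trans node-root (sym z-at)))))
    where
      m<i₁ : m < i₁
      m<i₁ = subst (m <_) (m+[n∸m]≡n i≤i₁) m<

  pendant-before : ∀ l i i′ → i < i′ → i′ ≤ len l → at l i ≡ z → depth (at l i′) ≡ 0 → LeavesOnBothSides l → 0 < N →
                   i ≡ N × depth (at l 0) ≡ N
  pendant-before l i i′ i<i′ i′≤ z-at d′ leaves 0<N
    with node1-before-z l i (≤-trans i<i′ i′≤) z-at (next-outside l i i′ i<i′ i′≤ z-at d′) leaves 0<N
  ... | i₀ , refl , d1 = pendant-prefix l i₀ (<⇒≤ (≤-trans i<i′ i′≤)) z-at d1 (proj₁ leaves)

  pendant-after : ∀ l i i₁ → i ≤ i₁ → suc i₁ ≤ len l → at l (suc i₁) ≡ z → depth (at l i) ≡ 0 → LeavesOnBothSides l → 0 < N →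
                  len l ≡ suc i₁ + N × depth (at l (len l)) ≡ N
  pendant-after l i i₁ i≤i₁ i₁< z-at d′ leaves 0<N
    with node1-after-z l i₁ i₁< z-at (previous-outside l i i₁ i≤i₁ i₁< z-at d′) leaves 0<N
  ... | i₁+1< , d1 = pendant-suffix l (suc i₁) i₁+1< z-at d1 (proj₂ leaves)

-- Two branch vertices on one path of a configuration

Arrangement : ℕ → ℕ → ℕ → ℕ → Set
Arrangement x y p q = (p ≡ x × q ≡ y) ⊎ (p ≡ y × q ≡ x)

module HShapes {V : Set} (Adj : V → V → Set) (Adj-sym : Symmetric Adj) where
  open Walks Adj Adj-sym
  open PendantPath

  record HShape : Set where
    field
      z z₂               : V
      r                  : ℕ
      B₁ B₂              : PendantPath z
      C₁ C₂              : PendantPath z₂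
      0<N-B₁             : 0 < N B₁
      0<N-B₂             : 0 < N B₂
      0<N-C₁             : 0 < N C₁
      0<N-C₂             : 0 < N C₂
      ω ω₂               : V
      z-neighbours       : ∀ {x} → Adj z x → depth B₁ x ≡ 1 ⊎ depth B₂ x ≡ 1 ⊎ x ≡ ω
      z₂-neighbours      : ∀ {x} → Adj z₂ x → depth C₁ x ≡ 1 ⊎ depth C₂ x ≡ 1 ⊎ x ≡ ω₂
      B-disjoint         : ∀ x → depth B₁ x ≡ 0 ⊎ depth B₂ x ≡ 0
      C-disjoint         : ∀ x → depth C₁ x ≡ 0 ⊎ depth C₂ x ≡ 0
      z₂∉B₁              : depth B₁ z₂ ≡ 0
      z₂∉B₂              : depth B₂ z₂ ≡ 0
      z∉C₁               : depth C₁ z ≡ 0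
      z∉C₂               : depth C₂ z ≡ 0
      position           : V → ℕ
      position-lipschitz : Lipschitz position
      position-z         : position z ≡ 0
      position-z₂        : position z₂ ≡ r
      spine-walk         : Walk z z₂ r

  swap-centres : HShape → HShape
  swap-centres H = record
    { z = z₂ ; z₂ = z ; r = r
    ; B₁ = C₁ ; B₂ = C₂ ; C₁ = B₁ ; C₂ = B₂
    ; 0<N-B₁ = 0<N-C₁ ; 0<N-B₂ = 0<N-C₂ ; 0<N-C₁ = 0<N-B₁ ; 0<N-C₂ = 0<N-B₂
    ; ω = ω₂ ; ω₂ = ω ; z-neighbours = z₂-neighbours ; z₂-neighbours = z-neighbours
    ; B-disjoint = C-disjoint ; C-disjoint = B-disjoint
    ; z₂∉B₁ = z∉C₁ ; z₂∉B₂ = z∉C₂ ; z∉C₁ = z₂∉B₁ ; z∉C₂ = z₂∉B₂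
    ; position = λ x → r ∸ position x ; position-lipschitz = ∸-lipschitz position-lipschitz r
    ; position-z = trans (cong (r ∸_) position-z₂) (n∸n≡0 r) ; position-z₂ = cong (r ∸_) position-z
    ; spine-walk = reverseʷ spine-walk }
    where open HShape H

module HShapeInConfiguration {V : Set} (Adj : V → V → Set) (Adj-sym : Symmetric Adj)
                             (H : HShapes.HShape Adj Adj-sym) (C : Graph.LinearConfiguration Adj) where
  open Walks Adj Adj-sym
  open LinearConfiguration C
  open ConfigurationAccess Adj Adj-sym C
  open HShapes.HShape H
  open PendantPath
  open PendantPathProperties using (extend⁺; extend⁺-lipschitz; extend⁺-inside; extend⁺-outside)
  module Pendant = PendantInConfiguration Adj Adj-sym C

  leaves-via : ∀ {x} (B : PendantPath x) l l⁻ j⁻ l⁺ j⁺ → suc (toℕ l⁻) ≡ toℕ l → j⁻ ≤ len l⁻ → depth B (at l⁻ j⁻) ≡ 0 →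
               toℕ l⁺ ≡ suc (toℕ l) → j⁺ ≤ len l⁺ → depth B (at l⁺ j⁺) ≡ 0 → Pendant.LeavesOnBothSides B l
  leaves-via B l l⁻ j⁻ l⁺ j⁺ l⁻≡ j⁻≤ d⁻ l⁺≡ j⁺≤ d⁺ = next , prev
    where
      next : ∀ l′ → toℕ l′ ≡ suc (toℕ l) → Pendant.HasOutside B l′
      next l′ e with toℕ-injective (trans e (sym l⁺≡))
      ... | refl = j⁺ , j⁺≤ , d⁺
      prev : ∀ l′ → toℕ l ≡ suc (toℕ l′) → Pendant.HasOutside B l′
      prev l′ e with toℕ-injective (suc-injective (trans (sym e) (sym l⁻≡)))
      ... | refl = j⁻ , j⁻≤ , d⁻

  -- The crossing edge from z to P^{l-1} starts the blocks of Bo, each as long as the part of P^l before z.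
  parallel-z : (Bs Bo : PendantPath z) → ∀ l i i′ → i < i′ → i′ ≤ len l → at l i ≡ z →
               ∀ l⁻ j⁻ → suc (toℕ l⁻) ≡ toℕ l → j⁻ ≤ len l⁻ → Adj z (at l⁻ j⁻) →
               Pendant.LeavesOnBothSides Bs l → depth Bs (at l i′) ≡ 0 → depth Bo (at l⁻ j⁻) ≡ 1 → 0 < N Bs → suc (N Bs) ∣ N Bo
  parallel-z Bs Bo l i i′ i<i′ i′≤ z-at l⁻ j⁻ l⁻≡ j⁻≤ adj leaves d′ d⁻ 0<N
    with Pendant.pendant-before Bs l i i′ i<i′ i′≤ z-at d′ leaves 0<N
  ... | i≡N , d0 with classify-edge (subst (λ a → Adj a (at l⁻ j⁻)) (sym z-at) adj) (<⇒≤ (≤-trans i<i′ i′≤)) refl j⁻≤ refl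
  ...   | inj₁ (refl , _)         = ⊥-elim (1+n≢n l⁻≡)
  ...   | inj₂ (inj₁ (l≡ , _))    = ⊥-elim (n≢2+n (trans l≡ (cong suc (sym l⁻≡))))
  ...   | inj₂ (inj₂ (_ , 0<i , d , D₁ , D₂)) =
          subst (λ a → suc a ∣ N Bo) d≡N
            (Pendant.blocks∣N⁻ Bo d (subst (0 <_) (sym d≡i) 0<i) (N Bo) 0 l⁻ l j⁻ i (sym l⁻≡) j⁻≤ (<⇒≤ (≤-trans i<i′ i′≤))
               d⁻ (trans z-at (sym (node-root Bo))) D₂ refl)
    where
      d≡i : d ≡ i
      d≡i = Dist-tight (depth-lipschitz Bs) (along l 0 i (<⇒≤ (≤-trans i<i′ i′≤)))
              (inj₂ (trans d0 (trans (sym i≡N) (cong (_+ i) (sym (trans (cong (depth Bs) z-at) (depth-root Bs))))))) D₂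
      d≡N : d ≡ N Bs
      d≡N = trans d≡i i≡N

  parallel-z₂ : (Cs Co : PendantPath z₂) → ∀ l i i₁ → i ≤ i₁ → suc i₁ ≤ len l → at l (suc i₁) ≡ z₂ →
                ∀ l⁺ j⁺ → toℕ l⁺ ≡ suc (toℕ l) → j⁺ ≤ len l⁺ → Adj z₂ (at l⁺ j⁺) →
                Pendant.LeavesOnBothSides Cs l → depth Cs (at l i) ≡ 0 → depth Co (at l⁺ j⁺) ≡ 1 → 0 < N Cs → suc (N Cs) ∣ N Co
  parallel-z₂ Cs Co l i i₁ i≤i₁ i₁< z₂-at l⁺ j⁺ l⁺≡ j⁺≤ adj leaves d′ d⁺ 0<N
    with Pendant.pendant-after Cs l i i₁ i≤i₁ i₁< z₂-at d′ leaves 0<N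
  ... | len≡ , dlast with classify-edge (subst (λ a → Adj a (at l⁺ j⁺)) (sym z₂-at) adj) i₁< refl j⁺≤ refl
  ...   | inj₁ (refl , _)       = ⊥-elim (1+n≢n (sym l⁺≡))
  ...   | inj₂ (inj₂ (l≡ , _))  = ⊥-elim (n≢2+n (trans l≡ (cong suc l⁺≡)))
  ...   | inj₂ (inj₁ (_ , _ , d , D₁ , D₂)) =
          subst (λ a → suc a ∣ N Co) d≡N
            (Pendant.blocks∣N⁺ Co d (subst (0 <_) (sym d≡N) 0<N) (N Co) 0 l l⁺ (suc i₁) j⁺ l⁺≡ i₁< j⁺≤
               d⁺ (trans z₂-at (sym (node-root Co))) D₁ refl)
    where
      d≡N : d ≡ N Cs
      d≡N = Dist-tight (depth-lipschitz Cs) (along l (suc i₁) (N Cs) (≤-reflexive (sym len≡)))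
              (inj₁ (trans (subst (λ a → depth Cs (at l a) ≡ N Cs) len≡ dlast)
                           (cong (_+ N Cs) (sym (trans (cong (depth Cs) z₂-at) (depth-root Cs))))))
              (subst (λ a → Dist (at l (suc i₁)) (at l a) d) len≡ D₁)

  -- P^l runs from the tip of Bs through the spine to z₂, so the blocks of Co have N Bs + r + 1 vertices.
  crossed-z₂ : (Bs : PendantPath z) (Co : PendantPath z₂) → ∀ l i i₁ → i < suc i₁ → suc i₁ ≤ len l →
               at l i ≡ z → at l (suc i₁) ≡ z₂ → i ≡ N Bs → depth Bs (at l 0) ≡ N Bs → depth Bs z₂ ≡ 0 →
               ∀ l⁻ j⁻ → suc (toℕ l⁻) ≡ toℕ l → j⁻ ≤ len l⁻ → Adj z₂ (at l⁻ j⁻) → depth Co (at l⁻ j⁻) ≡ 1 → 0 < N Bs →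
               suc (N Bs) + r ∣ N Co
  crossed-z₂ Bs Co l i i₁ i<i′ i′≤ z-at z₂-at i≡N d0 z₂∉Bs l⁻ j⁻ l⁻≡ j⁻≤ adj d⁻ 0<N
    with classify-edge (subst (λ a → Adj a (at l⁻ j⁻)) (sym z₂-at) adj) i′≤ refl j⁻≤ refl
  ... | inj₁ (refl , _)      = ⊥-elim (1+n≢n l⁻≡)
  ... | inj₂ (inj₁ (l≡ , _)) = ⊥-elim (n≢2+n (trans l≡ (cong suc (sym l⁻≡))))
  ... | inj₂ (inj₂ (_ , _ , d , D₁ , D₂)) =
        subst (_∣ N Co) (cong suc d≡)
          (Pendant.blocks∣N⁻ Co d (subst (0 <_) (sym d≡) (≤-trans 0<N (m≤m+n (N Bs) r))) (N Co) 0 l⁻ l j⁻ (suc i₁) (sym l⁻≡) j⁻≤ i′≤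
             d⁻ (trans z₂-at (sym (node-root Co))) D₂ refl)
    where
      h : V → ℕ
      h = extend⁺ Bs (λ x → r ∸ position x) r
      walk : Walk (at l 0) (at l (suc i₁)) (i + r)
      walk = subst (λ a → Walk (at l 0) a (i + r)) (sym z₂-at)
               (subst (λ a → Walk (at l 0) a i) z-at (along l 0 i (<⇒≤ (≤-trans i<i′ i′≤))) ++ʷ spine-walk)
      h-start : h (at l 0) ≡ r + N Bs
      h-start = trans (extend⁺-inside Bs _ r (at l 0) (subst (0 <_) (sym d0) 0<N)) (cong (r +_) d0)
      h-end : h (at l (suc i₁)) ≡ 0
      h-end = trans (extend⁺-outside Bs _ r _ (trans (cong (depth Bs) z₂-at) z₂∉Bs))
                    (trans (cong (λ a → r ∸ position a) z₂-at) (trans (cong (r ∸_) position-z₂) (n∸n≡0 r)))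
      d≡ : d ≡ N Bs + r
      d≡ = trans (Dist-tight (extend⁺-lipschitz Bs _ r (∸-lipschitz position-lipschitz r) (cong (r ∸_) position-z)) walk
                   (inj₂ (trans h-start (trans (+-comm r (N Bs)) (trans (cong (_+ r) (sym i≡N)) (sym (cong (_+ (i + r)) h-end)))))) D₂)
                 (cong (_+ r) i≡N)

  crossed-z : (Bo : PendantPath z) (Cs : PendantPath z₂) → ∀ l i i₁ → i < suc i₁ → suc i₁ ≤ len l →
              at l i ≡ z → at l (suc i₁) ≡ z₂ → len l ≡ suc i₁ + N Cs → depth Cs (at l (len l)) ≡ N Cs → depth Cs z ≡ 0 →
              ∀ l⁺ j⁺ → toℕ l⁺ ≡ suc (toℕ l) → j⁺ ≤ len l⁺ → Adj z (at l⁺ j⁺) → depth Bo (at l⁺ j⁺) ≡ 1 → 0 < N Cs →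
              suc (N Cs) + r ∣ N Bo
  crossed-z Bo Cs l i i₁ i<i′ i′≤ z-at z₂-at len≡ dlast z∉Cs l⁺ j⁺ l⁺≡ j⁺≤ adj d⁺ 0<N
    with classify-edge (subst (λ a → Adj a (at l⁺ j⁺)) (sym z-at) adj) (<⇒≤ (≤-trans i<i′ i′≤)) refl j⁺≤ refl
  ... | inj₁ (refl , _)      = ⊥-elim (1+n≢n (sym l⁺≡))
  ... | inj₂ (inj₂ (l≡ , _)) = ⊥-elim (n≢2+n (trans l≡ (cong suc l⁺≡)))
  ... | inj₂ (inj₁ (_ , _ , d , D₁ , D₂)) =
        subst (_∣ N Bo) (cong suc (trans d≡ (+-comm r (N Cs))))
          (Pendant.blocks∣N⁺ Bo d (subst (0 <_) (sym d≡) (≤-trans 0<N (m≤n+m (N Cs) r))) (N Bo) 0 l l⁺ i j⁺ l⁺≡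
             (<⇒≤ (≤-trans i<i′ i′≤)) j⁺≤ d⁺ (trans z-at (sym (node-root Bo))) D₁ refl)
    where
      h : V → ℕ
      h = extend⁺ Cs position r
      walk : Walk (at l i) (at l (suc i₁ + N Cs)) (r + N Cs)
      walk = subst (λ a → Walk a (at l (suc i₁ + N Cs)) (r + N Cs)) (sym z-at)
               (spine-walk ++ʷ subst (λ a → Walk a (at l (suc i₁ + N Cs)) (N Cs)) z₂-at (along l (suc i₁) (N Cs) (≤-reflexive (sym len≡))))
      h-end : h (at l (suc i₁ + N Cs)) ≡ r + N Cs
      h-end = trans (extend⁺-inside Cs position r _ (subst (0 <_) (sym dlast′) 0<N)) (cong (r +_) dlast′)
        where dlast′ = subst (λ a → depth Cs (at l a) ≡ N Cs) len≡ dlast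
      h-start : h (at l i) ≡ 0
      h-start = trans (extend⁺-outside Cs position r _ (trans (cong (depth Cs) z-at) z∉Cs)) (trans (cong position z-at) position-z)
      d≡ : d ≡ r + N Cs
      d≡ = Dist-tight (extend⁺-lipschitz Cs position r position-lipschitz position-z₂) walk
             (inj₁ (trans h-end (sym (cong (_+ (r + N Cs)) h-start)))) (subst (λ a → Dist (at l i) (at l a) d) len≡ D₁)

  private
    other-zero : ∀ {a b} → a ≡ 0 ⊎ b ≡ 0 → a ≡ 1 → b ≡ 0
    other-zero (inj₁ a≡0) a≡1 = ⊥-elim (0≢1+n (trans (sym a≡0) a≡1))
    other-zero (inj₂ b≡0) _   = b≡0

    divides-arranged : ∀ {x y p q} → Arrangement x y p q → suc p ∣ q → (suc x ∣ y) ⊎ (suc y ∣ x)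
    divides-arranged (inj₁ (refl , refl)) d = inj₁ d
    divides-arranged (inj₂ (refl , refl)) d = inj₂ d

  ω-unique : ∀ {x} → Adj z x → depth B₁ x ≡ 0 → depth B₂ x ≡ 0 → x ≡ ω
  ω-unique adj d₁ d₂ with z-neighbours adj
  ... | inj₁ d₁≡1        = ⊥-elim (0≢1+n (trans (sym d₁) d₁≡1))
  ... | inj₂ (inj₁ d₂≡1) = ⊥-elim (0≢1+n (trans (sym d₂) d₂≡1))
  ... | inj₂ (inj₂ x≡ω)  = x≡ω

  ω₂-unique : ∀ {x} → Adj z₂ x → depth C₁ x ≡ 0 → depth C₂ x ≡ 0 → x ≡ ω₂
  ω₂-unique adj d₁ d₂ with z₂-neighbours adj
  ... | inj₁ d₁≡1        = ⊥-elim (0≢1+n (trans (sym d₁) d₁≡1))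
  ... | inj₂ (inj₁ d₂≡1) = ⊥-elim (0≢1+n (trans (sym d₂) d₂≡1))
  ... | inj₂ (inj₂ x≡ω₂) = x≡ω₂

  ω-after-z : ∀ l i i₁ → i ≤ i₁ → suc i₁ ≤ len l → at l i ≡ z → at l (suc i₁) ≡ z₂ → at l (suc i) ≡ ω
  ω-after-z l i i₁ i≤i₁ i₁< z-at z₂-at =
    ω-unique (subst (λ a → Adj a (at l (suc i))) z-at (at-adjacent l i (≤-trans (s≤s i≤i₁) i₁<)))
      (Pendant.next-outside B₁ l i (suc i₁) (s≤s i≤i₁) i₁< z-at (trans (cong (depth B₁) z₂-at) z₂∉B₁))
      (Pendant.next-outside B₂ l i (suc i₁) (s≤s i≤i₁) i₁< z-at (trans (cong (depth B₂) z₂-at) z₂∉B₂))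

  ω₂-before-z₂ : ∀ l i i₁ → i ≤ i₁ → suc i₁ ≤ len l → at l i ≡ z → at l (suc i₁) ≡ z₂ → at l i₁ ≡ ω₂
  ω₂-before-z₂ l i i₁ i≤i₁ i₁< z-at z₂-at =
    ω₂-unique (subst (λ a → Adj a (at l i₁)) z₂-at (Adj-sym (at-adjacent l i₁ i₁<)))
      (Pendant.previous-outside C₁ l i i₁ i≤i₁ i₁< z₂-at (trans (cong (depth C₁) z-at) z∉C₁))
      (Pendant.previous-outside C₂ l i i₁ i≤i₁ i₁< z₂-at (trans (cong (depth C₂) z-at) z∉C₂))

  -- Bo is the pendant path at z starting at its neighbour y off P^l; Bs, the other one, will lie on P^l.
  SplitAtZ : V → Set
  SplitAtZ y = Σ (PendantPath z) λ Bs → Σ (PendantPath z) λ Bo → Arrangement (N B₁) (N B₂) (N Bs) (N Bo) ×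
                depth Bo y ≡ 1 × depth Bs y ≡ 0 × depth Bs z₂ ≡ 0 × 0 < N Bs

  split-at-z : ∀ {y} → Adj z y → y ≢ ω → SplitAtZ y
  split-at-z {y} adj y≢ω with z-neighbours adj
  ... | inj₁ d₁        = B₂ , B₁ , inj₂ (refl , refl) , d₁ , other-zero (B-disjoint y) d₁ , z₂∉B₂ , 0<N-B₂
  ... | inj₂ (inj₁ d₂) = B₁ , B₂ , inj₁ (refl , refl) , d₂ , other-zero (Data.Sum.swap (B-disjoint y)) d₂ , z₂∉B₁ , 0<N-B₁
  ... | inj₂ (inj₂ y≡ω) = ⊥-elim (y≢ω y≡ω)

  SplitAtZ₂ : V → Set
  SplitAtZ₂ y = Σ (PendantPath z₂) λ Cs → Σ (PendantPath z₂) λ Co → Arrangement (N C₁) (N C₂) (N Cs) (N Co) ×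
                 depth Co y ≡ 1 × depth Cs y ≡ 0 × depth Cs z ≡ 0 × 0 < N Cs

  split-at-z₂ : ∀ {y} → Adj z₂ y → y ≢ ω₂ → SplitAtZ₂ y
  split-at-z₂ {y} adj y≢ω₂ with z₂-neighbours adj
  ... | inj₁ d₁        = C₂ , C₁ , inj₂ (refl , refl) , d₁ , other-zero (C-disjoint y) d₁ , z∉C₂ , 0<N-C₂
  ... | inj₂ (inj₁ d₂) = C₁ , C₂ , inj₁ (refl , refl) , d₂ , other-zero (Data.Sum.swap (C-disjoint y)) d₂ , z∉C₁ , 0<N-C₁
  ... | inj₂ (inj₂ y≡ω₂) = ⊥-elim (y≢ω₂ y≡ω₂)

  module _ (l : Fin n) (i i₁ : ℕ) (i≤i₁ : i ≤ i₁) (i₁< : suc i₁ ≤ len l) (z-at : at l i ≡ z) (z₂-at : at l (suc i₁) ≡ z₂) where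
    private
      i≤ : i ≤ len l
      i≤ = ≤-trans i≤i₁ (<⇒≤ i₁<)
      z≢z₂ : z ≢ z₂
      z≢z₂ e = <⇒≢ (s≤s i≤i₁) (at-injective-index i≤ i₁< (trans z-at (trans e (sym z₂-at))))
      off-path : ∀ {l′ j} → toℕ l′ ≢ toℕ l → j ≤ len l′ → ∀ k → k ≤ len l → at l′ j ≢ at l k
      off-path l′≢l j≤ k k≤ e = l′≢l (at-injective-path j≤ k≤ e)

    parallel : ∀ l⁻ j⁻ → suc (toℕ l⁻) ≡ toℕ l → j⁻ ≤ len l⁻ → Adj z (at l⁻ j⁻) →
               ∀ l⁺ j⁺ → toℕ l⁺ ≡ suc (toℕ l) → j⁺ ≤ len l⁺ → Adj z₂ (at l⁺ j⁺) →
               ((suc (N B₁) ∣ N B₂) ⊎ (suc (N B₂) ∣ N B₁)) × ((suc (N C₁) ∣ N C₂) ⊎ (suc (N C₂) ∣ N C₁))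
    parallel l⁻ j⁻ l⁻≡ j⁻≤ adj⁻ l⁺ j⁺ l⁺≡ j⁺≤ adj⁺
      with split-at-z adj⁻ (λ e → off-path (λ e′ → 1+n≢n (trans l⁻≡ (sym e′))) j⁻≤ (suc i) (≤-trans (s≤s i≤i₁) i₁<)
                                  (trans e (sym (ω-after-z l i i₁ i≤i₁ i₁< z-at z₂-at))))
         | split-at-z₂ adj⁺ (λ e → off-path (λ e′ → 1+n≢n (trans (sym l⁺≡) e′)) j⁺≤ i₁ (<⇒≤ i₁<)
                                  (trans e (sym (ω₂-before-z₂ l i i₁ i≤i₁ i₁< z-at z₂-at))))
    ... | Bs , Bo , arrB , dBo , dBs , z₂∉Bs , 0<Bs | Cs , Co , arrC , dCo , dCs , z∉Cs , 0<Cs =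
          divides-arranged arrB (parallel-z Bs Bo l i (suc i₁) (s≤s i≤i₁) i₁< z-at l⁻ j⁻ l⁻≡ j⁻≤ adj⁻
                                   (leaves-via Bs l l⁻ j⁻ l⁺ j⁺ l⁻≡ j⁻≤ dBs l⁺≡ j⁺≤
                                      (Pendant.outside-neighbour Bs adj⁺ z₂∉Bs (z≢z₂ ∘′ sym)))
                                   (trans (cong (depth Bs) z₂-at) z₂∉Bs) dBo 0<Bs) ,
          divides-arranged arrC (parallel-z₂ Cs Co l i i₁ i≤i₁ i₁< z₂-at l⁺ j⁺ l⁺≡ j⁺≤ adj⁺
                                   (leaves-via Cs l l⁻ j⁻ l⁺ j⁺ l⁻≡ j⁻≤ (Pendant.outside-neighbour Cs adj⁻ z∉Cs z≢z₂) l⁺≡ j⁺≤ dCs)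
                                   (trans (cong (depth Cs) z-at) z∉Cs) dCo 0<Cs)

    crossed : ∀ l⁺ j⁺ → toℕ l⁺ ≡ suc (toℕ l) → j⁺ ≤ len l⁺ → Adj z (at l⁺ j⁺) →
              ∀ l⁻ j⁻ → suc (toℕ l⁻) ≡ toℕ l → j⁻ ≤ len l⁻ → Adj z₂ (at l⁻ j⁻) →
              Σ ℕ λ nBs → Σ ℕ λ nBo → Σ ℕ λ nCs → Σ ℕ λ nCo →
              Arrangement (N B₁) (N B₂) nBs nBo × Arrangement (N C₁) (N C₂) nCs nCo × (suc nBs + r ∣ nCo) × (suc nCs + r ∣ nBo)
    crossed l⁺ j⁺ l⁺≡ j⁺≤ adj⁺ l⁻ j⁻ l⁻≡ j⁻≤ adj⁻
      with split-at-z adj⁺ (λ e → off-path (λ e′ → 1+n≢n (trans (sym l⁺≡) e′)) j⁺≤ (suc i) (≤-trans (s≤s i≤i₁) i₁<)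
                                  (trans e (sym (ω-after-z l i i₁ i≤i₁ i₁< z-at z₂-at))))
         | split-at-z₂ adj⁻ (λ e → off-path (λ e′ → 1+n≢n (trans l⁻≡ (sym e′))) j⁻≤ i₁ (<⇒≤ i₁<)
                                  (trans e (sym (ω₂-before-z₂ l i i₁ i≤i₁ i₁< z-at z₂-at))))
    ... | Bs , Bo , arrB , dBo , dBs , z₂∉Bs , 0<Bs | Cs , Co , arrC , dCo , dCs , z∉Cs , 0<Cs
      with Pendant.pendant-before Bs l i (suc i₁) (s≤s i≤i₁) i₁< z-at (trans (cong (depth Bs) z₂-at) z₂∉Bs)
             (leaves-via Bs l l⁻ j⁻ l⁺ j⁺ l⁻≡ j⁻≤ (Pendant.outside-neighbour Bs adj⁻ z₂∉Bs (z≢z₂ ∘′ sym)) l⁺≡ j⁺≤ dBs) 0<Bs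
         | Pendant.pendant-after Cs l i i₁ i≤i₁ i₁< z₂-at (trans (cong (depth Cs) z-at) z∉Cs)
             (leaves-via Cs l l⁻ j⁻ l⁺ j⁺ l⁻≡ j⁻≤ dCs l⁺≡ j⁺≤ (Pendant.outside-neighbour Cs adj⁺ z∉Cs z≢z₂)) 0<Cs
    ...   | i≡N , d0 | len≡ , dlast =
            N Bs , N Bo , N Cs , N Co , arrB , arrC ,
            crossed-z₂ Bs Co l i i₁ (s≤s i≤i₁) i₁< z-at z₂-at i≡N d0 z₂∉Bs l⁻ j⁻ l⁻≡ j⁻≤ adj⁻ dCo 0<Bs ,
            crossed-z Bo Cs l i i₁ (s≤s i≤i₁) i₁< z-at z₂-at len≡ dlast z∉Cs l⁺ j⁺ l⁺≡ j⁺≤ adj⁺ dBo 0<Cs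

  private
    split-< : ∀ {i i′} → i < i′ → Σ ℕ λ i₁ → i′ ≡ suc i₁ × i ≤ i₁
    split-< {i′ = suc i₁} (s≤s i≤i₁) = i₁ , refl , i≤i₁

    neighbour-at : ∀ {x l} → (Σ (Fin (suc (len l))) λ j → Adj x (P l j)) → Σ ℕ λ j → j ≤ len l × Adj x (at l j)
    neighbour-at {l = l} (j , adj) = toℕ j , toℕ≤pred[n] j , subst (Adj _) (sym (at-toℕ l j)) adj

  parallel-path : ∀ l (i i′ : Fin (suc (len l))) → toℕ i < toℕ i′ → P l i ≡ z → P l i′ ≡ z₂ →
                  (Σ (Fin n) λ l⁻ → suc (toℕ l⁻) ≡ toℕ l × AdjToPath (P l i) l⁻) →
                  (Σ (Fin n) λ l⁺ → toℕ l⁺ ≡ suc (toℕ l) × AdjToPath (P l i′) l⁺) →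
                  ((suc (N B₁) ∣ N B₂) ⊎ (suc (N B₂) ∣ N B₁)) × ((suc (N C₁) ∣ N C₂) ⊎ (suc (N C₂) ∣ N C₁))
  parallel-path l i i′ i<i′ z-at z₂-at (l⁻ , l⁻≡ , adj⁻) (l⁺ , l⁺≡ , adj⁺)
    with split-< i<i′ | neighbour-at adj⁻ | neighbour-at adj⁺
  ... | i₁ , i′≡ , i≤i₁ | j⁻ , j⁻≤ , a⁻ | j⁺ , j⁺≤ , a⁺ =
        parallel l (toℕ i) i₁ i≤i₁ (subst (_≤ len l) i′≡ (toℕ≤pred[n] i′)) (trans (at-toℕ l i) z-at)
          (trans (cong (at l) (sym i′≡)) (trans (at-toℕ l i′) z₂-at))
          l⁻ j⁻ l⁻≡ j⁻≤ (subst (λ a → Adj a _) z-at a⁻) l⁺ j⁺ l⁺≡ j⁺≤ (subst (λ a → Adj a _) z₂-at a⁺)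

  crossed-path : ∀ l (i i′ : Fin (suc (len l))) → toℕ i < toℕ i′ → P l i ≡ z → P l i′ ≡ z₂ →
                 (Σ (Fin n) λ l⁺ → toℕ l⁺ ≡ suc (toℕ l) × AdjToPath (P l i) l⁺) →
                 (Σ (Fin n) λ l⁻ → suc (toℕ l⁻) ≡ toℕ l × AdjToPath (P l i′) l⁻) →
                 Σ ℕ λ nBs → Σ ℕ λ nBo → Σ ℕ λ nCs → Σ ℕ λ nCo →
                 Arrangement (N B₁) (N B₂) nBs nBo × Arrangement (N C₁) (N C₂) nCs nCo × (suc nBs + r ∣ nCo) × (suc nCs + r ∣ nBo)
  crossed-path l i i′ i<i′ z-at z₂-at (l⁺ , l⁺≡ , adj⁺) (l⁻ , l⁻≡ , adj⁻)
    with split-< i<i′ | neighbour-at adj⁺ | neighbour-at adj⁻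
  ... | i₁ , i′≡ , i≤i₁ | j⁺ , j⁺≤ , a⁺ | j⁻ , j⁻≤ , a⁻ =
        crossed l (toℕ i) i₁ i≤i₁ (subst (_≤ len l) i′≡ (toℕ≤pred[n] i′)) (trans (at-toℕ l i) z-at)
          (trans (cong (at l) (sym i′≡)) (trans (at-toℕ l i′) z₂-at))
          l⁺ j⁺ l⁺≡ j⁺≤ (subst (λ a → Adj a _) z-at a⁺) l⁻ j⁻ l⁻≡ j⁻≤ (subst (λ a → Adj a _) z₂-at a⁻)

-- Building configurations

module Layouts {V : Set} (Adj : V → V → Set) (Adj-sym : Symmetric Adj) where
  open Walks Adj Adj-sym
  open PendantPath
  open PendantPathProperties using (depth-step)

  record Layout : Set where
    field
      M                  : ℕ
      line               : ℕ → V
      position           : V → ℕ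
      position-lipschitz : Lipschitz position
      position-line      : ∀ k → k ≤ M → position (line k) ≡ k
      line-adjacent      : ∀ k → k < M → Adj (line k) (line (suc k))
      pX pY              : ℕ
      0<pX               : 0 < pX
      pX≤M               : pX ≤ M
      pY<M               : pY < M
      zX zY              : V
      line-pX            : line pX ≡ zX
      line-pY            : line pY ≡ zY
      X                  : PendantPath zX
      Y                  : PendantPath zY
      mX mY              : ℕ
      0<mX               : 0 < mX
      0<mY               : 0 < mY
      N-X                : N X ≡ mX * suc pX
      N-Y                : N Y ≡ mY * suc (M ∸ pY)
      covered            : ∀ x → (Σ ℕ λ k → k ≤ M × line k ≡ x) ⊎ 0 < depth X x ⊎ 0 < depth Y x
      line∉X             : ∀ k → k ≤ M → depth X (line k) ≡ 0
      line∉Y             : ∀ k → k ≤ M → depth Y (line k) ≡ 0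
      X∉Y                : ∀ x → 0 < depth X x → depth Y x ≡ 0
      Y∉X                : ∀ x → 0 < depth Y x → depth X x ≡ 0
      irreflexive        : ∀ {x} → Adj x x → ⊥

  module FromLayout (T : Layout) where
    open Layout T

    KY′ : ℕ
    KY′ = M ∸ pY

    -- X is cut into blocks of pX+1 and Y into blocks of KY′+1 consecutive nodes; X-blocks are
    -- walked towards the tip, Y-blocks towards the root.
    data Piece : Set where
      x-block  : ℕ → Piece
      the-line : Piece
      y-block  : ℕ → Piece

    Valid : Piece → Set
    Valid (x-block q) = q < mX
    Valid the-line    = ⊤
    Valid (y-block q) = q < mY

    piece-length : Piece → ℕ
    piece-length (x-block _) = pX
    piece-length the-line    = M
    piece-length (y-block _) = KY′

    vertex : Piece → ℕ → V
    vertex (x-block q) e = node X (q * suc pX + suc e)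
    vertex the-line    e = line e
    vertex (y-block q) e = node Y (q * suc KY′ + suc (KY′ ∸ e))

    count : ℕ
    count = mX + suc mY

    index : Piece → ℕ
    index (x-block q) = mX ∸ suc q
    index the-line    = mX
    index (y-block q) = suc (mX + q)

    piece : ℕ → Piece
    piece j with <-cmp j mX
    ... | tri< _ _ _ = x-block (mX ∸ suc j)
    ... | tri≈ _ _ _ = the-line
    ... | tri> _ _ _ = y-block (j ∸ suc mX)

    private
      reflect : ∀ {m k} → k < m → m ∸ suc (m ∸ suc k) ≡ k
      reflect {m} k<m = trans (cong (m ∸_) (1+[m∸1+n]≡m∸n k<m)) (m∸[m∸n]≡n (<⇒≤ k<m))

      m∸1+n<m : ∀ {m} n → 0 < m → m ∸ suc n < m
      m∸1+n<m {suc m} n _ = s≤s (m∸n≤m m n)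

    index-piece : ∀ j → index (piece j) ≡ j
    index-piece j with <-cmp j mX
    ... | tri< j<mX _ _ = reflect j<mX
    ... | tri≈ _ j≡mX _ = sym j≡mX
    ... | tri> _ _ mX<j = m+[n∸m]≡n mX<j

    piece-index : ∀ t → Valid t → piece (index t) ≡ t
    piece-index (x-block q) q<mX with <-cmp (mX ∸ suc q) mX
    ... | tri< _ _ _    = cong x-block (reflect q<mX)
    ... | tri≈ _ e _    = ⊥-elim (<⇒≢ (m∸1+n<m q 0<mX) e)
    ... | tri> _ _ mX<  = ⊥-elim (<⇒≱ mX< (m∸n≤m mX (suc q)))
    piece-index the-line _ with <-cmp mX mX
    ... | tri< mX<mX _ _ = ⊥-elim (<-irrefl refl mX<mX)
    ... | tri≈ _ _ _     = refl
    ... | tri> _ _ mX<mX = ⊥-elim (<-irrefl refl mX<mX)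
    piece-index (y-block q) _ with <-cmp (suc (mX + q)) mX
    ... | tri< <mX _ _ = ⊥-elim (<⇒≱ <mX (≤-trans (m≤m+n mX q) (n≤1+n _)))
    ... | tri≈ _ e _   = ⊥-elim (<⇒≢ (s≤s (m≤m+n mX q)) (sym e))
    ... | tri> _ _ _   = cong y-block (m+n∸m≡n mX q)

    piece-injective : ∀ {j j′} → piece j ≡ piece j′ → j ≡ j′
    piece-injective {j} {j′} e = trans (sym (index-piece j)) (trans (cong index e) (index-piece j′))

    index< : ∀ t → Valid t → index t < count
    index< (x-block q) _ = ≤-trans (s≤s (m∸n≤m mX (suc q))) (≤-trans (s≤s (m≤m+n mX mY)) (≤-reflexive (sym (+-suc mX mY))))
    index< the-line    _ = m<m+n mX z<s
    index< (y-block q) q<mY = subst (suc (mX + q) <_) (sym (+-suc mX mY)) (s≤s (+-monoʳ-< mX q<mY))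

    piece-valid : ∀ j → j < count → Valid (piece j)
    piece-valid j j< with <-cmp j mX
    ... | tri< j<mX _ _ = m∸1+n<m j (≤-trans z<s j<mX)
    ... | tri≈ _ _ _    = tt
    ... | tri> _ _ mX<j = +-cancelˡ-< (suc mX) (j ∸ suc mX) mY (subst (_< suc mX + mY) (sym (m+[n∸m]≡n mX<j)) (subst (j <_) (+-suc mX mY) j<))

    private
      block-bound : ∀ {q m K e} → q < m → e < K → q * K + suc e ≤ m * K
      block-bound {q} {m} {K} q<m e<K = ≤-trans (+-monoʳ-≤ (q * K) e<K) (≤-trans (≤-reflexive (+-comm (q * K) K)) (*-monoˡ-≤ K q<m))

    depth-x-block : ∀ q e → q < mX → e ≤ pX → depth X (vertex (x-block q) e) ≡ q * suc pX + suc e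
    depth-x-block q e q<mX e≤ = depth-node X _ (subst (q * suc pX + suc e ≤_) (sym N-X) (block-bound q<mX (s≤s e≤)))

    depth-y-block : ∀ q e → q < mY → e ≤ KY′ → depth Y (vertex (y-block q) e) ≡ q * suc KY′ + suc (KY′ ∸ e)
    depth-y-block q e q<mY e≤ = depth-node Y _ (subst (q * suc KY′ + suc (KY′ ∸ e) ≤_) (sym N-Y) (block-bound q<mY (s≤s (m∸n≤m KY′ e))))

    piece-adjacent : ∀ t e → Valid t → e < piece-length t → Adj (vertex t e) (vertex t (suc e))
    piece-adjacent (x-block q) e q<mX e< =
      subst (λ a → Adj (vertex (x-block q) e) (node X a)) (sym (+-suc (q * suc pX) (suc e)))
        (node-adjacent X _ (subst (suc (q * suc pX + suc e) ≤_) (sym N-X)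
          (subst (_≤ mX * suc pX) (+-suc (q * suc pX) (suc e)) (block-bound q<mX (s≤s e<)))))
    piece-adjacent the-line e _ e< = line-adjacent e e<
    piece-adjacent (y-block q) e q<mY e< =
      Adj-sym (subst (λ a → Adj (vertex (y-block q) (suc e)) (node Y a)) next
        (node-adjacent Y _ (subst (suc (q * suc KY′ + suc (KY′ ∸ suc e)) ≤_) (sym N-Y)
          (subst (_≤ mY * suc KY′) (sym next) (block-bound q<mY (s≤s (m∸n≤m KY′ e)))))))
      where
        next : suc (q * suc KY′ + suc (KY′ ∸ suc e)) ≡ q * suc KY′ + suc (KY′ ∸ e)
        next = trans (sym (+-suc (q * suc KY′) (suc (KY′ ∸ suc e)))) (cong (λ a → q * suc KY′ + suc a) (1+[m∸1+n]≡m∸n e<))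

    piece-walk : ∀ t → Valid t → ∀ a e → a + e ≤ piece-length t → Walk (vertex t a) (vertex t (a + e)) e
    piece-walk t ok a zero    _    = subst (λ j → Walk (vertex t a) (vertex t j) 0) (sym (+-identityʳ a)) here
    piece-walk t ok a (suc e) a+e≤ =
      step (piece-adjacent t a ok (≤-trans (s≤s (m≤m+n a e)) a+e≤′))
           (subst (λ j → Walk (vertex t (suc a)) (vertex t j) e) (sym (+-suc a e)) (piece-walk t ok (suc a) e a+e≤′))
      where a+e≤′ = subst (_≤ piece-length t) (+-suc a e) a+e≤

    piece-geodesic : ∀ t → Valid t → Dist (vertex t 0) (vertex t (piece-length t)) (piece-length t)
    piece-geodesic (x-block q) ok = tight-walk⇒Dist (depth-lipschitz X) (piece-walk (x-block q) ok 0 pX ≤-refl)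
      (inj₁ (trans (depth-x-block q pX ok ≤-refl) (trans (sym (+-assoc (q * suc pX) 1 pX)) (cong (_+ pX) (sym (depth-x-block q 0 ok z≤n))))))
    piece-geodesic the-line ok = tight-walk⇒Dist position-lipschitz (piece-walk the-line ok 0 M ≤-refl)
      (inj₁ (trans (position-line M ≤-refl) (cong (_+ M) (sym (position-line 0 z≤n)))))
    piece-geodesic (y-block q) ok = tight-walk⇒Dist (depth-lipschitz Y) (piece-walk (y-block q) ok 0 KY′ ≤-refl)
      (inj₂ (trans (depth-y-block q 0 ok z≤n) (trans (sym (+-assoc (q * suc KY′) 1 KY′))
        (cong (_+ KY′) (trans (cong (λ a → q * suc KY′ + suc a) (sym (n∸n≡0 KY′))) (sym (depth-y-block q KY′ ok ≤-refl)))))))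

    line-geodesic : ∀ a b → a ≤ b → b ≤ M → Dist (line a) (line b) (b ∸ a)
    line-geodesic a b a≤b b≤M = tight-walk⇒Dist position-lipschitz
      (subst (λ j → Walk (line a) (line j) (b ∸ a)) (m+[n∸m]≡n a≤b) (piece-walk the-line tt a (b ∸ a) (subst (_≤ M) (sym (m+[n∸m]≡n a≤b)) b≤M)))
      (inj₁ (trans (position-line b b≤M) (trans (sym (m+[n∸m]≡n a≤b)) (cong (_+ (b ∸ a)) (sym (position-line a (≤-trans a≤b b≤M)))))))

    private
      0<depth-x : ∀ q e → q < mX → e ≤ pX → 0 < depth X (vertex (x-block q) e)
      0<depth-x q e q<mX e≤ = subst (0 <_) (sym (trans (depth-x-block q e q<mX e≤) (+-suc (q * suc pX) e))) z<s

      0<depth-y : ∀ q e → q < mY → e ≤ KY′ → 0 < depth Y (vertex (y-block q) e)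
      0<depth-y q e q<mY e≤ = subst (0 <_) (sym (trans (depth-y-block q e q<mY e≤) (+-suc (q * suc KY′) (KY′ ∸ e)))) z<s

      depth-unique : ∀ {K q q′ e e′} → e ≤ K → e′ ≤ K → q * suc K + suc e ≡ q′ * suc K + suc e′ → q ≡ q′ × e ≡ e′
      depth-unique {K} {q} {q′} {e} {e′} e≤ e′≤ eq =
        division-unique (suc K) q q′ e e′ (s≤s e≤) (s≤s e′≤) (suc-injective (trans (sym (+-suc (q * suc K) e)) (trans eq (+-suc (q′ * suc K) e′))))

    vertex-injective : ∀ t t′ e e′ → Valid t → Valid t′ → e ≤ piece-length t → e′ ≤ piece-length t′ →
                       vertex t e ≡ vertex t′ e′ → t ≡ t′ × e ≡ e′
    vertex-injective (x-block q) (x-block q′) e e′ ok ok′ e≤ e′≤ eq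
      with depth-unique {pX} {q} {q′} e≤ e′≤ (trans (sym (depth-x-block q e ok e≤)) (trans (cong (depth X) eq) (depth-x-block q′ e′ ok′ e′≤)))
    ... | refl , refl = refl , refl
    vertex-injective (x-block q) the-line e e′ ok _ e≤ e′≤ eq =
      ⊥-elim (<⇒≢ (0<depth-x q e ok e≤) (sym (trans (cong (depth X) eq) (line∉X e′ e′≤))))
    vertex-injective (x-block q) (y-block q′) e e′ ok ok′ e≤ e′≤ eq =
      ⊥-elim (<⇒≢ (0<depth-y q′ e′ ok′ e′≤) (sym (trans (cong (depth Y) (sym eq)) (X∉Y _ (0<depth-x q e ok e≤)))))
    vertex-injective the-line (x-block q′) e e′ _ ok′ e≤ e′≤ eq =
      ⊥-elim (<⇒≢ (0<depth-x q′ e′ ok′ e′≤) (sym (trans (cong (depth X) (sym eq)) (line∉X e e≤))))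
    vertex-injective the-line the-line e e′ _ _ e≤ e′≤ eq =
      refl , trans (sym (position-line e e≤)) (trans (cong position eq) (position-line e′ e′≤))
    vertex-injective the-line (y-block q′) e e′ _ ok′ e≤ e′≤ eq =
      ⊥-elim (<⇒≢ (0<depth-y q′ e′ ok′ e′≤) (sym (trans (cong (depth Y) (sym eq)) (line∉Y e e≤))))
    vertex-injective (y-block q) (x-block q′) e e′ ok ok′ e≤ e′≤ eq =
      ⊥-elim (<⇒≢ (0<depth-x q′ e′ ok′ e′≤) (sym (trans (cong (depth X) (sym eq)) (Y∉X _ (0<depth-y q e ok e≤)))))
    vertex-injective (y-block q) the-line e e′ ok _ e≤ e′≤ eq =
      ⊥-elim (<⇒≢ (0<depth-y q e ok e≤) (sym (trans (cong (depth Y) eq) (line∉Y e′ e′≤))))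
    vertex-injective (y-block q) (y-block q′) e e′ ok ok′ e≤ e′≤ eq
      with depth-unique {KY′} {q} {q′} (m∸n≤m KY′ e) (m∸n≤m KY′ e′)
             (trans (sym (depth-y-block q e ok e≤)) (trans (cong (depth Y) eq) (depth-y-block q′ e′ ok′ e′≤)))
    ... | refl , KY′∸e≡ = refl , ∸-cancelˡ-≡ e≤ e′≤ KY′∸e≡

    private
      divmod : ∀ c K → Σ ℕ λ q → Σ ℕ λ e → e < suc K × c ≡ q * suc K + e
      divmod c K = c / suc K , c % suc K , m%n<n c (suc K) , trans (m≡m%n+[m/n]*n c (suc K)) (+-comm (c % suc K) _)

      depth-decomposition : ∀ {D} K → 0 < D → ∀ {q e} → D ∸ 1 ≡ q * suc K + e → D ≡ q * suc K + suc e
      depth-decomposition {suc D} K _ {q} {e} eq = trans (cong suc eq) (sym (+-suc (q * suc K) e))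

    x-block-of : ∀ x → 0 < depth X x → Σ ℕ λ q → Σ ℕ λ e → q < mX × e ≤ pX × vertex (x-block q) e ≡ x
    x-block-of x 0<d with divmod (depth X x ∸ 1) pX
    ... | q , e , e< , eq = q , e , q<mX , s≤s⁻¹ e< , trans (cong (node X) (sym d≡)) (node-depth X x 0<d)
      where
        d≡ : depth X x ≡ q * suc pX + suc e
        d≡ = depth-decomposition pX 0<d {q} eq
        q<mX : q < mX
        q<mX = quotient-< (suc pX) q e mX (subst (_≤ mX * suc pX) d≡ (subst (depth X x ≤_) N-X (depth≤N X x)))

    y-block-of : ∀ x → 0 < depth Y x → Σ ℕ λ q → Σ ℕ λ e → q < mY × e ≤ KY′ × vertex (y-block q) e ≡ x
    y-block-of x 0<d with divmod (depth Y x ∸ 1) KY′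
    ... | q , f , f< , eq = q , KY′ ∸ f , q<mY , m∸n≤m KY′ f ,
                            trans (cong (λ a → node Y (q * suc KY′ + suc a)) (m∸[m∸n]≡n (s≤s⁻¹ f<)))
                                  (trans (cong (node Y) (sym d≡)) (node-depth Y x 0<d))
      where
        d≡ : depth Y x ≡ q * suc KY′ + suc f
        d≡ = depth-decomposition KY′ 0<d {q} eq
        q<mY : q < mY
        q<mY = quotient-< (suc KY′) q f mY (subst (_≤ mY * suc KY′) d≡ (subst (depth Y x ≤_) N-Y (depth≤N Y x)))

    PathStep : V → V → Set
    PathStep x y = Σ Piece λ t → Valid t × Σ ℕ λ e → suc e ≤ piece-length t × vertex t e ≡ x × vertex t (suc e) ≡ y

    Crossing : V → V → Set
    Crossing x y = Σ Piece λ t → Σ Piece λ t′ → Valid t × Valid t′ × index t′ ≡ suc (index t) ×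
      Σ ℕ λ e → Σ ℕ λ e′ → e ≤ piece-length t × e′ ≤ piece-length t′ × 0 < e′ × vertex t e ≡ x × vertex t′ e′ ≡ y ×
      Σ ℕ λ d → Dist (vertex t e) (vertex t (piece-length t)) d × Dist (vertex t′ 0) (vertex t′ e′) d

    Classified : V → V → Set
    Classified x y = PathStep x y ⊎ PathStep y x ⊎ Crossing x y ⊎ Crossing y x

    classified-sym : ∀ {x y} → Classified x y → Classified y x
    classified-sym (inj₁ s)               = inj₂ (inj₁ s)
    classified-sym (inj₂ (inj₁ s))        = inj₁ s
    classified-sym (inj₂ (inj₂ (inj₁ c))) = inj₂ (inj₂ (inj₂ c))
    classified-sym (inj₂ (inj₂ (inj₂ c))) = inj₂ (inj₂ (inj₁ c))

    block-crossing : ∀ t t′ → Valid t → Valid t′ → index t′ ≡ suc (index t) → piece-length t ≡ piece-length t′ → 0 < piece-length t′ →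
                     Crossing (vertex t 0) (vertex t′ (piece-length t′))
    block-crossing t t′ ok ok′ idx len≡ 0<len = t , t′ , ok , ok′ , idx , 0 , piece-length t′ , z≤n , ≤-refl , 0<len , refl , refl ,
      piece-length t′ , subst (Dist (vertex t 0) (vertex t (piece-length t))) len≡ (piece-geodesic t ok) , piece-geodesic t′ ok′

    x-line-crossing : Crossing (vertex (x-block 0) 0) zX
    x-line-crossing = x-block 0 , the-line , 0<mX , tt , sym (1+[m∸1+n]≡m∸n 0<mX) , 0 , pX , z≤n , pX≤M , 0<pX , refl , line-pX ,
      pX , piece-geodesic (x-block 0) 0<mX , line-geodesic 0 pX z≤n pX≤M

    line-y-crossing : Crossing zY (vertex (y-block 0) KY′)
    line-y-crossing = the-line , y-block 0 , tt , 0<mY , cong suc (+-identityʳ mX) , pY , KY′ , <⇒≤ pY<M , ≤-refl ,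
      m<n⇒0<n∸m pY<M , line-pY , refl , KY′ , line-geodesic pY M (<⇒≤ pY<M) ≤-refl , piece-geodesic (y-block 0) 0<mY

    private
      depth-x : ∀ {x q e} → q < mX → e ≤ pX → vertex (x-block q) e ≡ x → depth X x ≡ q * suc pX + suc e
      depth-x q<mX e≤ ex = trans (cong (depth X) (sym ex)) (depth-x-block _ _ q<mX e≤)

      depth-y : ∀ {x q e} → q < mY → e ≤ KY′ → vertex (y-block q) e ≡ x → depth Y x ≡ q * suc KY′ + suc (KY′ ∸ e)
      depth-y q<mY e≤ ey = trans (cong (depth Y) (sym ey)) (depth-y-block _ _ q<mY e≤)

      next-block : ∀ q K → suc q * suc K + 1 ≡ suc (q * suc K + suc K)
      next-block q K = trans (+-comm (suc q * suc K) 1) (cong suc (+-comm (suc K) (q * suc K)))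

    internal-x : ∀ {x y} → 0 < depth X x → depth X y ≡ suc (depth X x) → PathStep x y ⊎ Crossing y x
    internal-x {x} {y} 0<dx dy with x-block-of x 0<dx
    ... | q , e , q<mX , e≤ , ex with m≤n⇒m<n∨m≡n e≤
    ...   | inj₁ e<pX = inj₁ (x-block q , q<mX , e , e<pX , ex ,
                          trans (cong (node X) (trans (+-suc (q * suc pX) (suc e)) (sym (trans dy (cong suc (depth-x q<mX e≤ ex))))))
                                (node-depth X y (subst (0 <_) (sym dy) z<s)))
    ...   | inj₂ refl = inj₂ (subst₂ Crossing y≡ ex
                          (block-crossing (x-block (suc q)) (x-block q) q+1<mX q<mX (sym (1+[m∸1+n]≡m∸n q+1<mX)) refl 0<pX))
      where
        dy≡ : depth X y ≡ suc q * suc pX + 1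
        dy≡ = trans dy (trans (cong suc (depth-x q<mX e≤ ex)) (sym (next-block q pX)))
        q+1<mX : suc q < mX
        q+1<mX = quotient-< (suc pX) (suc q) 0 mX (subst (_≤ mX * suc pX) dy≡ (subst (depth X y ≤_) N-X (depth≤N X y)))
        y≡ : vertex (x-block (suc q)) 0 ≡ y
        y≡ = trans (cong (node X) (sym dy≡)) (node-depth X y (subst (0 <_) (sym dy) z<s))

    internal-y : ∀ {x y} → 0 < depth Y x → depth Y y ≡ suc (depth Y x) → PathStep y x ⊎ Crossing x y
    internal-y {x} {y} 0<dx dy with y-block-of x 0<dx
    ... | q , zero , q<mY , e≤ , ex = inj₂ (subst₂ Crossing ex y≡
                                     (block-crossing (y-block q) (y-block (suc q)) q<mY q+1<mY (cong suc (+-suc mX q)) refl (m<n⇒0<n∸m pY<M)))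
      where
        dy≡ : depth Y y ≡ suc q * suc KY′ + suc (KY′ ∸ KY′)
        dy≡ = trans dy (trans (cong suc (depth-y q<mY e≤ ex)) (trans (sym (next-block q KY′)) (cong (λ a → suc q * suc KY′ + suc a) (sym (n∸n≡0 KY′)))))
        q+1<mY : suc q < mY
        q+1<mY = quotient-< (suc KY′) (suc q) (KY′ ∸ KY′) mY (subst (_≤ mY * suc KY′) dy≡ (subst (depth Y y ≤_) N-Y (depth≤N Y y)))
        y≡ : vertex (y-block (suc q)) KY′ ≡ y
        y≡ = trans (cong (node Y) (sym dy≡)) (node-depth Y y (subst (0 <_) (sym dy) z<s))
    ... | q , suc e , q<mY , e≤ , ex = inj₁ (y-block q , q<mY , e , e≤ , y≡ , ex)
      where
        y≡ : vertex (y-block q) e ≡ y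
        y≡ = trans (cong (λ a → node Y (q * suc KY′ + suc a)) (sym (1+[m∸1+n]≡m∸n e≤)))
               (trans (cong (node Y) (trans (+-suc (q * suc KY′) (suc (KY′ ∸ suc e))) (sym (trans dy (cong suc (depth-y q<mY e≤ ex))))))
                      (node-depth Y y (subst (0 <_) (sym dy) z<s)))

    line-x : ∀ {x y} → Adj x y → (Σ ℕ λ k → k ≤ M × line k ≡ x) → 0 < depth X y → Crossing y x
    line-x {x} {y} adj (k , k≤ , ex) 0<dy = subst₂ Crossing (trans (cong (node X) (sym dy≡1)) (node-depth X y 0<dy)) (sym x≡zX) x-line-crossing
      where
        dx≡0 : depth X x ≡ 0
        dx≡0 = trans (cong (depth X) (sym ex)) (line∉X k k≤)
        dy≡1 : depth X y ≡ 1
        dy≡1 = ≤-antisym (subst (λ b → depth X y ≤ suc b) dx≡0 (depth-lipschitz X (Adj-sym adj))) 0<dy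
        x≡zX : x ≡ zX
        x≡zX = attached-at-z X (Adj-sym adj) dy≡1 dx≡0

    line-y : ∀ {x y} → Adj x y → (Σ ℕ λ k → k ≤ M × line k ≡ x) → 0 < depth Y y → Crossing x y
    line-y {x} {y} adj (k , k≤ , ex) 0<dy = subst₂ Crossing (sym x≡zY) y≡ line-y-crossing
      where
        dx≡0 : depth Y x ≡ 0
        dx≡0 = trans (cong (depth Y) (sym ex)) (line∉Y k k≤)
        dy≡1 : depth Y y ≡ 1
        dy≡1 = ≤-antisym (subst (λ b → depth Y y ≤ suc b) dx≡0 (depth-lipschitz Y (Adj-sym adj))) 0<dy
        x≡zY : x ≡ zY
        x≡zY = attached-at-z Y (Adj-sym adj) dy≡1 dx≡0
        y≡ : vertex (y-block 0) KY′ ≡ y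
        y≡ = trans (cong (λ a → node Y (suc a)) (n∸n≡0 KY′)) (trans (cong (node Y) (sym dy≡1)) (node-depth Y y 0<dy))

    private
      x-y-apart : ∀ {x y} → Adj x y → 0 < depth X x → 0 < depth Y y → ⊥
      x-y-apart {x} {y} adj 0<dx 0<dy = <⇒≢ 0<dy (sym (trans (cong (depth Y) y≡zX) (trans (cong (depth Y) (sym line-pX)) (line∉Y pX pX≤M))))
        where
          dy≡0 : depth X y ≡ 0
          dy≡0 = Y∉X y 0<dy
          y≡zX : y ≡ zX
          y≡zX = attached-at-z X adj (≤-antisym (subst (λ b → depth X x ≤ suc b) dy≡0 (depth-lipschitz X adj)) 0<dx) dy≡0

    classify : ∀ {x y} → Adj x y → Classified x y
    classify {x} {y} adj with covered x | covered y
    ... | inj₁ (k , k≤ , ex) | inj₁ (k′ , k′≤ , ey) with off-by-one k≤1+k′ k′≤1+k k≢k′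
      where
        k≤1+k′ = subst₂ (λ a b → a ≤ suc b) (trans (cong position (sym ex)) (position-line k k≤)) (trans (cong position (sym ey)) (position-line k′ k′≤))
                   (position-lipschitz adj)
        k′≤1+k = subst₂ (λ a b → a ≤ suc b) (trans (cong position (sym ey)) (position-line k′ k′≤)) (trans (cong position (sym ex)) (position-line k k≤))
                   (position-lipschitz (Adj-sym adj))
        k≢k′ : k ≢ k′
        k≢k′ k≡k′ = irreflexive (subst (Adj x) (trans (sym ey) (trans (cong line (sym k≡k′)) ex)) adj)
    ...   | inj₁ refl = inj₁ (the-line , tt , k , k′≤ , ex , ey)
    ...   | inj₂ refl = inj₂ (inj₁ (the-line , tt , k′ , k≤ , ey , ex))
    classify adj | inj₁ lx | inj₂ (inj₁ py) = inj₂ (inj₂ (inj₂ (line-x adj lx py)))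
    classify adj | inj₁ lx | inj₂ (inj₂ py) = inj₂ (inj₂ (inj₁ (line-y adj lx py)))
    classify adj | inj₂ (inj₁ px) | inj₁ ly = inj₂ (inj₂ (inj₁ (line-x (Adj-sym adj) ly px)))
    classify adj | inj₂ (inj₂ px) | inj₁ ly = inj₂ (inj₂ (inj₂ (line-y (Adj-sym adj) ly px)))
    classify adj | inj₂ (inj₁ px) | inj₂ (inj₂ py) = ⊥-elim (x-y-apart adj px py)
    classify adj | inj₂ (inj₂ px) | inj₂ (inj₁ py) = ⊥-elim (x-y-apart (Adj-sym adj) py px)
    classify adj | inj₂ (inj₁ px) | inj₂ (inj₁ py) with depth-step X adj px
    ... | inj₁ up   = [ inj₁ , (λ c → inj₂ (inj₂ (inj₂ c))) ]′ (internal-x px up)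
    ... | inj₂ down = classified-sym ([ inj₁ , (λ c → inj₂ (inj₂ (inj₂ c))) ]′ (internal-x py down))
    classify adj | inj₂ (inj₂ px) | inj₂ (inj₂ py) with depth-step Y adj px
    ... | inj₁ up   = [ (λ s → inj₂ (inj₁ s)) , (λ c → inj₂ (inj₂ (inj₁ c))) ]′ (internal-y px up)
    ... | inj₂ down = classified-sym ([ (λ s → inj₂ (inj₁ s)) , (λ c → inj₂ (inj₂ (inj₁ c))) ]′ (internal-y py down))

    len′ : Fin count → ℕ
    len′ l = piece-length (piece (toℕ l))

    P′ : (l : Fin count) → Fin (suc (len′ l)) → V
    P′ l i = vertex (piece (toℕ l)) (toℕ i)

    path-of : (t : Piece) → Valid t → Fin count
    path-of t ok = fromℕ< (index< t ok)

    piece-of-path : ∀ t ok → piece (toℕ (path-of t ok)) ≡ t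
    piece-of-path t ok = trans (cong piece (toℕ-fromℕ< (index< t ok))) (piece-index t ok)

    slot : ∀ t ok e → e ≤ piece-length t → Σ (Fin (suc (len′ (path-of t ok)))) λ i → toℕ i ≡ e × P′ (path-of t ok) i ≡ vertex t e
    slot t ok e e≤ = clamp e , toℕ-clamp e e≤′ ,
                     trans (cong (vertex (piece (toℕ (path-of t ok)))) (toℕ-clamp e e≤′)) (cong (λ s → vertex s e) (piece-of-path t ok))
      where e≤′ = subst (λ s → e ≤ piece-length s) (sym (piece-of-path t ok)) e≤

    first-slot : ∀ t ok → P′ (path-of t ok) Fin.zero ≡ vertex t 0
    first-slot t ok = cong (λ s → vertex s 0) (piece-of-path t ok)

    last-slot : ∀ t ok → P′ (path-of t ok) (fromℕ (len′ (path-of t ok))) ≡ vertex t (piece-length t)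
    last-slot t ok = trans (cong (vertex (piece (toℕ (path-of t ok)))) (toℕ-fromℕ _)) (cong (λ s → vertex s (piece-length s)) (piece-of-path t ok))

    PathEdge′ : V → V → Set
    PathEdge′ x y = Σ (Fin count) λ l → Σ (Fin (suc (len′ l))) λ i → Σ (Fin (suc (len′ l))) λ j →
      toℕ j ≡ suc (toℕ i) × ((P′ l i ≡ x × P′ l j ≡ y) ⊎ (P′ l i ≡ y × P′ l j ≡ x))

    CrossEdge′ : V → V → Set
    CrossEdge′ x y = Σ (Fin count) λ l → Σ (Fin count) λ l′ → toℕ l′ ≡ suc (toℕ l) ×
      Σ (Fin (suc (len′ l))) λ i → Σ (Fin (suc (len′ l′))) λ j →
      P′ l i ≡ x × P′ l′ j ≡ y × 0 < toℕ j ×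
      Σ ℕ λ d → Dist (P′ l i) (P′ l (fromℕ (len′ l))) d × Dist (P′ l′ Fin.zero) (P′ l′ j) d

    path-edge : ∀ {x y} → PathStep x y → PathEdge′ x y
    path-edge (t , ok , e , e< , ex , ey) with slot t ok e (<⇒≤ e<) | slot t ok (suc e) e<
    ... | i , toℕi , Pi | j , toℕj , Pj = path-of t ok , i , j , trans toℕj (cong suc (sym toℕi)) , inj₁ (trans Pi ex , trans Pj ey)

    path-edge-sym : ∀ {x y} → PathEdge′ x y → PathEdge′ y x
    path-edge-sym (l , i , j , j≡ , inj₁ (ex , ey)) = l , i , j , j≡ , inj₂ (ex , ey)
    path-edge-sym (l , i , j , j≡ , inj₂ (ey , ex)) = l , i , j , j≡ , inj₁ (ey , ex)

    cross-edge : ∀ {x y} → Crossing x y → CrossEdge′ x y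
    cross-edge (t , t′ , ok , ok′ , idx , e , e′ , e≤ , e′≤ , 0<e′ , ex , ey , d , D , D′) with slot t ok e e≤ | slot t′ ok′ e′ e′≤
    ... | i , toℕi , Pi | j , toℕj , Pj =
      path-of t ok , path-of t′ ok′ , trans (toℕ-fromℕ< _) (trans idx (cong suc (sym (toℕ-fromℕ< _)))) , i , j ,
      trans Pi ex , trans Pj ey , subst (0 <_) (sym toℕj) 0<e′ , d ,
      subst₂ (λ a b → Dist a b d) (sym Pi) (sym (last-slot t ok)) D , subst₂ (λ a b → Dist a b d) (sym (first-slot t′ ok′)) (sym Pj) D′

    private
      placed : ∀ {x} t ok e → e ≤ piece-length t → vertex t e ≡ x → Σ (Fin count) λ l → Σ (Fin (suc (len′ l))) λ i → P′ l i ≡ x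
      placed t ok e e≤ ex with slot t ok e e≤
      ... | i , _ , Pi = path-of t ok , i , trans Pi ex

    cover′ : ∀ x → Σ (Fin count) λ l → Σ (Fin (suc (len′ l))) λ i → P′ l i ≡ x
    cover′ x with covered x
    ... | inj₁ (k , k≤ , ex) = placed the-line tt k k≤ ex
    ... | inj₂ (inj₁ 0<d) with x-block-of x 0<d
    ...   | q , e , q<mX , e≤ , ex = placed (x-block q) q<mX e e≤ ex
    cover′ x | inj₂ (inj₂ 0<d) with y-block-of x 0<d
    ...   | q , e , q<mY , e≤ , ex = placed (y-block q) q<mY e e≤ ex

    disjoint′ : ∀ l l′ (i : Fin (suc (len′ l))) (i′ : Fin (suc (len′ l′))) → P′ l i ≡ P′ l′ i′ →
                _≡_ {A = Σ (Fin count) λ m → Fin (suc (len′ m))} (l , i) (l′ , i′)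
    disjoint′ l l′ i i′ eq with vertex-injective (piece (toℕ l)) (piece (toℕ l′)) (toℕ i) (toℕ i′)
                                  (piece-valid _ (toℕ<n l)) (piece-valid _ (toℕ<n l′)) (toℕ≤pred[n] i) (toℕ≤pred[n] i′) eq
    ... | t≡ , i≡ with toℕ-injective (piece-injective t≡)
    ...   | refl = cong (l ,_) (toℕ-injective i≡)

    path-edges′ : ∀ l (i j : Fin (suc (len′ l))) → toℕ j ≡ suc (toℕ i) → Adj (P′ l i) (P′ l j)
    path-edges′ l i j j≡ = subst (λ a → Adj (P′ l i) (vertex (piece (toℕ l)) a)) (sym j≡)
                             (piece-adjacent _ (toℕ i) (piece-valid _ (toℕ<n l)) (subst (_≤ len′ l) j≡ (toℕ≤pred[n] j)))

    other-edges′ : ∀ x y → Adj x y → PathEdge′ x y ⊎ CrossEdge′ x y ⊎ CrossEdge′ y x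
    other-edges′ x y adj with classify adj
    ... | inj₁ s               = inj₁ (path-edge s)
    ... | inj₂ (inj₁ s)        = inj₁ (path-edge-sym (path-edge s))
    ... | inj₂ (inj₂ (inj₁ c)) = inj₂ (inj₁ (cross-edge c))
    ... | inj₂ (inj₂ (inj₂ c)) = inj₂ (inj₂ (cross-edge c))

    configuration : LinearConfiguration
    configuration = record
      { n           = count
      ; len         = len′
      ; P           = P′
      ; cover       = cover′
      ; disjoint    = disjoint′
      ; path-edges  = path-edges′
      ; other-edges = other-edges′
      }

    open LinearConfiguration configuration using (AdjToPath)

    line-path : Fin count
    line-path = path-of the-line tt

    iX : Fin (suc (len′ line-path))
    iX = proj₁ (slot the-line tt pX pX≤M)

    iY : Fin (suc (len′ line-path))
    iY = proj₁ (slot the-line tt pY (<⇒≤ pY<M))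

    toℕ-iX : toℕ iX ≡ pX
    toℕ-iX = proj₁ (proj₂ (slot the-line tt pX pX≤M))

    toℕ-iY : toℕ iY ≡ pY
    toℕ-iY = proj₁ (proj₂ (slot the-line tt pY (<⇒≤ pY<M)))

    zX-on-line : P′ line-path iX ≡ zX
    zX-on-line = trans (proj₂ (proj₂ (slot the-line tt pX pX≤M))) line-pX

    zY-on-line : P′ line-path iY ≡ zY
    zY-on-line = trans (proj₂ (proj₂ (slot the-line tt pY (<⇒≤ pY<M)))) line-pY

    zX-before : Σ (Fin count) λ l⁻ → suc (toℕ l⁻) ≡ toℕ line-path × AdjToPath (P′ line-path iX) l⁻
    zX-before = path-of (x-block 0) 0<mX ,
                trans (cong suc (toℕ-fromℕ< _)) (trans (1+[m∸1+n]≡m∸n 0<mX) (sym (toℕ-fromℕ< _))) ,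
                Fin.zero , subst₂ Adj (sym zX-on-line) (sym (first-slot (x-block 0) 0<mX))
                             (subst (λ a → Adj a (node X 1)) (node-root X) (node-adjacent X 0 (subst (0 <_) (sym N-X) (≤-trans 0<mX (m≤m*n mX (suc pX))))))

    zY-after : Σ (Fin count) λ l⁺ → toℕ l⁺ ≡ suc (toℕ line-path) × AdjToPath (P′ line-path iY) l⁺
    zY-after with slot (y-block 0) 0<mY KY′ ≤-refl
    ... | j , _ , Pj = path-of (y-block 0) 0<mY ,
                       trans (toℕ-fromℕ< _) (cong suc (trans (+-identityʳ mX) (sym (toℕ-fromℕ< _)))) ,
                       j , subst₂ Adj (sym zY-on-line) (sym Pj)
                             (subst₂ Adj (node-root Y) (cong (λ a → node Y (suc a)) (sym (n∸n≡0 KY′)))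
                               (node-adjacent Y 0 (subst (0 <_) (sym N-Y) (≤-trans 0<mY (m≤m*n mY (suc KY′))))))

module Decompositions {V : Set} (Adj : V → V → Set) (Adj-sym : Symmetric Adj) where
  open Walks Adj Adj-sym
  open PendantPath
  open PendantPathProperties using (extend⁺; extend⁻; extend⁺-lipschitz; extend⁻-lipschitz;
                                    extend⁺-inside; extend⁺-outside; extend⁻-inside; extend⁻-outside)
  open Layouts Adj Adj-sym using (Layout)

  -- Bs and Cs will lie on the line with the spine; Bo and Co will be tiled.
  record HDecomposition : Set where
    field
      z z₂               : V
      r                  : ℕ
      0<r                : 0 < r
      Bs Bo              : PendantPath z
      Cs Co              : PendantPath z₂
      0<N-Bs             : 0 < N Bs
      0<N-Cs             : 0 < N Cs
      spine              : ℕ → V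
      spine-0            : spine 0 ≡ z
      spine-r            : spine r ≡ z₂
      spine-adjacent     : ∀ k → k < r → Adj (spine k) (spine (suc k))
      position           : V → ℕ
      position-lipschitz : Lipschitz position
      position-spine     : ∀ k → k ≤ r → position (spine k) ≡ k
      covered            : ∀ x → 0 < depth Bs x ⊎ 0 < depth Bo x ⊎ 0 < depth Cs x ⊎ 0 < depth Co x ⊎
                                 (position x ≤ r × spine (position x) ≡ x)
      position-Bs        : ∀ x → 0 < depth Bs x → position x ≡ 0
      position-Bo        : ∀ x → 0 < depth Bo x → position x ≡ 0
      position-Cs        : ∀ x → 0 < depth Cs x → position x ≡ r
      position-Co        : ∀ x → 0 < depth Co x → position x ≡ r
      Bs∉Bo              : ∀ x → 0 < depth Bs x → depth Bo x ≡ 0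
      Bo∉Bs              : ∀ x → 0 < depth Bo x → depth Bs x ≡ 0
      Cs∉Co              : ∀ x → 0 < depth Cs x → depth Co x ≡ 0
      Co∉Cs              : ∀ x → 0 < depth Co x → depth Cs x ≡ 0
      irreflexive        : ∀ {x} → Adj x x → ⊥

  module ToLayout (S : HDecomposition) where
    open HDecomposition S

    private
      apart : ∀ {f g : V → ℕ} {a b} → a ≢ b → (∀ x → 0 < f x → position x ≡ a) → (∀ x → 0 < g x → position x ≡ b) →
              ∀ x → 0 < f x → g x ≡ 0
      apart {g = g} a≢b hf hg x 0<fx with g x in gx
      ... | zero  = refl
      ... | suc _ = ⊥-elim (a≢b (trans (sym (hf x 0<fx)) (hg x (subst (0 <_) (sym gx) z<s))))

      0≢r : 0 ≢ r
      0≢r = <⇒≢ 0<r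

      spine-outside : ∀ {c a} (B : PendantPath c) → (∀ x → 0 < depth B x → position x ≡ a) → a ≤ r → spine a ≡ c →
                      ∀ k → k ≤ r → depth B (spine k) ≡ 0
      spine-outside {a = a} B hB a≤r spine-a k k≤r with depth B (spine k) in dk
      ... | zero  = refl
      ... | suc _ = ⊥-elim (1+n≢0 (trans (sym dk) (trans (cong (depth B) (trans (cong spine k≡a) spine-a)) (depth-root B))))
        where
          k≡a : k ≡ a
          k≡a = trans (sym (position-spine k k≤r)) (hB (spine k) (subst (0 <_) (sym dk) z<s))

    Nb Ng M : ℕ
    Nb = N Bs
    Ng = N Cs
    M  = Nb + r + Ng

    line : ℕ → V
    line k with k ≤? Nb
    ... | yes _ = node Bs (Nb ∸ k)
    ... | no _ with k ≤? Nb + r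
    ...   | yes _ = spine (k ∸ Nb)
    ...   | no _  = node Cs (k ∸ (Nb + r))

    line-Bs : ∀ k → k ≤ Nb → line k ≡ node Bs (Nb ∸ k)
    line-Bs k k≤ with k ≤? Nb
    ... | yes _ = refl
    ... | no k≰ = ⊥-elim (k≰ k≤)

    line-spine : ∀ k → Nb ≤ k → k ≤ Nb + r → line k ≡ spine (k ∸ Nb)
    line-spine k Nb≤ k≤ with k ≤? Nb
    ... | yes k≤Nb = trans (cong (node Bs) (m≤n⇒m∸n≡0 (≤-reflexive (≤-antisym Nb≤ k≤Nb))))
                       (trans (node-root Bs) (trans (sym spine-0) (cong spine (sym (m≤n⇒m∸n≡0 k≤Nb)))))
    ... | no _ with k ≤? Nb + r
    ...   | yes _  = refl
    ...   | no k≰ = ⊥-elim (k≰ k≤)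

    line-Cs : ∀ k → Nb + r ≤ k → line k ≡ node Cs (k ∸ (Nb + r))
    line-Cs k Nb+r≤ with k ≤? Nb
    ... | yes k≤Nb = ⊥-elim (<⇒≱ 0<r (+-cancelˡ-≤ Nb r 0 (≤-trans (≤-trans Nb+r≤ k≤Nb) (≤-reflexive (sym (+-identityʳ Nb))))))
    ... | no _ with k ≤? Nb + r
    ...   | yes k≤ = trans (cong spine (trans (cong (_∸ Nb) (≤-antisym k≤ Nb+r≤)) (m+n∸m≡n Nb r)))
                       (trans spine-r (trans (sym (node-root Cs)) (cong (node Cs) (sym (m≤n⇒m∸n≡0 k≤)))))
    ...   | no _   = refl

    line-z : line Nb ≡ z
    line-z = trans (line-Bs Nb ≤-refl) (trans (cong (node Bs) (n∸n≡0 Nb)) (node-root Bs))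

    line-z₂ : line (Nb + r) ≡ z₂
    line-z₂ = trans (line-spine (Nb + r) (m≤m+n Nb r) ≤-refl) (trans (cong spine (m+n∸m≡n Nb r)) spine-r)

    private
      position-z : position z ≡ 0
      position-z = trans (cong position (sym spine-0)) (position-spine 0 z≤n)

      position-z₂ : position z₂ ≡ r
      position-z₂ = trans (cong position (sym spine-r)) (position-spine r ≤-refl)

      z₂∉Bs : depth Bs z₂ ≡ 0
      z₂∉Bs = subst (λ a → depth Bs a ≡ 0) spine-r (spine-outside Bs position-Bs z≤n spine-0 r ≤-refl)

      Cs-bound : ∀ k → k ≤ M → k ∸ (Nb + r) ≤ Ng
      Cs-bound k k≤M = subst (k ∸ (Nb + r) ≤_) (m+n∸m≡n (Nb + r) Ng) (∸-monoˡ-≤ (Nb + r) k≤M)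

      spine-bound : ∀ k → k ≤ Nb + r → k ∸ Nb ≤ r
      spine-bound k k≤ = subst (k ∸ Nb ≤_) (m+n∸m≡n Nb r) (∸-monoˡ-≤ Nb k≤)

      depth-line-Bs : ∀ k → k < Nb → depth Bs (line k) ≡ Nb ∸ k
      depth-line-Bs k k< = trans (cong (depth Bs) (line-Bs k (<⇒≤ k<))) (depth-node Bs (Nb ∸ k) (m∸n≤m Nb k))

      depth-line-Cs : ∀ k → Nb + r < k → k ≤ M → depth Cs (line k) ≡ k ∸ (Nb + r)
      depth-line-Cs k <k k≤M = trans (cong (depth Cs) (line-Cs k (<⇒≤ <k))) (depth-node Cs (k ∸ (Nb + r)) (Cs-bound k k≤M))

      Segment : ℕ → Set
      Segment k = k < Nb ⊎ (Nb ≤ k × k ≤ Nb + r) ⊎ Nb + r < k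

      segment : ∀ k → Segment k
      segment k with k <? Nb
      ... | yes k<Nb = inj₁ k<Nb
      ... | no k≮Nb with k ≤? Nb + r
      ...   | yes k≤ = inj₂ (inj₁ (≮⇒≥ k≮Nb , k≤))
      ...   | no k≰  = inj₂ (inj₂ (≰⇒> k≰))

      Segment⁺ : ℕ → Set
      Segment⁺ k = k < Nb ⊎ (Nb ≤ k × k < Nb + r) ⊎ Nb + r ≤ k

      segment⁺ : ∀ k → Segment⁺ k
      segment⁺ k with k <? Nb
      ... | yes k<Nb = inj₁ k<Nb
      ... | no k≮Nb with k <? Nb + r
      ...   | yes k<  = inj₂ (inj₁ (≮⇒≥ k≮Nb , k<))
      ...   | no k≮   = inj₂ (inj₂ (≮⇒≥ k≮))

    -- The line position: Nb ∸ depth on Bs, Nb + position on the spine, Nb + r + depth on Cs.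
    line-position : V → ℕ
    line-position = extend⁺ Cs (extend⁻ Bs (λ x → Nb + position x) Nb) (Nb + r)

    line-position-lipschitz : Lipschitz line-position
    line-position-lipschitz =
      extend⁺-lipschitz Cs _ (Nb + r)
        (extend⁻-lipschitz Bs _ Nb (λ {x} {y} e → ≤-trans (+-monoʳ-≤ Nb (position-lipschitz e)) (≤-reflexive (+-suc Nb (position y))))
                               (trans (cong (Nb +_) position-z) (+-identityʳ Nb)))
        (trans (extend⁻-outside Bs _ Nb z₂ z₂∉Bs) (cong (Nb +_) position-z₂))

    line-position-line : ∀ k → k ≤ M → line-position (line k) ≡ k
    line-position-line k k≤M with segment k
    ... | inj₁ k<Nb =
          trans (extend⁺-outside Cs _ (Nb + r) (line k) (apart 0≢r position-Bs position-Cs (line k) 0<d))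
                (trans (extend⁻-inside Bs _ Nb (line k) 0<d) (trans (cong (Nb ∸_) (depth-line-Bs k k<Nb)) (m∸[m∸n]≡n (<⇒≤ k<Nb))))
      where 0<d = subst (0 <_) (sym (depth-line-Bs k k<Nb)) (m<n⇒0<n∸m k<Nb)
    ... | inj₂ (inj₁ (Nb≤ , k≤)) =
          trans (cong line-position (line-spine k Nb≤ k≤))
                (trans (extend⁺-outside Cs _ (Nb + r) _ (spine-outside Cs position-Cs ≤-refl spine-r (k ∸ Nb) (spine-bound k k≤)))
                (trans (extend⁻-outside Bs _ Nb _ (spine-outside Bs position-Bs z≤n spine-0 (k ∸ Nb) (spine-bound k k≤)))
                (trans (cong (Nb +_) (position-spine (k ∸ Nb) (spine-bound k k≤))) (m+[n∸m]≡n Nb≤))))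
    ... | inj₂ (inj₂ <k) =
          trans (extend⁺-inside Cs _ (Nb + r) (line k) 0<d) (trans (cong ((Nb + r) +_) (depth-line-Cs k <k k≤M)) (m+[n∸m]≡n (<⇒≤ <k)))
      where 0<d = subst (0 <_) (sym (depth-line-Cs k <k k≤M)) (m<n⇒0<n∸m <k)

    line-adjacent : ∀ k → k < M → Adj (line k) (line (suc k))
    line-adjacent k k<M with segment⁺ k
    ... | inj₁ k<Nb = subst₂ Adj (sym (line-Bs k (<⇒≤ k<Nb))) (sym (line-Bs (suc k) k<Nb))
                       (Adj-sym (subst (λ a → Adj (node Bs (Nb ∸ suc k)) (node Bs a)) (1+[m∸1+n]≡m∸n k<Nb)
                          (node-adjacent Bs (Nb ∸ suc k) (subst (_≤ Nb) (sym (1+[m∸1+n]≡m∸n k<Nb)) (m∸n≤m Nb k)))))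
    ... | inj₂ (inj₁ (Nb≤ , k<)) = subst₂ Adj (sym (line-spine k Nb≤ (<⇒≤ k<))) (sym (line-spine (suc k) (≤-trans Nb≤ (n≤1+n k)) k<))
                       (subst (λ a → Adj (spine (k ∸ Nb)) (spine a)) (sym (+-∸-assoc 1 Nb≤))
                         (spine-adjacent (k ∸ Nb) (subst (_≤ r) (+-∸-assoc 1 Nb≤) (spine-bound (suc k) k<))))
    ... | inj₂ (inj₂ ≤k) = subst₂ Adj (sym (line-Cs k ≤k)) (sym (line-Cs (suc k) (≤-trans ≤k (n≤1+n k))))
                      (subst (λ a → Adj (node Cs (k ∸ (Nb + r))) (node Cs a)) (sym (+-∸-assoc 1 ≤k))
                        (node-adjacent Cs (k ∸ (Nb + r)) (subst (_≤ Ng) (+-∸-assoc 1 ≤k) (Cs-bound (suc k) k<M))))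

    line∉Bo×Co : ∀ k → k ≤ M → depth Bo (line k) ≡ 0 × depth Co (line k) ≡ 0
    line∉Bo×Co k k≤M with segment k
    ... | inj₁ k<Nb = Bs∉Bo (line k) 0<d , apart 0≢r position-Bs position-Co (line k) 0<d
      where 0<d = subst (0 <_) (sym (depth-line-Bs k k<Nb)) (m<n⇒0<n∸m k<Nb)
    ... | inj₂ (inj₁ (Nb≤ , k≤)) =
          subst (λ a → depth Bo a ≡ 0) (sym (line-spine k Nb≤ k≤)) (spine-outside Bo position-Bo z≤n spine-0 (k ∸ Nb) (spine-bound k k≤)) ,
          subst (λ a → depth Co a ≡ 0) (sym (line-spine k Nb≤ k≤)) (spine-outside Co position-Co ≤-refl spine-r (k ∸ Nb) (spine-bound k k≤))
    ... | inj₂ (inj₂ <k) = apart (0≢r ∘′ sym) position-Cs position-Bo (line k) 0<d , Cs∉Co (line k) 0<d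
      where 0<d = subst (0 <_) (sym (depth-line-Cs k <k k≤M)) (m<n⇒0<n∸m <k)

    line-covers : ∀ x → (Σ ℕ λ k → k ≤ M × line k ≡ x) ⊎ 0 < depth Bo x ⊎ 0 < depth Co x
    line-covers x with covered x
    ... | inj₁ 0<d = inj₁ (Nb ∸ depth Bs x , ≤-trans (m∸n≤m Nb (depth Bs x)) (≤-trans (m≤m+n Nb r) (m≤m+n (Nb + r) Ng)) ,
                           trans (line-Bs _ (m∸n≤m Nb (depth Bs x))) (trans (cong (node Bs) (m∸[m∸n]≡n (depth≤N Bs x))) (node-depth Bs x 0<d)))
    ... | inj₂ (inj₁ 0<d) = inj₂ (inj₁ 0<d)
    ... | inj₂ (inj₂ (inj₁ 0<d)) =
          inj₁ (Nb + r + depth Cs x , +-monoʳ-≤ (Nb + r) (depth≤N Cs x) ,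
                trans (line-Cs _ (m≤m+n (Nb + r) _)) (trans (cong (node Cs) (m+n∸m≡n (Nb + r) (depth Cs x))) (node-depth Cs x 0<d)))
    ... | inj₂ (inj₂ (inj₂ (inj₁ 0<d))) = inj₂ (inj₂ 0<d)
    ... | inj₂ (inj₂ (inj₂ (inj₂ (p≤r , spine-p)))) =
          inj₁ (Nb + position x , ≤-trans (+-monoʳ-≤ Nb p≤r) (m≤m+n (Nb + r) Ng) ,
                trans (line-spine _ (m≤m+n Nb _) (+-monoʳ-≤ Nb p≤r)) (trans (cong spine (m+n∸m≡n Nb (position x))) spine-p))

    Bo∉Co : ∀ x → 0 < depth Bo x → depth Co x ≡ 0
    Bo∉Co = apart 0≢r position-Bo position-Co

    Co∉Bo : ∀ x → 0 < depth Co x → depth Bo x ≡ 0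
    Co∉Bo = apart (0≢r ∘′ sym) position-Co position-Bo

    parallel-layout : ∀ mX mY → 0 < mX → 0 < mY → N Bo ≡ mX * suc Nb → N Co ≡ mY * suc (M ∸ (Nb + r)) → Layout
    parallel-layout mX mY 0<mX 0<mY N-Bo N-Co = record
      { M = M ; line = line ; position = line-position ; position-lipschitz = line-position-lipschitz
      ; position-line = line-position-line ; line-adjacent = line-adjacent
      ; pX = Nb ; pY = Nb + r ; 0<pX = 0<N-Bs ; pX≤M = ≤-trans (m≤m+n Nb r) (m≤m+n (Nb + r) Ng) ; pY<M = m<m+n (Nb + r) 0<N-Cs
      ; zX = z ; zY = z₂ ; line-pX = line-z ; line-pY = line-z₂ ; X = Bo ; Y = Co
      ; mX = mX ; mY = mY ; 0<mX = 0<mX ; 0<mY = 0<mY ; N-X = N-Bo ; N-Y = N-Co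
      ; covered = line-covers
      ; line∉X = λ k k≤ → proj₁ (line∉Bo×Co k k≤) ; line∉Y = λ k k≤ → proj₂ (line∉Bo×Co k k≤)
      ; X∉Y = Bo∉Co ; Y∉X = Co∉Bo ; irreflexive = irreflexive }

    crossed-layout : ∀ mX mY → 0 < mX → 0 < mY → N Co ≡ mX * suc (Nb + r) → N Bo ≡ mY * suc (M ∸ Nb) → Layout
    crossed-layout mX mY 0<mX 0<mY N-Co N-Bo = record
      { M = M ; line = line ; position = line-position ; position-lipschitz = line-position-lipschitz
      ; position-line = line-position-line ; line-adjacent = line-adjacent
      ; pX = Nb + r ; pY = Nb ; 0<pX = ≤-trans 0<r (m≤n+m r Nb) ; pX≤M = m≤m+n (Nb + r) Ng
      ; pY<M = ≤-trans (m<m+n Nb 0<r) (m≤m+n (Nb + r) Ng)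
      ; zX = z₂ ; zY = z ; line-pX = line-z₂ ; line-pY = line-z ; X = Co ; Y = Bo
      ; mX = mX ; mY = mY ; 0<mX = 0<mX ; 0<mY = 0<mY ; N-X = N-Co ; N-Y = N-Bo
      ; covered = λ x → [ inj₁ , (λ c → inj₂ (Data.Sum.swap c)) ]′ (line-covers x)
      ; line∉X = λ k k≤ → proj₂ (line∉Bo×Co k k≤) ; line∉Y = λ k k≤ → proj₁ (line∉Bo×Co k k≤)
      ; X∉Y = Co∉Bo ; Y∉X = Bo∉Co ; irreflexive = irreflexive }

-- Trees of type H

-- f p is the depth of position p of the path 0 … S in the pendant path hanging off position c on one side; g inverts f.
record SideProfile (c S : ℕ) (f g : ℕ → ℕ) (K : ℕ) : Set where
  field
    f-c        : f c ≡ 0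
    f-g        : ∀ k → k ≤ K → f (g k) ≡ k
    g≤S        : ∀ k → k ≤ K → g k ≤ S
    g-f        : ∀ p → p ≤ S → 0 < f p → g (f p) ≡ p
    f≤K        : ∀ p → p ≤ S → f p ≤ K
    f-step⁺    : ∀ p → f p ≤ suc (f (suc p))
    f-step⁻    : ∀ p → f (suc p) ≤ suc (f p)
    f-flat     : ∀ p → f p ≡ f (suc p) → f p ≡ 0
    f-attached : ∀ p q → f p ≡ 1 → f q ≡ 0 → (q ≡ suc p ⊎ p ≡ suc q) → q ≡ c
    g-adjacent : ∀ k → k < K → g (suc k) ≡ suc (g k) ⊎ g k ≡ suc (g (suc k))
    g-0        : g 0 ≡ c

below-profile : ∀ c S → c ≤ S → SideProfile c S (c ∸_) (c ∸_) c
below-profile c S c≤S = record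
  { f-c        = n∸n≡0 c
  ; f-g        = λ k k≤ → m∸[m∸n]≡n k≤
  ; g≤S        = λ k _ → ≤-trans (m∸n≤m c k) c≤S
  ; g-f        = λ p _ 0<f → m∸[m∸n]≡n (<⇒≤ (0<m∸n⇒n<m {c} {p} 0<f))
  ; f≤K        = λ p _ → m∸n≤m c p
  ; f-step⁺    = m∸n≤1+m∸1+n c
  ; f-step⁻    = λ p → ≤-trans (∸-monoʳ-≤ c (n≤1+n p)) (n≤1+n _)
  ; f-flat     = flat c
  ; f-attached = attached c
  ; g-adjacent = λ k k< → inj₂ (sym (1+[m∸1+n]≡m∸n k<))
  ; g-0        = refl
  }
  where
    flat : ∀ c p → c ∸ p ≡ c ∸ suc p → c ∸ p ≡ 0
    flat zero    p       _ = 0∸n≡0 p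
    flat (suc c) zero    e = ⊥-elim (1+n≢n e)
    flat (suc c) (suc p) e = flat c p e

    ∸≡1 : ∀ c p → c ∸ p ≡ 1 → c ≡ suc p
    ∸≡1 (suc c) zero    refl = refl
    ∸≡1 (suc c) (suc p) e    = cong suc (∸≡1 c p e)

    attached : ∀ c p q → c ∸ p ≡ 1 → c ∸ q ≡ 0 → (q ≡ suc p ⊎ p ≡ suc q) → q ≡ c
    attached c p q e1 e0 (inj₁ refl) = sym (∸≡1 c p e1)
    attached c p q e1 e0 (inj₂ refl) = ⊥-elim (1+n≢0 (trans (sym c∸q≡2) e0))
      where
        c∸q≡2 : c ∸ q ≡ 2
        c∸q≡2 = trans (cong (_∸ q) (∸≡1 c (suc q) e1)) (m+n∸n≡m 2 q)

above-profile : ∀ c S → c ≤ S → SideProfile c S (_∸ c) (c +_) (S ∸ c)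
above-profile c S c≤S = record
  { f-c        = n∸n≡0 c
  ; f-g        = λ k _ → m+n∸m≡n c k
  ; g≤S        = λ k k≤ → ≤-trans (+-monoʳ-≤ c k≤) (≤-reflexive (m+[n∸m]≡n c≤S))
  ; g-f        = λ p _ 0<f → m+[n∸m]≡n (<⇒≤ (0<m∸n⇒n<m {p} {c} 0<f))
  ; f≤K        = λ p p≤ → ∸-monoˡ-≤ c p≤
  ; f-step⁺    = λ p → ≤-trans (∸-monoˡ-≤ c (n≤1+n p)) (n≤1+n _)
  ; f-step⁻    = step⁻ c
  ; f-flat     = flat c
  ; f-attached = attached c
  ; g-adjacent = λ k _ → inj₁ (+-suc c k)
  ; g-0        = +-identityʳ c
  }
  where
    step⁻ : ∀ c p → suc p ∸ c ≤ suc (p ∸ c)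
    step⁻ zero          p       = ≤-refl
    step⁻ (suc zero)    zero    = z≤n
    step⁻ (suc (suc c)) zero    = z≤n
    step⁻ (suc c)       (suc p) = step⁻ c p

    flat : ∀ c p → p ∸ c ≡ suc p ∸ c → p ∸ c ≡ 0
    flat zero    p       ()
    flat (suc c) zero    _ = refl
    flat (suc c) (suc p) e = flat c p e

    ∸≡1 : ∀ c p → p ∸ c ≡ 1 → p ≡ suc c
    ∸≡1 zero    p       e = e
    ∸≡1 (suc c) (suc p) e = cong suc (∸≡1 c p e)

    attached : ∀ c p q → p ∸ c ≡ 1 → q ∸ c ≡ 0 → (q ≡ suc p ⊎ p ≡ suc q) → q ≡ c
    attached c p q e1 e0 (inj₁ refl) with ∸≡1 c p e1
    ... | refl = ⊥-elim (<⇒≱ (n≤1+n (suc c)) (m∸n≡0⇒m≤n e0))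
    attached c p q e1 e0 (inj₂ refl) = suc-injective (∸≡1 c (suc q) e1)

-- Positions are 0-based: a₀ = a − 1 is the index of u_a among u 0 … u s′, and similarly for b₀, s′, t′, r′.
module HTree (s′ t′ r′ a₀ b₀ : ℕ) (0<a₀ : 0 < a₀) (a₀<s′ : a₀ < s′) (0<b₀ : 0 < b₀) (b₀<t′ : b₀ < t′) where

  V : Set
  V = HVertex (suc s′) (suc t′) (suc r′)

  Edge : V → V → Set
  Edge = HEdge (suc s′) (suc t′) (suc r′) (suc a₀) (suc b₀)

  Adj : V → V → Set
  Adj = HAdj (suc s′) (suc t′) (suc r′) (suc a₀) (suc b₀)

  Adj-sym : Symmetric Adj
  Adj-sym (inj₁ e) = inj₂ e
  Adj-sym (inj₂ e) = inj₁ e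

  open Walks Adj Adj-sym
  open PendantPath

  ua vb : V
  ua = u (clamp a₀)
  vb = v (clamp b₀)

  toℕ-a₀ : toℕ (clamp {s′} a₀) ≡ a₀
  toℕ-a₀ = toℕ-clamp a₀ (<⇒≤ a₀<s′)

  toℕ-b₀ : toℕ (clamp {t′} b₀) ≡ b₀
  toℕ-b₀ = toℕ-clamp b₀ (<⇒≤ b₀<t′)

  u≡ua : ∀ {i : Fin (suc s′)} → toℕ i ≡ a₀ → u i ≡ ua
  u≡ua e = cong u (toℕ-injective (trans e (sym toℕ-a₀)))

  v≡vb : ∀ {j : Fin (suc t′)} → toℕ j ≡ b₀ → v j ≡ vb
  v≡vb e = cong v (toℕ-injective (trans e (sym toℕ-b₀)))

  private
    both-ways : ∀ {h : V → ℕ} → (∀ {x y} → Edge x y → h x ≤ suc (h y) × h y ≤ suc (h x)) → Lipschitz h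
    both-ways h-edge (inj₁ e) = proj₁ (h-edge e)
    both-ways h-edge (inj₂ e) = proj₂ (h-edge e)

  module OnU (f g : ℕ → ℕ) (K : ℕ) (prof : SideProfile a₀ s′ f g K) where
    open SideProfile prof

    depthᵤ : V → ℕ
    depthᵤ (u i) = f (toℕ i)
    depthᵤ (v _) = 0
    depthᵤ (w _) = 0

    private
      f-a : ∀ {i : Fin (suc s′)} → suc (toℕ i) ≡ suc a₀ → f (toℕ i) ≡ 0
      f-a e = trans (cong f (suc-injective e)) f-c

      lipschitz-edge : ∀ {x y} → Edge x y → depthᵤ x ≤ suc (depthᵤ y) × depthᵤ y ≤ suc (depthᵤ x)
      lipschitz-edge (uu {i} eq) = subst (λ m → f (toℕ i) ≤ suc (f m)) (sym eq) (f-step⁺ (toℕ i)) ,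
                                    subst (λ m → f m ≤ suc (f (toℕ i))) (sym eq) (f-step⁻ (toℕ i))
      lipschitz-edge (vv _)        = z≤n , z≤n
      lipschitz-edge (ww _)        = z≤n , z≤n
      lipschitz-edge (uw p _)      = subst (_≤ 1) (sym (f-a p)) z≤n , z≤n
      lipschitz-edge (wv _ _)      = z≤n , z≤n
      lipschitz-edge (uv _ p _)    = subst (_≤ 1) (sym (f-a p)) z≤n , z≤n

      flat-edge : ∀ {x y} → Edge x y → (depthᵤ x ≡ depthᵤ y → depthᵤ x ≡ 0) × (depthᵤ y ≡ depthᵤ x → depthᵤ y ≡ 0)
      flat-edge (uu {i} eq) = (λ e → f-flat (toℕ i) (subst (λ m → f (toℕ i) ≡ f m) eq e)) ,
                               (λ e → trans e (f-flat (toℕ i) (sym (subst (λ m → f m ≡ f (toℕ i)) eq e))))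
      flat-edge (vv _)        = (λ _ → refl) , (λ _ → refl)
      flat-edge (ww _)        = (λ _ → refl) , (λ _ → refl)
      flat-edge (uw p _)      = (λ _ → f-a p) , (λ _ → refl)
      flat-edge (wv _ _)      = (λ _ → refl) , (λ _ → refl)
      flat-edge (uv _ p _)    = (λ _ → f-a p) , (λ _ → refl)

      attached-edge : ∀ {x y} → Edge x y → (depthᵤ x ≡ 1 → depthᵤ y ≡ 0 → y ≡ ua) × (depthᵤ y ≡ 1 → depthᵤ x ≡ 0 → x ≡ ua)
      attached-edge (uu {i} {j} eq) = (λ e1 e0 → u≡ua (f-attached (toℕ i) (toℕ j) e1 e0 (inj₁ eq))) ,
                                      (λ e1 e0 → u≡ua (f-attached (toℕ j) (toℕ i) e1 e0 (inj₂ eq)))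
      attached-edge (vv _)     = (λ ()) , (λ ())
      attached-edge (ww _)     = (λ ()) , (λ ())
      attached-edge (uw p _)   = (λ e _ → ⊥-elim (0≢1+n (trans (sym (f-a p)) e))) , (λ ())
      attached-edge (wv _ _)   = (λ ()) , (λ ())
      attached-edge (uv _ p _) = (λ e _ → ⊥-elim (0≢1+n (trans (sym (f-a p)) e))) , (λ ())

      g-bounded : ∀ k → k ≤ K → toℕ (clamp {s′} (g k)) ≡ g k
      g-bounded k k≤ = toℕ-clamp (g k) (g≤S k k≤)

    pendant : PendantPath ua
    pendant = record
      { N = K ; depth = depthᵤ ; node = λ k → u (clamp (g k))
      ; depth-root = trans (cong f toℕ-a₀) f-c
      ; node-root = cong (λ m → u (clamp m)) g-0
      ; depth-node = λ k k≤ → trans (cong f (g-bounded k k≤)) (f-g k k≤)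
      ; node-depth = λ { (u i) 0<d → cong u (trans (cong clamp (g-f (toℕ i) (toℕ≤pred[n] i) 0<d)) (clamp-toℕ i)) }
      ; depth≤N = λ { (u i) → f≤K (toℕ i) (toℕ≤pred[n] i) ; (v _) → z≤n ; (w _) → z≤n }
      ; depth-lipschitz = both-ways lipschitz-edge
      ; depth-flat = λ { (inj₁ e) → proj₁ (flat-edge e) ; (inj₂ e) → proj₂ (flat-edge e) }
      ; attached-at-z = λ { (inj₁ e) → proj₁ (attached-edge e) ; (inj₂ e) → proj₂ (attached-edge e) }
      ; node-adjacent = adjacent
      }
      where
        adjacent : ∀ k → k < K → Adj (u (clamp (g k))) (u (clamp (g (suc k))))
        adjacent k k< with g-adjacent k k<
        ... | inj₁ e = inj₁ (uu (trans (g-bounded (suc k) k<) (trans e (cong suc (sym (g-bounded k (<⇒≤ k<)))))))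
        ... | inj₂ e = inj₂ (uu (trans (g-bounded k (<⇒≤ k<)) (trans e (cong suc (sym (g-bounded (suc k) k<))))))

  module OnV (f g : ℕ → ℕ) (K : ℕ) (prof : SideProfile b₀ t′ f g K) where
    open SideProfile prof

    depthᵥ : V → ℕ
    depthᵥ (u _) = 0
    depthᵥ (v j) = f (toℕ j)
    depthᵥ (w _) = 0

    private
      f-b : ∀ {j : Fin (suc t′)} → suc (toℕ j) ≡ suc b₀ → f (toℕ j) ≡ 0
      f-b e = trans (cong f (suc-injective e)) f-c

      lipschitz-edge : ∀ {x y} → Edge x y → depthᵥ x ≤ suc (depthᵥ y) × depthᵥ y ≤ suc (depthᵥ x)
      lipschitz-edge (vv {i} eq) = subst (λ m → f (toℕ i) ≤ suc (f m)) (sym eq) (f-step⁺ (toℕ i)) ,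
                                    subst (λ m → f m ≤ suc (f (toℕ i))) (sym eq) (f-step⁻ (toℕ i))
      lipschitz-edge (uu _)        = z≤n , z≤n
      lipschitz-edge (ww _)        = z≤n , z≤n
      lipschitz-edge (uw _ _)      = z≤n , z≤n
      lipschitz-edge (wv _ q)      = z≤n , subst (_≤ 1) (sym (f-b q)) z≤n
      lipschitz-edge (uv _ _ q)    = z≤n , subst (_≤ 1) (sym (f-b q)) z≤n

      flat-edge : ∀ {x y} → Edge x y → (depthᵥ x ≡ depthᵥ y → depthᵥ x ≡ 0) × (depthᵥ y ≡ depthᵥ x → depthᵥ y ≡ 0)
      flat-edge (vv {i} eq) = (λ e → f-flat (toℕ i) (subst (λ m → f (toℕ i) ≡ f m) eq e)) ,
                               (λ e → trans e (f-flat (toℕ i) (sym (subst (λ m → f m ≡ f (toℕ i)) eq e))))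
      flat-edge (uu _)        = (λ _ → refl) , (λ _ → refl)
      flat-edge (ww _)        = (λ _ → refl) , (λ _ → refl)
      flat-edge (uw _ _)      = (λ _ → refl) , (λ _ → refl)
      flat-edge (wv _ q)      = (λ _ → refl) , (λ _ → f-b q)
      flat-edge (uv _ _ q)    = (λ _ → refl) , (λ _ → f-b q)

      attached-edge : ∀ {x y} → Edge x y → (depthᵥ x ≡ 1 → depthᵥ y ≡ 0 → y ≡ vb) × (depthᵥ y ≡ 1 → depthᵥ x ≡ 0 → x ≡ vb)
      attached-edge (vv {i} {j} eq) = (λ e1 e0 → v≡vb (f-attached (toℕ i) (toℕ j) e1 e0 (inj₁ eq))) ,
                                      (λ e1 e0 → v≡vb (f-attached (toℕ j) (toℕ i) e1 e0 (inj₂ eq)))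
      attached-edge (uu _)     = (λ ()) , (λ ())
      attached-edge (ww _)     = (λ ()) , (λ ())
      attached-edge (uw _ _)   = (λ ()) , (λ ())
      attached-edge (wv _ q)   = (λ ()) , (λ e _ → ⊥-elim (0≢1+n (trans (sym (f-b q)) e)))
      attached-edge (uv _ _ q) = (λ ()) , (λ e _ → ⊥-elim (0≢1+n (trans (sym (f-b q)) e)))

      g-bounded : ∀ k → k ≤ K → toℕ (clamp {t′} (g k)) ≡ g k
      g-bounded k k≤ = toℕ-clamp (g k) (g≤S k k≤)

    pendant : PendantPath vb
    pendant = record
      { N = K ; depth = depthᵥ ; node = λ k → v (clamp (g k))
      ; depth-root = trans (cong f toℕ-b₀) f-c
      ; node-root = cong (λ m → v (clamp m)) g-0
      ; depth-node = λ k k≤ → trans (cong f (g-bounded k k≤)) (f-g k k≤)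
      ; node-depth = λ { (v j) 0<d → cong v (trans (cong clamp (g-f (toℕ j) (toℕ≤pred[n] j) 0<d)) (clamp-toℕ j)) }
      ; depth≤N = λ { (u _) → z≤n ; (v j) → f≤K (toℕ j) (toℕ≤pred[n] j) ; (w _) → z≤n }
      ; depth-lipschitz = both-ways lipschitz-edge
      ; depth-flat = λ { (inj₁ e) → proj₁ (flat-edge e) ; (inj₂ e) → proj₂ (flat-edge e) }
      ; attached-at-z = λ { (inj₁ e) → proj₁ (attached-edge e) ; (inj₂ e) → proj₂ (attached-edge e) }
      ; node-adjacent = adjacent
      }
      where
        adjacent : ∀ k → k < K → Adj (v (clamp (g k))) (v (clamp (g (suc k))))
        adjacent k k< with g-adjacent k k<
        ... | inj₁ e = inj₁ (vv (trans (g-bounded (suc k) k<) (trans e (cong suc (sym (g-bounded k (<⇒≤ k<)))))))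
        ... | inj₂ e = inj₂ (vv (trans (g-bounded k (<⇒≤ k<)) (trans e (cong suc (sym (g-bounded (suc k) k<))))))

  u-below u-above : PendantPath ua
  u-below = OnU.pendant (a₀ ∸_) (a₀ ∸_) a₀ (below-profile a₀ s′ (<⇒≤ a₀<s′))
  u-above = OnU.pendant (_∸ a₀) (a₀ +_) (s′ ∸ a₀) (above-profile a₀ s′ (<⇒≤ a₀<s′))

  v-below v-above : PendantPath vb
  v-below = OnV.pendant (b₀ ∸_) (b₀ ∸_) b₀ (below-profile b₀ t′ (<⇒≤ b₀<t′))
  v-above = OnV.pendant (_∸ b₀) (b₀ +_) (t′ ∸ b₀) (above-profile b₀ t′ (<⇒≤ b₀<t′))

  -- The spine u_a = w_1, w_2, …, w_{r+1} = v_b, indexed by 0 … r′+1.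
  spine-vertex : ℕ → V
  spine-vertex zero    = ua
  spine-vertex (suc k) with k <? r′
  ... | yes k<r′ = w (fromℕ< k<r′)
  ... | no _     = vb

  spine-position : V → ℕ
  spine-position (u _) = 0
  spine-position (w k) = suc (toℕ k)
  spine-position (v _) = suc r′

  private
    spine-w : ∀ k (k<r′ : k < r′) → spine-vertex (suc k) ≡ w (fromℕ< k<r′)
    spine-w k k<r′ with k <? r′
    ... | yes _   = cong w (toℕ-injective (trans (toℕ-fromℕ< _) (sym (toℕ-fromℕ< k<r′))))
    ... | no k≮r′ = ⊥-elim (k≮r′ k<r′)

    spine-end : ∀ k → r′ ≤ k → spine-vertex (suc k) ≡ vb
    spine-end k r′≤k with k <? r′
    ... | yes k<r′ = ⊥-elim (<⇒≱ k<r′ r′≤k)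
    ... | no _     = refl

    w-index : ∀ {k : Fin r′} {r} → toℕ k + 2 ≡ r → suc (toℕ k) ≡ pred r
    w-index {k} e = cong pred (trans (+-comm 2 (toℕ k)) e)

  spine-z₂ : spine-vertex (suc r′) ≡ vb
  spine-z₂ = spine-end r′ ≤-refl

  spine-position-lipschitz : Lipschitz spine-position
  spine-position-lipschitz = both-ways edge
    where
      edge : ∀ {x y} → Edge x y → spine-position x ≤ suc (spine-position y) × spine-position y ≤ suc (spine-position x)
      edge (uu _)           = z≤n , z≤n
      edge (vv _)           = n≤1+n _ , n≤1+n _
      edge (ww {i} {j} eq)  = s≤s (≤-trans (n≤1+n (toℕ i)) (≤-trans (≤-reflexive (sym eq)) (n≤1+n (toℕ j)))) , s≤s (≤-reflexive eq)
      edge (uw _ q)         = z≤n , s≤s (≤-reflexive q)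
      edge (wv {k} p _)     = ≤-trans (≤-reflexive (w-index p)) (≤-trans (n≤1+n r′) (n≤1+n _)) , ≤-reflexive (cong suc (sym (w-index p)))
      edge (uv r≡1 _ _)     = z≤n , ≤-reflexive r≡1

  position-spine : ∀ k → k ≤ suc r′ → spine-position (spine-vertex k) ≡ k
  position-spine zero    _ = refl
  position-spine (suc k) k≤ with k <? r′
  ... | yes k<r′ = cong suc (toℕ-fromℕ< k<r′)
  ... | no k≮r′  = cong suc (≤-antisym (≮⇒≥ k≮r′) (s≤s⁻¹ k≤))

  spine-adjacent : ∀ k → k < suc r′ → Adj (spine-vertex k) (spine-vertex (suc k))
  spine-adjacent zero _ with 0 <? r′
  ... | yes 0<r′ = inj₁ (uw (cong suc toℕ-a₀) (toℕ-fromℕ< 0<r′))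
  ... | no 0≮r′  = inj₁ (uv (cong suc (n≤0⇒n≡0 (≮⇒≥ 0≮r′))) (cong suc toℕ-a₀) (cong suc toℕ-b₀))
  spine-adjacent (suc k) k< with k <? r′ | suc k <? r′
  ... | yes k<r′ | yes k+1<r′ = inj₁ (ww (trans (toℕ-fromℕ< k+1<r′) (cong suc (sym (toℕ-fromℕ< k<r′)))))
  ... | yes k<r′ | no k+1≮r′  = inj₁ (wv (trans (cong (_+ 2) (toℕ-fromℕ< k<r′)) (trans (+-comm k 2) (cong suc (≤-antisym k<r′ (≮⇒≥ k+1≮r′)))))
                                     (cong suc toℕ-b₀))
  ... | no k≮r′ | _           = ⊥-elim (k≮r′ (s≤s⁻¹ k<))

  spine-walk : Walk ua vb (suc r′)
  spine-walk = subst (λ a → Walk ua a (suc r′)) spine-z₂ (walk-to (suc r′) ≤-refl)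
    where
      walk-to : ∀ k → k ≤ suc r′ → Walk ua (spine-vertex k) k
      walk-to zero    _  = here
      walk-to (suc k) k≤ = subst (Walk ua (spine-vertex (suc k))) (+-comm k 1)
                             (walk-to k (≤-trans (n≤1+n k) k≤) ++ʷ step (spine-adjacent k k≤) here)

  irreflexive : ∀ {x} → Adj x x → ⊥
  irreflexive (inj₁ (uu {i} eq)) = 1+n≢n (sym eq)
  irreflexive (inj₁ (vv {i} eq)) = 1+n≢n (sym eq)
  irreflexive (inj₁ (ww {i} eq)) = 1+n≢n (sym eq)
  irreflexive (inj₂ (uu {i} eq)) = 1+n≢n (sym eq)
  irreflexive (inj₂ (vv {i} eq)) = 1+n≢n (sym eq)
  irreflexive (inj₂ (ww {i} eq)) = 1+n≢n (sym eq)

  OnSpine : V → Set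
  OnSpine x = spine-position x ≤ suc r′ × spine-vertex (spine-position x) ≡ x

  covered : ∀ x → 0 < depth u-below x ⊎ 0 < depth u-above x ⊎ 0 < depth v-below x ⊎ 0 < depth v-above x ⊎ OnSpine x
  covered (u i) with <-cmp (toℕ i) a₀
  ... | tri< i<a₀ _ _ = inj₁ (m<n⇒0<n∸m i<a₀)
  ... | tri≈ _ i≡a₀ _ = inj₂ (inj₂ (inj₂ (inj₂ (z≤n , sym (u≡ua i≡a₀)))))
  ... | tri> _ _ a₀<i = inj₂ (inj₁ (m<n⇒0<n∸m a₀<i))
  covered (v j) with <-cmp (toℕ j) b₀
  ... | tri< j<b₀ _ _ = inj₂ (inj₂ (inj₁ (m<n⇒0<n∸m j<b₀)))
  ... | tri≈ _ j≡b₀ _ = inj₂ (inj₂ (inj₂ (inj₂ (≤-refl , trans spine-z₂ (sym (v≡vb j≡b₀))))))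
  ... | tri> _ _ b₀<j = inj₂ (inj₂ (inj₂ (inj₁ (m<n⇒0<n∸m b₀<j))))
  covered (w k) = inj₂ (inj₂ (inj₂ (inj₂ (s≤s (<⇒≤ (toℕ<n k)) ,
                    trans (spine-w (toℕ k) (toℕ<n k)) (cong w (toℕ-injective (toℕ-fromℕ< (toℕ<n k))))))))

  u-below∉u-above : ∀ x → 0 < depth u-below x → depth u-above x ≡ 0
  u-below∉u-above (u i) 0<d = m≤n⇒m∸n≡0 (<⇒≤ (0<m∸n⇒n<m {a₀} {toℕ i} 0<d))

  u-above∉u-below : ∀ x → 0 < depth u-above x → depth u-below x ≡ 0
  u-above∉u-below (u i) 0<d = m≤n⇒m∸n≡0 (<⇒≤ (0<m∸n⇒n<m {toℕ i} {a₀} 0<d))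

  v-below∉v-above : ∀ x → 0 < depth v-below x → depth v-above x ≡ 0
  v-below∉v-above (v j) 0<d = m≤n⇒m∸n≡0 (<⇒≤ (0<m∸n⇒n<m {b₀} {toℕ j} 0<d))

  v-above∉v-below : ∀ x → 0 < depth v-above x → depth v-below x ≡ 0
  v-above∉v-below (v j) 0<d = m≤n⇒m∸n≡0 (<⇒≤ (0<m∸n⇒n<m {toℕ j} {b₀} 0<d))

  u-disjoint : ∀ x → depth u-below x ≡ 0 ⊎ depth u-above x ≡ 0
  u-disjoint (u i) with ≤-total (toℕ i) a₀
  ... | inj₁ i≤a₀ = inj₂ (m≤n⇒m∸n≡0 i≤a₀)
  ... | inj₂ a₀≤i = inj₁ (m≤n⇒m∸n≡0 a₀≤i)
  u-disjoint (v _) = inj₁ refl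
  u-disjoint (w _) = inj₁ refl

  v-disjoint : ∀ x → depth v-below x ≡ 0 ⊎ depth v-above x ≡ 0
  v-disjoint (v j) with ≤-total (toℕ j) b₀
  ... | inj₁ j≤b₀ = inj₂ (m≤n⇒m∸n≡0 j≤b₀)
  ... | inj₂ b₀≤j = inj₁ (m≤n⇒m∸n≡0 b₀≤j)
  v-disjoint (u _) = inj₁ refl
  v-disjoint (w _) = inj₁ refl

  ua-neighbours : ∀ {x} → Adj ua x → depth u-below x ≡ 1 ⊎ depth u-above x ≡ 1 ⊎ x ≡ spine-vertex 1
  ua-neighbours (inj₁ (uu {j = j} eq)) = inj₂ (inj₁ (trans (cong (_∸ a₀) (trans eq (cong suc toℕ-a₀))) (m+n∸n≡m 1 a₀)))
  ua-neighbours (inj₂ (uu {i = i} eq)) = inj₁ (trans (cong (_∸ toℕ i) (trans (sym toℕ-a₀) eq)) (m+n∸n≡m 1 (toℕ i)))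
  ua-neighbours (inj₁ (uw {k = k} _ k≡0)) =
    inj₂ (inj₂ (sym (trans (spine-w 0 (subst (_< r′) k≡0 (toℕ<n k))) (cong w (toℕ-injective (trans (toℕ-fromℕ< _) (sym k≡0)))))))
  ua-neighbours (inj₁ (uv r≡1 _ q)) = inj₂ (inj₂ (trans (v≡vb (suc-injective q)) (sym (spine-end 0 (≤-reflexive (suc-injective r≡1))))))

  vb-neighbours : ∀ {x} → Adj vb x → depth v-below x ≡ 1 ⊎ depth v-above x ≡ 1 ⊎ x ≡ spine-vertex r′
  vb-neighbours (inj₁ (vv {j = j} eq)) = inj₂ (inj₁ (trans (cong (_∸ b₀) (trans eq (cong suc toℕ-b₀))) (m+n∸n≡m 1 b₀)))
  vb-neighbours (inj₂ (vv {i = i} eq)) = inj₁ (trans (cong (_∸ toℕ i) (trans (sym toℕ-b₀) eq)) (m+n∸n≡m 1 (toℕ i)))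
  vb-neighbours (inj₂ (wv {k = k} p _)) =
    inj₂ (inj₂ (sym (trans (cong spine-vertex (sym (w-index p))) (trans (spine-w (toℕ k) (toℕ<n k)) (cong w (toℕ-injective (toℕ-fromℕ< _)))))))
  vb-neighbours (inj₂ (uv r≡1 p _)) = inj₂ (inj₂ (trans (u≡ua (suc-injective p)) (cong spine-vertex (sym (suc-injective r≡1)))))

  h-shape : HShapes.HShape Adj Adj-sym
  h-shape = record
    { z = ua ; z₂ = vb ; r = suc r′
    ; B₁ = u-below ; B₂ = u-above ; C₁ = v-below ; C₂ = v-above
    ; 0<N-B₁ = 0<a₀ ; 0<N-B₂ = m<n⇒0<n∸m a₀<s′ ; 0<N-C₁ = 0<b₀ ; 0<N-C₂ = m<n⇒0<n∸m b₀<t′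
    ; ω = spine-vertex 1 ; ω₂ = spine-vertex r′ ; z-neighbours = ua-neighbours ; z₂-neighbours = vb-neighbours
    ; B-disjoint = u-disjoint ; C-disjoint = v-disjoint
    ; z₂∉B₁ = refl ; z₂∉B₂ = refl ; z∉C₁ = refl ; z∉C₂ = refl
    ; position = spine-position ; position-lipschitz = spine-position-lipschitz ; position-z = refl ; position-z₂ = refl
    ; spine-walk = spine-walk }

  -- Which pendant path at u_a (and at v_b) is put on the line; the other one is tiled.
  data Side : Set where
    below above : Side

  u-line u-tiled : Side → PendantPath ua
  u-line below  = u-below
  u-line above  = u-above
  u-tiled below = u-above
  u-tiled above = u-below

  v-line v-tiled : Side → PendantPath vb
  v-line below  = v-below
  v-line above  = v-above
  v-tiled below = v-above
  v-tiled above = v-below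

  0<u-line : ∀ σ → 0 < N (u-line σ)
  0<u-line below = 0<a₀
  0<u-line above = m<n⇒0<n∸m a₀<s′

  0<u-tiled : ∀ σ → 0 < N (u-tiled σ)
  0<u-tiled below = m<n⇒0<n∸m a₀<s′
  0<u-tiled above = 0<a₀

  0<v-line : ∀ τ → 0 < N (v-line τ)
  0<v-line below = 0<b₀
  0<v-line above = m<n⇒0<n∸m b₀<t′

  0<v-tiled : ∀ τ → 0 < N (v-tiled τ)
  0<v-tiled below = m<n⇒0<n∸m b₀<t′
  0<v-tiled above = 0<b₀

  open Decompositions Adj Adj-sym using (HDecomposition)

  position-u-line : ∀ σ x → 0 < depth (u-line σ) x → spine-position x ≡ 0
  position-u-line below (u _) _ = refl
  position-u-line above (u _) _ = refl

  position-u-tiled : ∀ σ x → 0 < depth (u-tiled σ) x → spine-position x ≡ 0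
  position-u-tiled below (u _) _ = refl
  position-u-tiled above (u _) _ = refl

  position-v-line : ∀ τ x → 0 < depth (v-line τ) x → spine-position x ≡ suc r′
  position-v-line below (v _) _ = refl
  position-v-line above (v _) _ = refl

  position-v-tiled : ∀ τ x → 0 < depth (v-tiled τ) x → spine-position x ≡ suc r′
  position-v-tiled below (v _) _ = refl
  position-v-tiled above (v _) _ = refl

  line∉tiledᵤ : ∀ σ x → 0 < depth (u-line σ) x → depth (u-tiled σ) x ≡ 0
  line∉tiledᵤ below = u-below∉u-above
  line∉tiledᵤ above = u-above∉u-below

  tiled∉lineᵤ : ∀ σ x → 0 < depth (u-tiled σ) x → depth (u-line σ) x ≡ 0
  tiled∉lineᵤ below = u-above∉u-below
  tiled∉lineᵤ above = u-below∉u-above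

  line∉tiledᵥ : ∀ τ x → 0 < depth (v-line τ) x → depth (v-tiled τ) x ≡ 0
  line∉tiledᵥ below = v-below∉v-above
  line∉tiledᵥ above = v-above∉v-below

  tiled∉lineᵥ : ∀ τ x → 0 < depth (v-tiled τ) x → depth (v-line τ) x ≡ 0
  tiled∉lineᵥ below = v-above∉v-below
  tiled∉lineᵥ above = v-below∉v-above

  u-sides : ∀ σ {x} → 0 < depth u-below x ⊎ 0 < depth u-above x → 0 < depth (u-line σ) x ⊎ 0 < depth (u-tiled σ) x
  u-sides below c = c
  u-sides above c = Data.Sum.swap c

  v-sides : ∀ τ {x} → 0 < depth v-below x ⊎ 0 < depth v-above x → 0 < depth (v-line τ) x ⊎ 0 < depth (v-tiled τ) x
  v-sides below c = c
  v-sides above c = Data.Sum.swap c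

  arrange : ∀ σ τ {x} → 0 < depth u-below x ⊎ 0 < depth u-above x ⊎ 0 < depth v-below x ⊎ 0 < depth v-above x ⊎ OnSpine x →
            0 < depth (u-line σ) x ⊎ 0 < depth (u-tiled σ) x ⊎ 0 < depth (v-line τ) x ⊎ 0 < depth (v-tiled τ) x ⊎ OnSpine x
  arrange σ τ (inj₁ p)                      = [ inj₁ , (λ q → inj₂ (inj₁ q)) ]′ (u-sides σ (inj₁ p))
  arrange σ τ (inj₂ (inj₁ p))               = [ inj₁ , (λ q → inj₂ (inj₁ q)) ]′ (u-sides σ (inj₂ p))
  arrange σ τ (inj₂ (inj₂ (inj₁ p)))        = inj₂ (inj₂ ([ inj₁ , (λ q → inj₂ (inj₁ q)) ]′ (v-sides τ (inj₁ p))))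
  arrange σ τ (inj₂ (inj₂ (inj₂ (inj₁ p)))) = inj₂ (inj₂ ([ inj₁ , (λ q → inj₂ (inj₁ q)) ]′ (v-sides τ (inj₂ p))))
  arrange σ τ (inj₂ (inj₂ (inj₂ (inj₂ p)))) = inj₂ (inj₂ (inj₂ (inj₂ p)))

  decompose : Side → Side → HDecomposition
  decompose σ τ = record
    { z = ua ; z₂ = vb ; r = suc r′ ; 0<r = z<s
    ; Bs = u-line σ ; Bo = u-tiled σ ; Cs = v-line τ ; Co = v-tiled τ
    ; 0<N-Bs = 0<u-line σ ; 0<N-Cs = 0<v-line τ
    ; spine = spine-vertex ; spine-0 = refl ; spine-r = spine-z₂ ; spine-adjacent = spine-adjacent
    ; position = spine-position ; position-lipschitz = spine-position-lipschitz ; position-spine = position-spine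
    ; covered = λ x → arrange σ τ (covered x)
    ; position-Bs = position-u-line σ ; position-Bo = position-u-tiled σ
    ; position-Cs = position-v-line τ ; position-Co = position-v-tiled τ
    ; Bs∉Bo = line∉tiledᵤ σ ; Bo∉Bs = tiled∉lineᵤ σ ; Cs∉Co = line∉tiledᵥ τ ; Co∉Cs = tiled∉lineᵥ τ
    ; irreflexive = irreflexive }

  s t r a b : ℕ
  s = suc s′
  t = suc t′
  r = suc r′
  a = suc a₀
  b = suc b₀

  private
    IsUa⇒≡ : ∀ {x} → IsUa s t r a x → x ≡ ua
    IsUa⇒≡ (i , refl , e) = u≡ua (suc-injective e)

    IsVb⇒≡ : ∀ {x} → IsVb s t r b x → x ≡ vb
    IsVb⇒≡ (j , refl , e) = v≡vb (suc-injective e)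

    isUa : ∀ {x} → x ≡ ua → IsUa s t r a x
    isUa x≡ = clamp a₀ , x≡ , cong suc toℕ-a₀

    isVb : ∀ {x} → x ≡ vb → IsVb s t r b x
    isVb x≡ = clamp b₀ , x≡ , cong suc toℕ-b₀

  module HC = HShapeInConfiguration Adj Adj-sym
  open HShapes Adj Adj-sym using (swap-centres)
  open Layouts Adj Adj-sym using (module FromLayout)
  open Decompositions Adj Adj-sym using (module ToLayout)

  parallel-forward : ParallelPath s t r a b →
                     ((suc a₀ ∣ s′ ∸ a₀) ⊎ (suc (s′ ∸ a₀) ∣ a₀)) × ((suc b₀ ∣ t′ ∸ b₀) ⊎ (suc (t′ ∸ b₀) ∣ b₀))
  parallel-forward (C , l , i , i′ , i<i′ , inj₁ (isu , isv) , before , after) =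
    HC.parallel-path h-shape C l i i′ i<i′ (IsUa⇒≡ isu) (IsVb⇒≡ isv) before after
  parallel-forward (C , l , i , i′ , i<i′ , inj₂ (isv , isu) , before , after) =
    Data.Product.swap (HC.parallel-path (swap-centres h-shape) C l i i′ i<i′ (IsVb⇒≡ isv) (IsUa⇒≡ isu) before after)

  parallel-backward : suc a₀ ∣ s′ ∸ a₀ → suc b₀ ∣ t′ ∸ b₀ → ParallelPath s t r a b
  parallel-backward (divides mX eX) (divides mY eY) =
    K.configuration , K.line-path , K.iX , K.iY , subst₂ _<_ (sym K.toℕ-iX) (sym K.toℕ-iY) (m<m+n a₀ z<s) ,
    inj₁ (isUa K.zX-on-line , isVb K.zY-on-line) , K.zX-before , K.zY-after
    where
      module D = ToLayout (decompose below below)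
      N-Co : t′ ∸ b₀ ≡ mY * suc (D.M ∸ (a₀ + r))
      N-Co = trans eY (cong (λ c → mY * suc c) (sym (m+n∸m≡n (a₀ + r) b₀)))
      module K = FromLayout (D.parallel-layout mX mY (quotient-pos (m<n⇒0<n∸m a₀<s′) eX) (quotient-pos (m<n⇒0<n∸m b₀<t′) eY) eX N-Co)

  a-label : Side → ℕ
  a-label σ = suc (N (u-line σ))

  b-label : Side → ℕ
  b-label τ = suc (N (v-line τ))

  a-label-cases : ∀ σ → a-label σ ≡ a ⊎ a-label σ ≡ suc s ∸ a
  a-label-cases below = inj₁ refl
  a-label-cases above = inj₂ (sym (+-∸-assoc 1 (<⇒≤ a₀<s′)))

  b-label-cases : ∀ τ → b-label τ ≡ b ⊎ b-label τ ≡ suc t ∸ b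
  b-label-cases below = inj₁ refl
  b-label-cases above = inj₂ (sym (+-∸-assoc 1 (<⇒≤ b₀<t′)))

  a-label-of : ∀ {a′} → a′ ≡ a ⊎ a′ ≡ suc s ∸ a → Σ Side λ σ → a′ ≡ a-label σ
  a-label-of (inj₁ refl) = below , refl
  a-label-of (inj₂ e)    = above , trans e (+-∸-assoc 1 (<⇒≤ a₀<s′))

  b-label-of : ∀ {b′} → b′ ≡ b ⊎ b′ ≡ suc t ∸ b → Σ Side λ τ → b′ ≡ b-label τ
  b-label-of (inj₁ refl) = below , refl
  b-label-of (inj₂ e)    = above , trans e (+-∸-assoc 1 (<⇒≤ b₀<t′))

  s∸a-label : ∀ σ → s ∸ a-label σ ≡ N (u-tiled σ)
  s∸a-label below = refl
  s∸a-label above = m∸[m∸n]≡n (<⇒≤ a₀<s′)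

  t∸b-label : ∀ τ → t ∸ b-label τ ≡ N (v-tiled τ)
  t∸b-label below = refl
  t∸b-label above = m∸[m∸n]≡n (<⇒≤ b₀<t′)

  u-side-of : ∀ {p q} → Arrangement a₀ (s′ ∸ a₀) p q → Σ Side λ σ → p ≡ N (u-line σ) × q ≡ N (u-tiled σ)
  u-side-of (inj₁ (refl , refl)) = below , refl , refl
  u-side-of (inj₂ (refl , refl)) = above , refl , refl

  v-side-of : ∀ {p q} → Arrangement b₀ (t′ ∸ b₀) p q → Σ Side λ τ → p ≡ N (v-line τ) × q ≡ N (v-tiled τ)
  v-side-of (inj₁ (refl , refl)) = below , refl , refl
  v-side-of (inj₂ (refl , refl)) = above , refl , refl

  crossed-backward : ∀ σ τ → a-label σ + r ∣ N (v-tiled τ) → b-label τ + r ∣ N (u-tiled σ) → CrossedPath s t r a b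
  crossed-backward σ τ (divides mX eX) (divides mY eY) =
    K.configuration , K.line-path , K.iY , K.iX , subst₂ _<_ (sym K.toℕ-iY) (sym K.toℕ-iX) (m<m+n (N (u-line σ)) z<s) ,
    inj₁ (isUa K.zY-on-line , isVb K.zX-on-line) , K.zY-after , K.zX-before
    where
      module D = ToLayout (decompose σ τ)
      N-Bo : N (u-tiled σ) ≡ mY * suc (D.M ∸ N (u-line σ))
      N-Bo = trans eY (cong (λ c → mY * suc c) (trans (+-comm (N (v-line τ)) r)
               (sym (trans (cong (_∸ N (u-line σ)) (+-assoc (N (u-line σ)) r (N (v-line τ)))) (m+n∸m≡n (N (u-line σ)) (r + N (v-line τ)))))))
      module K = FromLayout (D.crossed-layout mX mY (quotient-pos (0<v-tiled τ) eX) (quotient-pos (0<u-tiled σ) eY) eX N-Bo)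

  CrossedCondition : Set
  CrossedCondition = Σ ℕ λ a′ → Σ ℕ λ b′ → (a′ ≡ a ⊎ a′ ≡ suc s ∸ a) × (b′ ≡ b ⊎ b′ ≡ suc t ∸ b) ×
                     (a′ + r) ∣ (t ∸ b′) × (b′ + r) ∣ (s ∸ a′) × a′ + r ≤ t ∸ b′ × b′ + r ≤ s ∸ a′

  crossed-condition : ∀ σ τ → a-label σ + r ∣ N (v-tiled τ) → b-label τ + r ∣ N (u-tiled σ) → CrossedCondition
  crossed-condition σ τ d₁ d₂ =
    a-label σ , b-label τ , a-label-cases σ , b-label-cases τ , d₁′ , d₂′ ,
    ∣⇒≤ {{>-nonZero (subst (0 <_) (sym (t∸b-label τ)) (0<v-tiled τ))}} d₁′ ,
    ∣⇒≤ {{>-nonZero (subst (0 <_) (sym (s∸a-label σ)) (0<u-tiled σ))}} d₂′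
    where
      d₁′ = subst (a-label σ + r ∣_) (sym (t∸b-label τ)) d₁
      d₂′ = subst (b-label τ + r ∣_) (sym (s∸a-label σ)) d₂

  CrossingData : Set
  CrossingData = Σ ℕ λ nBs → Σ ℕ λ nBo → Σ ℕ λ nCs → Σ ℕ λ nCo →
                  Arrangement a₀ (s′ ∸ a₀) nBs nBo × Arrangement b₀ (t′ ∸ b₀) nCs nCo × (suc nBs + r ∣ nCo) × (suc nCs + r ∣ nBo)

  from-crossing-data : CrossingData → CrossedCondition
  from-crossing-data (_ , _ , _ , _ , arrB , arrC , d₁ , d₂) with u-side-of arrB | v-side-of arrC
  ... | σ , refl , refl | τ , refl , refl = crossed-condition σ τ d₁ d₂

  crossed-forward : CrossedPath s t r a b → CrossedCondition
  crossed-forward (C , l , i , i′ , i<i′ , inj₁ (isu , isv) , after , before) =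
    from-crossing-data (HC.crossed-path h-shape C l i i′ i<i′ (IsUa⇒≡ isu) (IsVb⇒≡ isv) after before)
  crossed-forward (C , l , i , i′ , i<i′ , inj₂ (isv , isu) , after , before) =
    from-crossing-data (swap-roles (HC.crossed-path (swap-centres h-shape) C l i i′ i<i′ (IsVb⇒≡ isv) (IsUa⇒≡ isu) after before))
    where
      swap-roles : (Σ ℕ λ nCs → Σ ℕ λ nCo → Σ ℕ λ nBs → Σ ℕ λ nBo →
                    Arrangement b₀ (t′ ∸ b₀) nCs nCo × Arrangement a₀ (s′ ∸ a₀) nBs nBo × (suc nCs + r ∣ nBo) × (suc nBs + r ∣ nCo)) →
                   CrossingData
      swap-roles (nCs , nCo , nBs , nBo , arrC , arrB , d₂ , d₁) = nBs , nBo , nCs , nCo , arrB , arrC , d₁ , d₂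

  crossed-from-condition : CrossedCondition → CrossedPath s t r a b
  crossed-from-condition (_ , _ , la , lb , d₁ , d₂ , _) with a-label-of la | b-label-of lb
  ... | σ , refl | τ , refl = crossed-backward σ τ (subst (a-label σ + r ∣_) (t∸b-label τ) d₁) (subst (b-label τ + r ∣_) (s∸a-label σ) d₂)

proposition1 : (s t r a b : ℕ) → 1 ≤ r → 1 < a → a < s → 1 < b → b < t →
    -- (i) under the normalisation a ≤ s - a, b ≤ t - b
    (a ≤ s ∸ a → b ≤ t ∸ b → (ParallelPath s t r a b ⇔ (a ∣ s × b ∣ t)))
    ×
    -- (ii) for some labelling (a', b') of T (a' ∈ {a, s+1-a} mirrors the u-path,
    --      b' ∈ {b, t+1-b} mirrors the v-path)
    (CrossedPath s t r a b ⇔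
      (Σ ℕ λ a' → Σ ℕ λ b' → (a' ≡ a ⊎ a' ≡ suc s ∸ a) × (b' ≡ b ⊎ b' ≡ suc t ∸ b) ×
        (a' + r) ∣ (t ∸ b') × (b' + r) ∣ (s ∸ a') ×
        a' + r ≤ t ∸ b' × b' + r ≤ s ∸ a'))
proposition1 (suc s′) (suc t′) (suc r′) (suc a₀) (suc b₀) (s≤s z≤n) (s≤s 0<a₀) (s≤s a₀<s′) (s≤s 0<b₀) (s≤s b₀<t′) =
  (λ a≤ b≤ → mk⇔ (λ p → Data.Product.map (side-divides 0<a₀ (<⇒≤ a₀<s′) a≤) (side-divides 0<b₀ (<⇒≤ b₀<t′) b≤) (parallel-forward p))
                 (λ { (a∣s , b∣t) → parallel-backward (∣⇒∣∸ (s≤s (<⇒≤ a₀<s′)) a∣s) (∣⇒∣∸ (s≤s (<⇒≤ b₀<t′)) b∣t) })) ,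
  mk⇔ crossed-forward crossed-from-condition
  where open HTree s′ t′ r′ a₀ b₀ 0<a₀ a₀<s′ 0<b₀ b₀<t′
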